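{- Let $q$ be an odd prime power and let $Q\in\mathbb{F}_q[x,y,z]$ be a ternary quadratic form. Then $Q$ is nice if and only if all of the following hold: (i) $Q$ is non-diagonal (i.e. at least one of the monomials $yz,xz,xy$ has non-zero coefficient in $Q$); (ii) each of the variables $x,y,z$ appears in some monomial having non-zero coefficient in $Q$; (iii) $Q$ is not a square in $\overline{\mathbb{F}_q}[x,y,z]$.
   Context: A polynomial $P\in\mathbb{F}[x_1,\ldots,x_n]$ of degree $d$, with $n\ge 2$, is called nice if, after some permutation of the variables $x_1,\ldots,x_n$, writing $$P(x_1,\ldots,x_n)=ax_n^d+\sum_{k=1}^d P_k(x_1,\ldots,x_{n-1})x_n^{d-k}$$ with $a\in\mathbb{F}$ and each $P_k$ a polynomial of degree at most $k$, the polynomials $P_1,\ldots,P_d$ are algebraically independent. -}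

module Defs where

open import Level using (Level; _⊔_) renaming (suc to lsuc)
open import Algebra.Bundles using (CommutativeRing)
open import Algebra.Morphism.Structures using (module RingMorphisms)
open import Data.Nat as ℕ using (ℕ; zero; suc; _<_; _∸_; _^_)
open import Data.Nat.Divisibility using (_∣_)
open import Data.Nat.Primality using (Prime)
open import Data.Fin as Fin using (Fin; toℕ)
open import Data.Fin.Permutation using (Permutation′; _⟨$⟩ʳ_)
open import Data.Vec as Vec using (Vec; []; _∷_; lookup; tabulate; replicate; _∷ʳ_; zipWith)
open import Data.Vec.Properties using (≡-dec)
open import Data.List as List using (List; []; _∷_; [_]; _++_; concatMap)
open import Data.Product using (Σ; _×_; _,_; ∃)
open import Data.Sum using (_⊎_)
open import Data.Bool using (if_then_else_)
open import Relation.Nullary using (¬_)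
open import Relation.Nullary.Decidable using (⌊_⌋)
open import Relation.Binary.PropositionalEquality using (_≡_; _≢_)

record Field (c ℓ : Level) : Set (lsuc (c ⊔ ℓ)) where
  field
    commutativeRing : CommutativeRing c ℓ
  open CommutativeRing commutativeRing public
  field
    0≉1     : ¬ (0# ≈ 1#)
    inverse : ∀ x → ¬ (x ≈ 0#) → Σ Carrier λ y → (x * y) ≈ 1#

OddPrimePower : ℕ → Set
OddPrimePower q = Σ ℕ λ p → Σ ℕ λ k → Prime p × (q ≡ p ^ suc k) × ¬ (2 ∣ q)

module _ {c ℓ : Level} (F : Field c ℓ) where
  open Field F

  HasOrder : ℕ → Set (c ⊔ ℓ)
  HasOrder q = Σ (Fin q → Carrier) λ f →
    (∀ x → Σ (Fin q) λ i → f i ≈ x) × (∀ i j → f i ≈ f j → i ≡ j)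

  -- Polynomials in n variables over F: finite lists of terms
  -- (coefficient, exponent vector); equality is coefficientwise.

  Poly : ℕ → Set c
  Poly n = List (Carrier × Vec ℕ n)

  coeff : ∀ {n} → Poly n → Vec ℕ n → Carrier
  coeff [] e = 0#
  coeff ((a , f) ∷ p) e =
    if ⌊ ≡-dec ℕ._≟_ f e ⌋ then a + coeff p e else coeff p e

  _≈P_ : ∀ {n} → Poly n → Poly n → Set ℓ
  P ≈P R = ∀ e → coeff P e ≈ coeff R e

  IsZero : ∀ {n} → Poly n → Set ℓ
  IsZero P = ∀ e → coeff P e ≈ 0#

  constP : ∀ {n} → Carrier → Poly n
  constP a = [ (a , replicate _ 0) ]

  0P 1P : ∀ {n} → Poly n
  0P = []
  1P = constP 1#

  infixl 6 _+P_
  infixl 7 _*P_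
  infix 4 _≈P_
  infixr 8 _^P_

  _+P_ : ∀ {n} → Poly n → Poly n → Poly n
  _+P_ = _++_

  _*P_ : ∀ {n} → Poly n → Poly n → Poly n
  P *P R = concatMap (λ { (a , e) → List.map (λ { (b , f) → (a * b , zipWith ℕ._+_ e f) }) R }) P

  _^P_ : ∀ {n} → Poly n → ℕ → Poly n
  P ^P zero  = 1P
  P ^P suc k = P *P (P ^P k)

  sumP : ∀ {n} → List (Poly n) → Poly n
  sumP = List.foldr _+P_ 0P

  prodP : ∀ {n k} → Vec (Poly n) k → Poly n
  prodP = Vec.foldr _ _*P_ 1P

  totalDeg : ∀ {n} → Vec ℕ n → ℕ
  totalDeg = Vec.sum

  HasDegree : ∀ {n} → Poly n → ℕ → Set ℓ
  HasDegree P d = (Σ (Vec ℕ _) λ e → totalDeg e ≡ d × ¬ (coeff P e ≈ 0#))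
                × (∀ e → d < totalDeg e → coeff P e ≈ 0#)

  DegreeAtMost : ∀ {n} → Poly n → ℕ → Set ℓ
  DegreeAtMost P k = ∀ e → k < totalDeg e → coeff P e ≈ 0#

  substP : ∀ {k n} → Poly k → (Fin k → Poly n) → Poly n
  substP G Ps = sumP (List.map (λ { (a , e) →
    constP a *P prodP (tabulate (λ i → Ps i ^P lookup e i)) }) G)

  evalP : ∀ {n} → Poly n → (Fin n → Carrier) → Carrier
  evalP P v = List.foldr _+_ 0# (List.map (λ { (a , e) →
    a * Vec.foldr _ _*_ 1# (tabulate (λ i → pow (v i) (lookup e i))) }) P)
    where
    pow : Carrier → ℕ → Carrier
    pow x zero    = 1#
    pow x (suc k) = x * pow x k

  AlgebraicallyIndependent : ∀ {k n} → (Fin k → Poly n) → Set (c ⊔ ℓ)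
  AlgebraicallyIndependent {k} Ps = ∀ (G : Poly k) → IsZero (substP G Ps) → IsZero G

  rename : ∀ {n} → Permutation′ n → Poly n → Poly n
  rename σ = List.map (λ { (a , e) → (a , tabulate (λ i → lookup e (σ ⟨$⟩ʳ i))) })

  liftP : ∀ {m} → Poly m → Poly (suc m)
  liftP = List.map (λ { (a , e) → (a , e ∷ʳ 0) })

  lastVar^ : ∀ {m} → ℕ → Poly (suc m)
  lastVar^ j = [ (1# , replicate _ 0 ∷ʳ j) ]

  -- Nice polynomials (n = m + 2 ≥ 2 variables).  P_k is (Ps k') with
  -- k = toℕ k' + 1.
  Nice : ∀ {m} → Poly (suc (suc m)) → Set (c ⊔ ℓ)
  Nice {m} P = Σ ℕ λ d → HasDegree P d ×
    Σ (Permutation′ (suc (suc m))) λ σ → Σ Carrier λ a →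
    Σ (Fin d → Poly (suc m)) λ Ps →
      (∀ k → DegreeAtMost (Ps k) (suc (toℕ k)))
    × (rename σ P ≈P (constP a *P lastVar^ d
         +P sumP (List.tabulate (λ k → liftP (Ps k) *P lastVar^ (d ∸ suc (toℕ k))))))
    × AlgebraicallyIndependent Ps

  -- Ternary quadratic forms: polynomials in x,y,z (variables 0,1,2)
  -- all of whose monomials with nonzero coefficient have degree 2.

  IsQuadraticForm : Poly 3 → Set ℓ
  IsQuadraticForm Q = ∀ e → totalDeg e ≢ 2 → coeff Q e ≈ 0#

  NonDiagonal : Poly 3 → Set ℓ
  NonDiagonal Q = ¬ (coeff Q (0 ∷ 1 ∷ 1 ∷ []) ≈ 0#)
                ⊎ ¬ (coeff Q (1 ∷ 0 ∷ 1 ∷ []) ≈ 0#)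
                ⊎ ¬ (coeff Q (1 ∷ 1 ∷ 0 ∷ []) ≈ 0#)

  AllVariablesAppear : ∀ {n} → Poly n → Set ℓ
  AllVariablesAppear P = ∀ i → Σ (Vec ℕ _) λ e → ¬ (coeff P e ≈ 0#) × lookup e i ≢ 0

  IsSquare : ∀ {n} → Poly n → Set (c ⊔ ℓ)
  IsSquare P = Σ (Poly _) λ S → P ≈P (S *P S)

module _ {c ℓ c′ ℓ′ : Level} (F : Field c ℓ) (K : Field c′ ℓ′) where
  private
    module F = Field F
    module K = Field K

  mapPoly : ∀ {n} → (F.Carrier → K.Carrier) → Poly F n → Poly K n
  mapPoly φ = List.map (λ { (a , e) → (φ a , e) })

  record IsAlgebraicClosure (φ : F.Carrier → K.Carrier) : Set (c ⊔ ℓ ⊔ c′ ⊔ ℓ′) where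
    field
      isRingHom : RingMorphisms.IsRingHomomorphism F.rawRing K.rawRing φ
      algClosed : ∀ (f : Poly K 1) → ¬ DegreeAtMost K f 0 →
                  Σ K.Carrier λ x → evalP K f (λ _ → x) K.≈ K.0#
      algebraic : ∀ (x : K.Carrier) → Σ (Poly F 1) λ f →
                  ¬ IsZero F f × (evalP K (mapPoly φ f) (λ _ → x) K.≈ K.0#)

-- Moving a chosen variable z to the last place, Q = c z² + L z + R with
-- L linear and R quadratic in the other two variables, and this is the
-- only decomposition of the shape required by niceness; so Q is nice iff
-- for some choice of z the pair (L, R) is algebraically independent.
-- Such a pair is dependent iff L = 0 or R = λ L²: otherwise a shear
-- x ↦ x + t y turns L into α x while R keeps a term in y, and then the
-- leading terms of the products Lⁱ Rʲ are pairwise distinct.  If all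
-- three choices of z give dependent pairs, non-diagonality and the
-- presence of every variable rule out L = 0, and the relations
-- R = λ L² say that all 2×2 minors of the matrix of Q vanish.  In odd
-- characteristic a form of rank one is a square over the algebraic
-- closure, and conversely a square has rank one, which forces L = 0 or
-- R = λ L² for every choice of z.  Finiteness of F gives decidable
-- equality and odd order gives 2 ≠ 0.

module Submission where

open import Defs
open import Data.Nat using (ℕ)
open import Data.Product using (_×_)
open import Relation.Nullary using (¬_)
open import Function.Bundles using (_⇔_)
open import Level using (Level)
open import Relation.Binary using (Decidable)

module Exponents where

  open import Data.Nat as ℕ using (ℕ; _+_; _∸_)
  open import Data.Nat.Properties as ℕ using ()
  open import Data.Fin as Fin using (Fin)
  open import Data.Fin.Permutation as Perm using (Permutation′; _⟨$⟩ʳ_; _⟨$⟩ˡ_)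
  open import Data.Product using (∃; _,_)
  open import Data.Vec as Vec using (Vec; []; _∷_; zipWith; replicate; lookup; tabulate; _∷ʳ_)
  open import Data.Vec.Properties as Vecₚ using (≡-dec)
  open import Function using (_∘_)
  open import Relation.Nullary using (Dec; yes; no)
  open import Relation.Binary.PropositionalEquality
  open import Algebra.Properties.CommutativeMonoid.Sum ℕ.+-0-commutativeMonoid as Σℕ using ()

  Exponent : ℕ → Set
  Exponent = Vec ℕ

  infix 4 _≟ₑ_ _∣ₑ_
  infixl 6 _+ₑ_

  _≟ₑ_ : ∀ {n} (f g : Exponent n) → Dec (f ≡ g)
  _≟ₑ_ = ≡-dec ℕ._≟_

  _+ₑ_ : ∀ {n} → Exponent n → Exponent n → Exponent n
  _+ₑ_ = zipWith _+_

  0ₑ : ∀ {n} → Exponent n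
  0ₑ = replicate _ 0

  +ₑ-comm : ∀ {n} (f g : Exponent n) → f +ₑ g ≡ g +ₑ f
  +ₑ-comm = Vecₚ.zipWith-comm ℕ.+-comm

  +ₑ-assoc : ∀ {n} (f g h : Exponent n) → (f +ₑ g) +ₑ h ≡ f +ₑ (g +ₑ h)
  +ₑ-assoc = Vecₚ.zipWith-assoc ℕ.+-assoc

  +ₑ-identityˡ : ∀ {n} (f : Exponent n) → 0ₑ +ₑ f ≡ f
  +ₑ-identityˡ = Vecₚ.zipWith-identityˡ ℕ.+-identityˡ

  +ₑ-identityʳ : ∀ {n} (f : Exponent n) → f +ₑ 0ₑ ≡ f
  +ₑ-identityʳ = Vecₚ.zipWith-identityʳ ℕ.+-identityʳ

  +ₑ-cancelˡ : ∀ {n} (f g h : Exponent n) → f +ₑ g ≡ f +ₑ h → g ≡ h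
  +ₑ-cancelˡ [] [] [] _ = refl
  +ₑ-cancelˡ (x ∷ f) (y ∷ g) (z ∷ h) eq with Vecₚ.∷-injective eq
  ... | x+y≡x+z , rest = cong₂ _∷_ (ℕ.+-cancelˡ-≡ x y z x+y≡x+z) (+ₑ-cancelˡ f g h rest)

  lookup-+ₑ : ∀ {n} (f g : Exponent n) i → lookup (f +ₑ g) i ≡ lookup f i + lookup g i
  lookup-+ₑ f g i = Vecₚ.lookup-zipWith _+_ i f g

  sum-+ₑ : ∀ {n} (f g : Exponent n) → Vec.sum (f +ₑ g) ≡ Vec.sum f + Vec.sum g
  sum-+ₑ [] [] = refl
  sum-+ₑ (x ∷ f) (y ∷ g) =
    trans (cong (x + y +_) (sum-+ₑ f g)) (interchange x y (Vec.sum f) (Vec.sum g))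
    where open import Algebra.Properties.CommutativeSemigroup ℕ.+-commutativeSemigroup using (interchange)

  ∷ʳ-+ₑ : ∀ {n} (f g : Exponent n) x y → (f ∷ʳ x) +ₑ (g ∷ʳ y) ≡ (f +ₑ g) ∷ʳ (x + y)
  ∷ʳ-+ₑ [] [] x y = refl
  ∷ʳ-+ₑ (u ∷ f) (v ∷ g) x y = cong (u + v ∷_) (∷ʳ-+ₑ f g x y)

  sum-∷ʳ : ∀ {n} (f : Exponent n) x → Vec.sum (f ∷ʳ x) ≡ Vec.sum f + x
  sum-∷ʳ [] x = ℕ.+-identityʳ x
  sum-∷ʳ (y ∷ f) x = trans (cong (y +_) (sum-∷ʳ f x)) (sym (ℕ.+-assoc y _ x))

  _∣ₑ_ : ∀ {n} → Exponent n → Exponent n → Set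
  f ∣ₑ e = ∃ λ g → f +ₑ g ≡ e

  +ₑ-∸ₑ : ∀ {n} (f g e : Exponent n) → f +ₑ g ≡ e → zipWith _∸_ e f ≡ g
  +ₑ-∸ₑ [] [] [] _ = refl
  +ₑ-∸ₑ (x ∷ f) (y ∷ g) (z ∷ e) eq with Vecₚ.∷-injective eq
  ... | refl , rest = cong₂ _∷_ (ℕ.m+n∸m≡n x y) (+ₑ-∸ₑ f g e rest)

  _∣ₑ?_ : ∀ {n} (f e : Exponent n) → Dec (f ∣ₑ e)
  f ∣ₑ? e with f +ₑ zipWith _∸_ e f ≟ₑ e
  ... | yes p = yes (_ , p)
  ... | no ¬p = no λ { (g , p) → ¬p (subst (λ h → f +ₑ h ≡ e) (sym (+ₑ-∸ₑ f g e p)) p) }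

  permuteₑ : ∀ {n} → Permutation′ n → Exponent n → Exponent n
  permuteₑ σ e = tabulate (λ i → lookup e (σ ⟨$⟩ʳ i))

  unpermuteₑ : ∀ {n} → Permutation′ n → Exponent n → Exponent n
  unpermuteₑ σ e = tabulate (λ j → lookup e (σ ⟨$⟩ˡ j))

  lookup-unpermuteₑ : ∀ {n} (σ : Permutation′ n) e i → lookup (unpermuteₑ σ e) i ≡ lookup e (σ ⟨$⟩ˡ i)
  lookup-unpermuteₑ σ e = Vecₚ.lookup∘tabulate _

  vec-ext : ∀ {n} (u v : Exponent n) → (∀ i → lookup u i ≡ lookup v i) → u ≡ v
  vec-ext u v p = trans (sym (Vecₚ.tabulate∘lookup u)) (trans (Vecₚ.tabulate-cong p) (Vecₚ.tabulate∘lookup v))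

  permuteₑ⇒unpermuteₑ : ∀ {n} (σ : Permutation′ n) f e → permuteₑ σ f ≡ e → f ≡ unpermuteₑ σ e
  permuteₑ⇒unpermuteₑ σ f e refl = vec-ext _ _ λ j → begin
    lookup f j                                    ≡⟨ cong (lookup f) (Perm.inverseʳ σ) ⟨
    lookup f (σ ⟨$⟩ʳ (σ ⟨$⟩ˡ j))                  ≡⟨ Vecₚ.lookup∘tabulate _ (σ ⟨$⟩ˡ j) ⟨
    lookup (permuteₑ σ f) (σ ⟨$⟩ˡ j)              ≡⟨ lookup-unpermuteₑ σ (permuteₑ σ f) j ⟨
    lookup (unpermuteₑ σ (permuteₑ σ f)) j        ∎
    where open ≡-Reasoning

  unpermuteₑ⇒permuteₑ : ∀ {n} (σ : Permutation′ n) f e → f ≡ unpermuteₑ σ e → permuteₑ σ f ≡ e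
  unpermuteₑ⇒permuteₑ σ f e refl = vec-ext _ _ λ i → begin
    lookup (permuteₑ σ (unpermuteₑ σ e)) i  ≡⟨ Vecₚ.lookup∘tabulate _ i ⟩
    lookup (unpermuteₑ σ e) (σ ⟨$⟩ʳ i)      ≡⟨ lookup-unpermuteₑ σ e _ ⟩
    lookup e (σ ⟨$⟩ˡ (σ ⟨$⟩ʳ i))            ≡⟨ cong (lookup e) (Perm.inverseˡ σ) ⟩
    lookup e i                              ∎
    where open ≡-Reasoning

  unpermuteₑ-flip : ∀ {n} (σ : Permutation′ n) e → unpermuteₑ σ (unpermuteₑ (Perm.flip σ) e) ≡ e
  unpermuteₑ-flip σ e = vec-ext _ e λ j → begin
    lookup (unpermuteₑ σ (unpermuteₑ (Perm.flip σ) e)) j  ≡⟨ lookup-unpermuteₑ σ (unpermuteₑ (Perm.flip σ) e) j ⟩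
    lookup (unpermuteₑ (Perm.flip σ) e) (σ ⟨$⟩ˡ j)        ≡⟨ lookup-unpermuteₑ (Perm.flip σ) e _ ⟩
    lookup e (σ ⟨$⟩ʳ (σ ⟨$⟩ˡ j))                          ≡⟨ cong (lookup e) (Perm.inverseʳ σ) ⟩
    lookup e j                                            ∎
    where open ≡-Reasoning

  permuteₑ-+ₑ : ∀ {n} (σ : Permutation′ n) f g → permuteₑ σ (f +ₑ g) ≡ permuteₑ σ f +ₑ permuteₑ σ g
  permuteₑ-+ₑ σ f g = vec-ext _ _ λ i → begin
    lookup (permuteₑ σ (f +ₑ g)) i                           ≡⟨ Vecₚ.lookup∘tabulate _ i ⟩
    lookup (f +ₑ g) (σ ⟨$⟩ʳ i)                               ≡⟨ lookup-+ₑ f g _ ⟩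
    lookup f (σ ⟨$⟩ʳ i) + lookup g (σ ⟨$⟩ʳ i)                ≡⟨ cong₂ _+_ (Vecₚ.lookup∘tabulate _ i) (Vecₚ.lookup∘tabulate _ i) ⟨
    lookup (permuteₑ σ f) i + lookup (permuteₑ σ g) i        ≡⟨ lookup-+ₑ (permuteₑ σ f) (permuteₑ σ g) i ⟨
    lookup (permuteₑ σ f +ₑ permuteₑ σ g) i                  ∎
    where open ≡-Reasoning

  sum-tabulate : ∀ {n} (h : Fin n → ℕ) → Vec.sum (tabulate h) ≡ Σℕ.sum h
  sum-tabulate {ℕ.zero} h = refl
  sum-tabulate {ℕ.suc n} h = cong (h Fin.zero +_) (sum-tabulate (h ∘ Fin.suc))

  sum-unpermuteₑ : ∀ {n} (σ : Permutation′ n) e → Vec.sum (unpermuteₑ σ e) ≡ Vec.sum e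
  sum-unpermuteₑ σ e = begin
    Vec.sum (unpermuteₑ σ e)                     ≡⟨ sum-tabulate (λ j → lookup e (σ ⟨$⟩ˡ j)) ⟩
    Σℕ.sum (λ j → lookup e (σ ⟨$⟩ˡ j))           ≡⟨ Σℕ.sum-permute (lookup e) (Perm.flip σ) ⟨
    Σℕ.sum (lookup e)                            ≡⟨ sum-tabulate (lookup e) ⟨
    Vec.sum (tabulate (lookup e))                ≡⟨ cong Vec.sum (Vecₚ.tabulate∘lookup e) ⟩
    Vec.sum e                                    ∎
    where open ≡-Reasoning

module Parity where

  open import Data.Nat as ℕ using (ℕ; zero; suc; _+_; _*_)
  open import Data.Nat.Properties as ℕ using ()
  open import Data.Nat.Divisibility using (_∣_; divides)
  open import Data.Fin as Fin using (Fin)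
  open import Data.Fin.Properties as Fin using ()
  open import Data.Fin.Permutation as Perm using (Permutation′)
  open import Relation.Binary using (tri<; tri≈; tri>)
  open import Relation.Binary.PropositionalEquality as ≡ using (_≡_; _≢_)
  open import Algebra.Properties.CommutativeMonoid.Sum ℕ.+-0-commutativeMonoid using (sum; sum-cong-≗; sum-permute; ∑-distrib-+)
  open import Data.Empty using (⊥-elim)
  open import Function using (_∘_)

  -- Pairing i with τ i, exactly one of the two counts 1 in ∑ᵢ [i < τ i],
  -- so the sum counts each orbit once and q is twice that sum.
  fixedPointFreeInvolution⇒even : ∀ q (τ : Fin q → Fin q) → (∀ i → τ (τ i) ≡ i) → (∀ i → τ i ≢ i) → 2 ∣ q
  fixedPointFreeInvolution⇒even q τ involutive fixedPointFree = divides (sum below) (begin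
    q                                       ≡⟨ sum-ones q ⟨
    sum {q} (λ _ → 1)                       ≡⟨ sum-cong-≗ orbit ⟩
    sum (λ i → below i + below (τ i))       ≡⟨ ∑-distrib-+ below (below ∘ τ) ⟩
    sum below + sum (below ∘ τ)             ≡⟨ ≡.cong (sum below +_) (sum-permute below π) ⟨
    sum below + sum below                   ≡⟨ ≡.cong (sum below +_) (ℕ.+-identityʳ (sum below)) ⟨
    2 * sum below                           ≡⟨ ℕ.*-comm 2 (sum below) ⟩
    sum below * 2                           ∎)
    where
    open ≡.≡-Reasoning
    π : Permutation′ q
    π = Perm.permutation τ τ involutive involutive
    [_<_] : Fin q → Fin q → ℕ
    [ i < j ] with Fin.<-cmp i j
    ... | tri< _ _ _ = 1
    ... | tri≈ _ _ _ = 0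
    ... | tri> _ _ _ = 0
    below : Fin q → ℕ
    below i = [ i < τ i ]
    exactly-one : ∀ i j → i ≢ j → [ i < j ] + [ j < i ] ≡ 1
    exactly-one i j i≢j with Fin.<-cmp i j | Fin.<-cmp j i
    ... | tri≈ _ i≡j _ | _ = ⊥-elim (i≢j i≡j)
    ... | _ | tri≈ _ j≡i _ = ⊥-elim (i≢j (≡.sym j≡i))
    ... | tri< i<j _ _ | tri< j<i _ _ = ⊥-elim (ℕ.<-asym i<j j<i)
    ... | tri< _ _ _ | tri> _ _ _ = ≡.refl
    ... | tri> _ _ _ | tri< _ _ _ = ≡.refl
    ... | tri> _ _ j<i | tri> _ _ i<j = ⊥-elim (ℕ.<-asym i<j j<i)
    orbit : ∀ i → 1 ≡ below i + below (τ i)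
    orbit i = ≡.sym (≡.trans (≡.cong (λ j → [ i < τ i ] + [ τ i < j ]) (involutive i))
                             (exactly-one i (τ i) (λ i≡τi → fixedPointFree i (≡.sym i≡τi))))
    sum-ones : ∀ n → sum {n} (λ _ → 1) ≡ n
    sum-ones zero = ≡.refl
    sum-ones (suc n) = ≡.cong suc (sum-ones n)

module FieldProperties {c ℓ : Level} (F : Field c ℓ) where

  open import Algebra.Bundles using (Semiring)
  open import Data.Nat using (zero; suc)
  open import Data.Product using (proj₁; proj₂)
  open import Relation.Nullary using (¬_)

  open Field F
  open import Algebra.Definitions.RawSemiring (Semiring.rawSemiring semiring) public using (_^_)
  open import Relation.Binary.Reasoning.Setoid setoid

  2# : Carrier
  2# = 1# + 1#

  x+x≈2#*x : ∀ x → x + x ≈ 2# * x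
  x+x≈2#*x x = sym (trans (distribʳ x 1# 1#) (+-cong (*-identityˡ x) (*-identityˡ x)))

  1≉0 : ¬ 1# ≈ 0#
  1≉0 1≈0 = 0≉1 (sym 1≈0)

  inv : ∀ x → ¬ x ≈ 0# → Carrier
  inv x x≉0 = proj₁ (inverse x x≉0)

  *-inv : ∀ x (x≉0 : ¬ x ≈ 0#) → x * inv x x≉0 ≈ 1#
  *-inv x x≉0 = proj₂ (inverse x x≉0)

  x*y≈0∧y≉0⇒x≈0 : ∀ {x y} → x * y ≈ 0# → ¬ y ≈ 0# → x ≈ 0#
  x*y≈0∧y≉0⇒x≈0 {x} {y} xy≈0 y≉0 = begin
    x                     ≈⟨ *-identityʳ x ⟨
    x * 1#                ≈⟨ *-congˡ (*-inv y y≉0) ⟨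
    x * (y * inv y y≉0)   ≈⟨ *-assoc x y _ ⟨
    (x * y) * inv y y≉0   ≈⟨ *-congʳ xy≈0 ⟩
    0# * inv y y≉0        ≈⟨ zeroˡ _ ⟩
    0#                    ∎

  *-nonzero : ∀ {x y} → ¬ x ≈ 0# → ¬ y ≈ 0# → ¬ x * y ≈ 0#
  *-nonzero x≉0 y≉0 xy≈0 = x≉0 (x*y≈0∧y≉0⇒x≈0 xy≈0 y≉0)

  ^-nonzero : ∀ {x} → ¬ x ≈ 0# → ∀ n → ¬ x ^ n ≈ 0#
  ^-nonzero x≉0 zero = 1≉0
  ^-nonzero x≉0 (suc n) = *-nonzero x≉0 (^-nonzero x≉0 n)

  *-solveˡ : ∀ {x y z} (x≉0 : ¬ x ≈ 0#) → x * y ≈ z → y ≈ inv x x≉0 * z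
  *-solveˡ {x} {y} {z} x≉0 xy≈z = begin
    y                         ≈⟨ *-identityˡ y ⟨
    1# * y                    ≈⟨ *-congʳ (trans (*-comm _ x) (*-inv x x≉0)) ⟨
    (inv x x≉0 * x) * y       ≈⟨ *-assoc _ x y ⟩
    inv x x≉0 * (x * y)       ≈⟨ *-congˡ xy≈z ⟩
    inv x x≉0 * z             ∎

module OddOrder {c ℓ : Level} (F : Field c ℓ) {q : ℕ} (order : HasOrder F q) where

  open Parity
  open import Data.Nat.Divisibility using (_∣_)
  open import Data.Fin as Fin using (Fin)
  open import Data.Fin.Properties as Fin using ()
  open import Data.Product using (proj₁; proj₂)
  open import Relation.Binary using (Decidable)
  open import Relation.Nullary using (¬_; yes; no)
  open import Relation.Binary.PropositionalEquality as ≡ using (_≡_; _≢_)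
  open Field F
  open FieldProperties F using (1≉0; 2#)
  open import Relation.Binary.Reasoning.Setoid setoid

  private
    enum : Fin q → Carrier
    enum = proj₁ order
    index : ∀ x → Fin q
    index x = proj₁ (proj₁ (proj₂ order) x)
    enum-index : ∀ x → enum (index x) ≈ x
    enum-index x = proj₂ (proj₁ (proj₂ order) x)
    enum-injective : ∀ i j → enum i ≈ enum j → i ≡ j
    enum-injective = proj₂ (proj₂ order)

  _≟_ : Decidable _≈_
  x ≟ y with index x Fin.≟ index y
  ... | yes i≡j = yes (trans (sym (enum-index x)) (trans (reflexive (≡.cong enum i≡j)) (enum-index y)))
  ... | no i≢j = no λ x≈y → i≢j (enum-injective _ _ (trans (enum-index x) (trans x≈y (sym (enum-index y)))))

  -- In characteristic 2, translation by 1 is a fixed-point-free involution.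
  oddOrder⇒2≉0 : ¬ 2 ∣ q → ¬ 2# ≈ 0#
  oddOrder⇒2≉0 odd 2≈0 = odd (fixedPointFreeInvolution⇒even q τ involutive fixedPointFree)
    where
    τ : Fin q → Fin q
    τ i = index (enum i + 1#)
    enum-τ : ∀ i → enum (τ i) ≈ enum i + 1#
    enum-τ i = enum-index (enum i + 1#)
    involutive : ∀ i → τ (τ i) ≡ i
    involutive i = enum-injective _ _ (begin
      enum (τ (τ i))        ≈⟨ enum-τ (τ i) ⟩
      enum (τ i) + 1#       ≈⟨ +-congʳ (enum-τ i) ⟩
      enum i + 1# + 1#      ≈⟨ +-assoc _ _ _ ⟩
      enum i + 2#           ≈⟨ +-congˡ 2≈0 ⟩
      enum i + 0#           ≈⟨ +-identityʳ _ ⟩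
      enum i                ∎)
    fixedPointFree : ∀ i → τ i ≢ i
    fixedPointFree i τi≡i = 1≉0 (begin
      1#                        ≈⟨ +-identityˡ 1# ⟨
      0# + 1#                   ≈⟨ +-congʳ (-‿inverseˡ (enum i)) ⟨
      (- enum i + enum i) + 1#  ≈⟨ +-assoc _ _ _ ⟩
      - enum i + (enum i + 1#)  ≈⟨ +-congˡ (enum-τ i) ⟨
      - enum i + enum (τ i)     ≈⟨ +-congˡ (reflexive (≡.cong enum τi≡i)) ⟩
      - enum i + enum i         ≈⟨ -‿inverseˡ (enum i) ⟩
      0#                        ∎)

module Polynomials {c ℓ : Level} (F : Field c ℓ) where

  open Exponents
  open import Algebra.Bundles using (CommutativeMonoid)
  import Algebra.Properties.Ring as RingProperties
  open import Data.Nat as ℕ using (ℕ; zero; suc)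
  open import Data.Nat.Properties as ℕ using ()
  open import Data.Fin as Fin using (Fin)
  open import Data.List as List using (List; []; _∷_; _++_; upTo; cartesianProductWith)
  open import Data.List.Properties using (++-identityʳ)
  open import Data.List.Membership.Propositional using (_∈_; _∉_)
  open import Data.List.Membership.Propositional.Properties using (∈-cartesianProductWith⁺; ∈-upTo⁺)
  open import Data.List.Relation.Unary.All using (All; []; _∷_)
  open import Data.List.Relation.Unary.Any using (here; there)
  open import Data.List.Relation.Unary.Unique.Propositional using (Unique; []; _∷_)
  open import Data.List.Relation.Unary.Unique.Propositional.Properties using (cartesianProductWith⁺; upTo⁺)
  open import Data.Product using (_×_; _,_; proj₁; proj₂)
  open import Data.Empty using (⊥-elim)
  open import Data.Vec using ([]; _∷_; lookup; tabulate)
  open import Data.Vec.Properties using (∷-injective)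
  open import Relation.Nullary using (¬_; yes; no)
  open import Relation.Nullary.Decidable using (⌊_⌋)
  open import Data.Bool using (if_then_else_)
  open import Function using (_∘_)
  open import Relation.Binary.PropositionalEquality as ≡ using (_≡_; _≢_)

  open Field F
  open RingProperties ring using (-‿distribˡ-*; -0#≈0#; -‿+-comm)
  open import Algebra.Properties.AbelianGroup +-abelianGroup using (x∙y⁻¹≈ε⇒x≈y)
  open import Relation.Binary.Reasoning.Setoid setoid

  infix 4 _≈ₚ_
  infixl 6 _+ₚ_
  infixl 7 _*ₚ_
  infixr 8 _^ₚ_

  _≈ₚ_ : ∀ {n} → Poly F n → Poly F n → Set ℓ
  _≈ₚ_ = _≈P_ F

  _+ₚ_ _*ₚ_ : ∀ {n} → Poly F n → Poly F n → Poly F n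
  _+ₚ_ = _+P_ F
  _*ₚ_ = _*P_ F

  _^ₚ_ : ∀ {n} → Poly F n → ℕ → Poly F n
  _^ₚ_ = _^P_ F

  private
    variable
      a b : Level
      A : Set a
      B : Set b

  sumBy : (A → Carrier) → List A → Carrier
  sumBy g [] = 0#
  sumBy g (x ∷ xs) = g x + sumBy g xs

  sumBy-zero : ∀ {g : A → Carrier} xs → (∀ x → g x ≈ 0#) → sumBy g xs ≈ 0#
  sumBy-zero [] _ = refl
  sumBy-zero (x ∷ xs) g≈0 = trans (+-cong (g≈0 x) (sumBy-zero xs g≈0)) (+-identityˡ _)

  sumBy-cong : ∀ {g h : A → Carrier} xs → (∀ x → g x ≈ h x) → sumBy g xs ≈ sumBy h xs
  sumBy-cong [] _ = refl
  sumBy-cong (x ∷ xs) g≈h = +-cong (g≈h x) (sumBy-cong xs g≈h)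

  sumBy-++ : ∀ (g : A → Carrier) xs ys → sumBy g (xs ++ ys) ≈ sumBy g xs + sumBy g ys
  sumBy-++ g [] ys = sym (+-identityˡ _)
  sumBy-++ g (x ∷ xs) ys = trans (+-congˡ (sumBy-++ g xs ys)) (sym (+-assoc _ _ _))

  sumBy-+ : ∀ (g h : A → Carrier) xs → sumBy (λ x → g x + h x) xs ≈ sumBy g xs + sumBy h xs
  sumBy-+ g h [] = sym (+-identityˡ _)
  sumBy-+ g h (x ∷ xs) = trans (+-congˡ (sumBy-+ g h xs)) (interchange (g x) (h x) _ _)
    where open import Algebra.Properties.CommutativeSemigroup +-commutativeSemigroup using (interchange)

  sumBy-*ˡ : ∀ k (g : A → Carrier) xs → k * sumBy g xs ≈ sumBy (λ x → k * g x) xs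
  sumBy-*ˡ k g [] = zeroʳ k
  sumBy-*ˡ k g (x ∷ xs) = trans (distribˡ k _ _) (+-congˡ (sumBy-*ˡ k g xs))

  sumBy-map : ∀ (g : B → Carrier) (f : A → B) xs → sumBy g (List.map f xs) ≡ sumBy (λ x → g (f x)) xs
  sumBy-map g f [] = ≡.refl
  sumBy-map g f (x ∷ xs) = ≡.cong (g (f x) +_) (sumBy-map g f xs)

  sumBy-swap : ∀ (k : A → B → Carrier) xs ys →
               sumBy (λ x → sumBy (k x) ys) xs ≈ sumBy (λ y → sumBy (λ x → k x y) xs) ys
  sumBy-swap k [] ys = sym (sumBy-zero ys (λ _ → refl))
  sumBy-swap k (x ∷ xs) ys = trans (+-congˡ (sumBy-swap k xs ys)) (sym (sumBy-+ (k x) _ ys))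

  coeff-+ₚ : ∀ {n} (P R : Poly F n) e → coeff F (P +ₚ R) e ≈ coeff F P e + coeff F R e
  coeff-+ₚ [] R e = sym (+-identityˡ _)
  coeff-+ₚ ((a , f) ∷ P) R e with f ≟ₑ e
  ... | yes _ = trans (+-congˡ (coeff-+ₚ P R e)) (sym (+-assoc _ _ _))
  ... | no _ = coeff-+ₚ P R e

  linExt : ∀ {n} → (Exponent n → Carrier) → Poly F n → Carrier
  linExt h = sumBy (λ t → proj₁ t * h (proj₂ t))

  linExt-congʳ : ∀ {n} {h h′ : Exponent n → Carrier} P → (∀ f → h f ≈ h′ f) → linExt h P ≈ linExt h′ P
  linExt-congʳ P h≈h′ = sumBy-cong P (λ t → *-congˡ (h≈h′ (proj₂ t)))

  without : ∀ {n} → Exponent n → Poly F n → Poly F n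
  without m [] = []
  without m ((a , f) ∷ P) with f ≟ₑ m
  ... | yes _ = without m P
  ... | no _ = (a , f) ∷ without m P

  coeff-without-≡ : ∀ {n} (P : Poly F n) m → coeff F (without m P) m ≈ 0#
  coeff-without-≡ [] m = refl
  coeff-without-≡ ((a , f) ∷ P) m with f ≟ₑ m
  ... | yes _ = coeff-without-≡ P m
  ... | no f≢m with f ≟ₑ m
  ...   | yes f≡m = ⊥-elim (f≢m f≡m)
  ...   | no _ = coeff-without-≡ P m

  coeff-without-≢ : ∀ {n} (P : Poly F n) m g → g ≢ m → coeff F (without m P) g ≈ coeff F P g
  coeff-without-≢ [] m g g≢m = refl
  coeff-without-≢ ((a , f) ∷ P) m g g≢m with f ≟ₑ m
  ... | yes ≡.refl with f ≟ₑ g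
  ...   | yes ≡.refl = ⊥-elim (g≢m ≡.refl)
  ...   | no _ = coeff-without-≢ P f g g≢m
  coeff-without-≢ ((a , f) ∷ P) m g g≢m | no _ with f ≟ₑ g
  ...   | yes _ = +-congˡ (coeff-without-≢ P m g g≢m)
  ...   | no _ = coeff-without-≢ P m g g≢m

  length-without : ∀ {n} (P : Poly F n) m → List.length (without m P) ℕ.≤ List.length P
  length-without [] m = ℕ.z≤n
  length-without ((a , f) ∷ P) m with f ≟ₑ m
  ... | yes _ = ℕ.m≤n⇒m≤1+n (length-without P m)
  ... | no _ = ℕ.s≤s (length-without P m)

  linExt-without : ∀ {n} (h : Exponent n → Carrier) (P : Poly F n) m →
                   linExt h P ≈ coeff F P m * h m + linExt h (without m P)
  linExt-without h [] m = sym (trans (+-identityʳ _) (zeroˡ _))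
  linExt-without h ((a , f) ∷ P) m with f ≟ₑ m
  ... | yes ≡.refl = begin
    a * h f + linExt h P                                        ≈⟨ +-congˡ (linExt-without h P f) ⟩
    a * h f + (coeff F P f * h f + linExt h (without f P))      ≈⟨ +-assoc _ _ _ ⟨
    (a * h f + coeff F P f * h f) + linExt h (without f P)      ≈⟨ +-congʳ (distribʳ _ _ _) ⟨
    (a + coeff F P f) * h f + linExt h (without f P)            ∎
  ... | no _ = begin
    a * h f + linExt h P                                        ≈⟨ +-congˡ (linExt-without h P m) ⟩
    a * h f + (coeff F P m * h m + linExt h (without m P))      ≈⟨ x∙yz≈y∙xz _ _ _ ⟩
    coeff F P m * h m + (a * h f + linExt h (without m P))      ∎
    where open import Algebra.Properties.CommutativeSemigroup +-commutativeSemigroup using (x∙yz≈y∙xz)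

  -- Removing all terms of one monomial strictly shortens a nonempty
  -- polynomial, which drives the induction.
  linExt-zero : ∀ {n} (h : Exponent n → Carrier) (P : Poly F n) →
                (∀ f → coeff F P f * h f ≈ 0#) → linExt h P ≈ 0#
  linExt-zero h P = go P ℕ.≤-refl
    where
    go : ∀ {k} (P : Poly F _) → List.length P ℕ.≤ k → (∀ f → coeff F P f * h f ≈ 0#) → linExt h P ≈ 0#
    go [] _ _ = refl
    go {suc k} P@((a , f) ∷ P′) (ℕ.s≤s |P′|≤k) P≈0 = begin
      linExt h P                                     ≈⟨ linExt-without h P f ⟩
      coeff F P f * h f + linExt h (without f P)     ≈⟨ +-cong (P≈0 f) (go (without f P) shorter without≈0) ⟩
      0# + 0#                                        ≈⟨ +-identityˡ _ ⟩
      0#                                             ∎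
      where
      shorter : List.length (without f P) ℕ.≤ k
      shorter with f ≟ₑ f
      ... | yes _ = ℕ.≤-trans (length-without P′ f) |P′|≤k
      ... | no f≢f = ⊥-elim (f≢f ≡.refl)
      without≈0 : ∀ g → coeff F (without f P) g * h g ≈ 0#
      without≈0 g with g ≟ₑ f
      ... | yes ≡.refl = trans (*-congʳ (coeff-without-≡ P f)) (zeroˡ _)
      ... | no g≢f = trans (*-congʳ (coeff-without-≢ P f g g≢f)) (P≈0 g)

  linExt-support : ∀ {n} (h : Exponent n → Carrier) (ms : List (Exponent n)) → Unique ms → (P : Poly F n) →
                   (∀ g → g ∉ ms → coeff F P g * h g ≈ 0#) → linExt h P ≈ sumBy (λ m → coeff F P m * h m) ms
  linExt-support h [] _ P outside≈0 = linExt-zero h P (λ g → outside≈0 g (λ ()))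
  linExt-support h (m ∷ ms) (m∉ms ∷ unique) P outside≈0 = begin
    linExt h P                                                   ≈⟨ linExt-without h P m ⟩
    coeff F P m * h m + linExt h (without m P)                   ≈⟨ +-congˡ (linExt-support h ms unique (without m P) outside′≈0) ⟩
    coeff F P m * h m + sumBy (λ m′ → coeff F (without m P) m′ * h m′) ms
      ≈⟨ +-congˡ (sumBy-cong-distinct ms m∉ms) ⟩
    coeff F P m * h m + sumBy (λ m′ → coeff F P m′ * h m′) ms    ∎
    where
    sumBy-cong-distinct : ∀ ms → All (m ≢_) ms →
      sumBy (λ m′ → coeff F (without m P) m′ * h m′) ms ≈ sumBy (λ m′ → coeff F P m′ * h m′) ms
    sumBy-cong-distinct [] [] = refl
    sumBy-cong-distinct (m′ ∷ ms) (m≢m′ ∷ rest) =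
      +-cong (*-congʳ (coeff-without-≢ P m m′ (λ m′≡m → m≢m′ (≡.sym m′≡m)))) (sumBy-cong-distinct ms rest)
    outside′≈0 : ∀ g → g ∉ ms → coeff F (without m P) g * h g ≈ 0#
    outside′≈0 g g∉ms with g ≟ₑ m
    ... | yes ≡.refl = trans (*-congʳ (coeff-without-≡ P m)) (zeroˡ _)
    ... | no g≢m = trans (*-congʳ (coeff-without-≢ P m g g≢m)) (outside≈0 g λ { (here g≡m) → g≢m g≡m ; (there g∈ms) → g∉ms g∈ms })

  linExt-point : ∀ {n} (h : Exponent n → Carrier) (P : Poly F n) m →
                 (∀ g → g ≢ m → coeff F P g * h g ≈ 0#) → linExt h P ≈ coeff F P m * h m
  linExt-point h P m outside≈0 =
    trans (linExt-support h (m ∷ []) ([] ∷ []) P (λ g g∉m → outside≈0 g (λ g≡m → g∉m (here g≡m)))) (+-identityʳ _)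

  negₚ : ∀ {n} → Poly F n → Poly F n
  negₚ = List.map (λ t → (- proj₁ t , proj₂ t))

  coeff-negₚ : ∀ {n} (P : Poly F n) e → coeff F (negₚ P) e ≈ - coeff F P e
  coeff-negₚ [] e = sym -0#≈0#
  coeff-negₚ ((a , f) ∷ P) e with f ≟ₑ e
  ... | yes _ = trans (+-congˡ (coeff-negₚ P e)) (-‿+-comm a _)
  ... | no _ = coeff-negₚ P e

  linExt-negₚ : ∀ {n} (h : Exponent n → Carrier) (P : Poly F n) → linExt h (negₚ P) ≈ - linExt h P
  linExt-negₚ h [] = sym -0#≈0#
  linExt-negₚ h ((a , f) ∷ P) = trans (+-cong (sym (-‿distribˡ-* a (h f))) (linExt-negₚ h P)) (-‿+-comm _ _)

  linExt-congˡ : ∀ {n} (h : Exponent n → Carrier) (P R : Poly F n) → P ≈ₚ R → linExt h P ≈ linExt h R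
  linExt-congˡ h P R P≈R = x∙y⁻¹≈ε⇒x≈y _ _ (begin
    linExt h P - linExt h R          ≈⟨ +-congˡ (linExt-negₚ h R) ⟨
    linExt h P + linExt h (negₚ R)   ≈⟨ sumBy-++ _ P (negₚ R) ⟨
    linExt h (P ++ negₚ R)           ≈⟨ linExt-zero h (P ++ negₚ R) difference≈0 ⟩
    0#                               ∎)
    where
    difference≈0 : ∀ f → coeff F (P ++ negₚ R) f * h f ≈ 0#
    difference≈0 f = trans (*-congʳ (begin
      coeff F (P ++ negₚ R) f            ≈⟨ coeff-+ₚ P (negₚ R) f ⟩
      coeff F P f + coeff F (negₚ R) f   ≈⟨ +-cong (P≈R f) (coeff-negₚ R f) ⟩
      coeff F R f - coeff F R f          ≈⟨ -‿inverseʳ _ ⟩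
      0#                                 ∎)) (zeroˡ _)

  δ : ∀ {n} → Exponent n → Exponent n → Carrier → Carrier
  δ f e x = if ⌊ f ≟ₑ e ⌋ then x else 0#

  δ-cong : ∀ {n} {f f′ : Exponent n} e {x y} → f ≡ f′ → x ≈ y → δ f e x ≈ δ f′ e y
  δ-cong {f = f} e ≡.refl x≈y with f ≟ₑ e
  ... | yes _ = x≈y
  ... | no _ = refl

  δ-*ˡ : ∀ {n} (f e : Exponent n) a x → a * δ f e x ≈ δ f e (a * x)
  δ-*ˡ f e a x with f ≟ₑ e
  ... | yes _ = refl
  ... | no _ = zeroʳ a

  coeff-as-linExt : ∀ {n} (P : Poly F n) e → coeff F P e ≈ linExt (λ f → δ f e 1#) P
  coeff-as-linExt [] e = refl
  coeff-as-linExt ((a , f) ∷ P) e with f ≟ₑ e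
  ... | yes _ = +-cong (sym (*-identityʳ a)) (coeff-as-linExt P e)
  ... | no _ = trans (coeff-as-linExt P e) (sym (trans (+-congʳ (zeroʳ a)) (+-identityˡ _)))

  coeffShift : ∀ {n} → Poly F n → Exponent n → Exponent n → Carrier
  coeffShift R f e = sumBy (λ t → δ (f +ₑ proj₂ t) e (proj₁ t)) R

  coeffShift-hit : ∀ {n} (R : Poly F n) f g e → f +ₑ g ≡ e → coeffShift R f e ≈ coeff F R g
  coeffShift-hit [] f g e _ = refl
  coeffShift-hit ((b , g′) ∷ R) f g e f+g≡e with f +ₑ g′ ≟ₑ e | g′ ≟ₑ g
  ... | yes _ | yes _ = +-congˡ (coeffShift-hit R f g e f+g≡e)
  ... | yes f+g′≡e | no g′≢g = ⊥-elim (g′≢g (+ₑ-cancelˡ f g′ g (≡.trans f+g′≡e (≡.sym f+g≡e))))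
  ... | no f+g′≢e | yes ≡.refl = ⊥-elim (f+g′≢e f+g≡e)
  ... | no _ | no _ = trans (+-identityˡ _) (coeffShift-hit R f g e f+g≡e)

  coeffShift-miss : ∀ {n} (R : Poly F n) f e → ¬ (f ∣ₑ e) → coeffShift R f e ≈ 0#
  coeffShift-miss [] f e _ = refl
  coeffShift-miss ((b , g) ∷ R) f e f∤e with f +ₑ g ≟ₑ e
  ... | yes f+g≡e = ⊥-elim (f∤e (g , f+g≡e))
  ... | no _ = trans (+-identityˡ _) (coeffShift-miss R f e f∤e)

  coeff-term-*ₚ : ∀ {n} a (f : Exponent n) (R : Poly F n) e → coeff F (((a , f) ∷ []) *ₚ R) e ≈ a * coeffShift R f e
  coeff-term-*ₚ a f [] e = sym (zeroʳ a)
  coeff-term-*ₚ a f ((b , g) ∷ R) e with f +ₑ g ≟ₑ e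
  ... | yes _ = trans (+-congˡ (coeff-term-*ₚ a f R e)) (sym (distribˡ _ _ _))
  ... | no _ = trans (coeff-term-*ₚ a f R e) (*-congˡ (sym (+-identityˡ _)))

  coeff-*ₚ : ∀ {n} (P R : Poly F n) e → coeff F (P *ₚ R) e ≈ linExt (λ f → coeffShift R f e) P
  coeff-*ₚ [] R e = refl
  coeff-*ₚ ((a , f) ∷ P) R e = trans (coeff-+ₚ aR (P *ₚ R) e) (+-cong aR-coeff (coeff-*ₚ P R e))
    where
    aR = List.map (λ { (b , g) → (a * b , f +ₑ g) }) R
    aR-coeff : coeff F aR e ≈ a * coeffShift R f e
    aR-coeff = trans (reflexive (≡.cong (λ Q → coeff F Q e) (≡.sym (++-identityʳ aR)))) (coeff-term-*ₚ a f R e)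

  coeffShift-cong : ∀ {n} (R R′ : Poly F n) → R ≈ₚ R′ → ∀ f e → coeffShift R f e ≈ coeffShift R′ f e
  coeffShift-cong R R′ R≈R′ f e with f ∣ₑ? e
  ... | yes (g , f+g≡e) = trans (coeffShift-hit R f g e f+g≡e) (trans (R≈R′ g) (sym (coeffShift-hit R′ f g e f+g≡e)))
  ... | no f∤e = trans (coeffShift-miss R f e f∤e) (sym (coeffShift-miss R′ f e f∤e))

  *ₚ-congˡ : ∀ {n} (P P′ R : Poly F n) → P ≈ₚ P′ → P *ₚ R ≈ₚ P′ *ₚ R
  *ₚ-congˡ P P′ R P≈P′ e =
    trans (coeff-*ₚ P R e) (trans (linExt-congˡ _ P P′ P≈P′) (sym (coeff-*ₚ P′ R e)))

  *ₚ-congʳ : ∀ {n} (P R R′ : Poly F n) → R ≈ₚ R′ → P *ₚ R ≈ₚ P *ₚ R′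
  *ₚ-congʳ P R R′ R≈R′ e =
    trans (coeff-*ₚ P R e) (trans (linExt-congʳ P (λ f → coeffShift-cong R R′ R≈R′ f e)) (sym (coeff-*ₚ P R′ e)))

  *ₚ-cong : ∀ {n} (P P′ R R′ : Poly F n) → P ≈ₚ P′ → R ≈ₚ R′ → P *ₚ R ≈ₚ P′ *ₚ R′
  *ₚ-cong P P′ R R′ P≈P′ R≈R′ e = trans (*ₚ-congˡ P P′ R P≈P′ e) (*ₚ-congʳ P′ R R′ R≈R′ e)

  divisorsₑ : ∀ {n} → Exponent n → List (Exponent n)
  divisorsₑ [] = [] ∷ []
  divisorsₑ (x ∷ e) = cartesianProductWith _∷_ (upTo (suc x)) (divisorsₑ e)

  divisorsₑ-unique : ∀ {n} (e : Exponent n) → Unique (divisorsₑ e)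
  divisorsₑ-unique [] = [] ∷ []
  divisorsₑ-unique (x ∷ e) = cartesianProductWith⁺ _∷_ ∷-injective (upTo⁺ (suc x)) (divisorsₑ-unique e)

  ∣ₑ⇒∈divisorsₑ : ∀ {n} {f e : Exponent n} → f ∣ₑ e → f ∈ divisorsₑ e
  ∣ₑ⇒∈divisorsₑ {f = []} {[]} _ = here ≡.refl
  ∣ₑ⇒∈divisorsₑ {f = y ∷ f} {x ∷ e} (z ∷ g , y+z∷f+g≡x∷e) with ∷-injective y+z∷f+g≡x∷e
  ... | ≡.refl , f+g≡e = ∈-cartesianProductWith⁺ _∷_ (∈-upTo⁺ (ℕ.s≤s (ℕ.m≤m+n y z))) (∣ₑ⇒∈divisorsₑ (g , f+g≡e))

  coeff-*ₚ-divisors : ∀ {n} (P R : Poly F n) e →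
                      coeff F (P *ₚ R) e ≈ sumBy (λ f → coeff F P f * coeffShift R f e) (divisorsₑ e)
  coeff-*ₚ-divisors P R e = trans (coeff-*ₚ P R e) (linExt-support _ (divisorsₑ e) (divisorsₑ-unique e) P vanishes)
    where
    vanishes : ∀ g → g ∉ divisorsₑ e → coeff F P g * coeffShift R g e ≈ 0#
    vanishes g g∉ = trans (*-congˡ (coeffShift-miss R g e (λ g∣e → g∉ (∣ₑ⇒∈divisorsₑ g∣e)))) (zeroʳ _)

  convolution : ∀ {n} → Poly F n → Poly F n → Exponent n → Carrier
  convolution P R e = sumBy (λ t → sumBy (λ s → δ (proj₂ t +ₑ proj₂ s) e (proj₁ t * proj₁ s)) R) P

  coeff-*ₚ-convolution : ∀ {n} (P R : Poly F n) e → coeff F (P *ₚ R) e ≈ convolution P R e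
  coeff-*ₚ-convolution P R e = trans (coeff-*ₚ P R e) (sumBy-cong P λ t →
    trans (sumBy-*ˡ (proj₁ t) _ R) (sumBy-cong R (λ s → δ-*ˡ (proj₂ t +ₑ proj₂ s) e (proj₁ t) (proj₁ s))))

  sumBy-*ₚ : ∀ {n} (k : Carrier × Exponent n → Carrier) (P R : Poly F n) →
             sumBy k (P *ₚ R) ≈ sumBy (λ t → sumBy (λ s → k (proj₁ t * proj₁ s , proj₂ t +ₑ proj₂ s)) R) P
  sumBy-*ₚ k [] R = refl
  sumBy-*ₚ k ((a , f) ∷ P) R = trans (sumBy-++ k (List.map (λ { (b , g) → (a * b , f +ₑ g) }) R) (P *ₚ R))
    (+-cong (reflexive (sumBy-map k (λ { (b , g) → (a * b , f +ₑ g) }) R)) (sumBy-*ₚ k P R))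

  *ₚ-comm : ∀ {n} (P R : Poly F n) → P *ₚ R ≈ₚ R *ₚ P
  *ₚ-comm P R e = begin
    coeff F (P *ₚ R) e         ≈⟨ coeff-*ₚ-convolution P R e ⟩
    convolution P R e          ≈⟨ sumBy-swap _ P R ⟩
    sumBy (λ s → sumBy (λ t → δ (proj₂ t +ₑ proj₂ s) e (proj₁ t * proj₁ s)) P) R
      ≈⟨ sumBy-cong R (λ s → sumBy-cong P (λ t → δ-cong e (+ₑ-comm (proj₂ t) (proj₂ s)) (*-comm _ _))) ⟩
    convolution R P e          ≈⟨ coeff-*ₚ-convolution R P e ⟨
    coeff F (R *ₚ P) e         ∎

  *ₚ-assoc : ∀ {n} (P R S : Poly F n) → (P *ₚ R) *ₚ S ≈ₚ P *ₚ (R *ₚ S)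
  *ₚ-assoc P R S e = begin
    coeff F ((P *ₚ R) *ₚ S) e    ≈⟨ coeff-*ₚ-convolution (P *ₚ R) S e ⟩
    convolution (P *ₚ R) S e     ≈⟨ sumBy-*ₚ _ P R ⟩
    sumBy (λ t → sumBy (λ s → sumBy (λ u → δ ((proj₂ t +ₑ proj₂ s) +ₑ proj₂ u) e ((proj₁ t * proj₁ s) * proj₁ u)) S) R) P
      ≈⟨ sumBy-cong P (λ t → sumBy-cong R (λ s → sumBy-cong S (λ u →
           δ-cong e (+ₑ-assoc (proj₂ t) (proj₂ s) (proj₂ u)) (*-assoc _ _ _)))) ⟩
    sumBy (λ t → sumBy (λ s → sumBy (λ u → δ (proj₂ t +ₑ (proj₂ s +ₑ proj₂ u)) e (proj₁ t * (proj₁ s * proj₁ u))) S) R) P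
      ≈⟨ sumBy-cong P (λ t → sumBy-*ₚ (λ w → δ (proj₂ t +ₑ proj₂ w) e (proj₁ t * proj₁ w)) R S) ⟨
    convolution P (R *ₚ S) e     ≈⟨ coeff-*ₚ-convolution P (R *ₚ S) e ⟨
    coeff F (P *ₚ (R *ₚ S)) e    ∎

  coeff-constP-*ₚ : ∀ {n} a (P : Poly F n) e → coeff F (constP F a *ₚ P) e ≈ a * coeff F P e
  coeff-constP-*ₚ a P e = trans (coeff-term-*ₚ a 0ₑ P e) (*-congˡ (coeffShift-hit P 0ₑ e e (+ₑ-identityˡ e)))

  *ₚ-identityˡ : ∀ {n} (P : Poly F n) → 1P F *ₚ P ≈ₚ P
  *ₚ-identityˡ P e = trans (coeff-constP-*ₚ 1# P e) (*-identityˡ _)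

  *ₚ-identityʳ : ∀ {n} (P : Poly F n) → P *ₚ 1P F ≈ₚ P
  *ₚ-identityʳ P e = trans (*ₚ-comm P (1P F) e) (*ₚ-identityˡ P e)

  *ₚ-commutativeMonoid : ℕ → CommutativeMonoid c ℓ
  *ₚ-commutativeMonoid n = record
    { Carrier = Poly F n
    ; _≈_ = _≈ₚ_
    ; _∙_ = _*ₚ_
    ; ε = 1P F
    ; isCommutativeMonoid = record
      { isMonoid = record
        { isSemigroup = record
          { isMagma = record
            { isEquivalence = record { refl = λ _ → refl ; sym = λ p e → sym (p e) ; trans = λ p q e → trans (p e) (q e) }
            ; ∙-cong = λ {P} {P′} {R} {R′} → *ₚ-cong P P′ R R′ }
          ; assoc = *ₚ-assoc }
        ; identity = *ₚ-identityˡ , *ₚ-identityʳ }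
      ; comm = *ₚ-comm } }

  ^ₚ-cong : ∀ {n} (P P′ : Poly F n) k → P ≈ₚ P′ → P ^ₚ k ≈ₚ P′ ^ₚ k
  ^ₚ-cong P P′ zero _ e = refl
  ^ₚ-cong P P′ (suc k) P≈P′ = *ₚ-cong P P′ (P ^ₚ k) (P′ ^ₚ k) P≈P′ (^ₚ-cong P P′ k P≈P′)

  ^ₚ-+ : ∀ {n} (P : Poly F n) i j → P ^ₚ (i ℕ.+ j) ≈ₚ P ^ₚ i *ₚ P ^ₚ j
  ^ₚ-+ P zero j e = sym (*ₚ-identityˡ (P ^ₚ j) e)
  ^ₚ-+ P (suc i) j e = trans (*ₚ-congʳ P _ _ (^ₚ-+ P i j) e) (sym (*ₚ-assoc P (P ^ₚ i) (P ^ₚ j) e))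

  monomial : ∀ {k n} → (Fin k → Poly F n) → Exponent k → Poly F n
  monomial Ts f = prodP F (tabulate (λ i → Ts i ^ₚ lookup f i))

  monomial-cong : ∀ {k n} (Ts Ts′ : Fin k → Poly F n) f → (∀ i → Ts i ≈ₚ Ts′ i) → monomial Ts f ≈ₚ monomial Ts′ f
  monomial-cong Ts Ts′ [] _ e = refl
  monomial-cong Ts Ts′ (x ∷ f) Ts≈Ts′ =
    *ₚ-cong (Ts Fin.zero ^ₚ x) (Ts′ Fin.zero ^ₚ x) (monomial (Ts ∘ Fin.suc) f) (monomial (Ts′ ∘ Fin.suc) f)
            (^ₚ-cong (Ts Fin.zero) (Ts′ Fin.zero) x (Ts≈Ts′ Fin.zero))
            (monomial-cong (Ts ∘ Fin.suc) (Ts′ ∘ Fin.suc) f (Ts≈Ts′ ∘ Fin.suc))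

  monomial-+ₑ : ∀ {k n} (Ts : Fin k → Poly F n) f g → monomial Ts (f +ₑ g) ≈ₚ monomial Ts f *ₚ monomial Ts g
  monomial-+ₑ Ts [] [] e = sym (*ₚ-identityˡ (1P F) e)
  monomial-+ₑ {n = n} Ts (x ∷ f) (y ∷ g) e = trans
    (*ₚ-cong (T₀ ^ₚ (x ℕ.+ y)) (T₀ ^ₚ x *ₚ T₀ ^ₚ y) (monomial Ts′ (f +ₑ g)) (monomial Ts′ f *ₚ monomial Ts′ g)
             (^ₚ-+ T₀ x y) (monomial-+ₑ Ts′ f g) e)
    (interchange (T₀ ^ₚ x) (T₀ ^ₚ y) (monomial Ts′ f) (monomial Ts′ g) e)
    where
    T₀ = Ts Fin.zero
    Ts′ = Ts ∘ Fin.suc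
    open import Algebra.Properties.CommutativeSemigroup
      (CommutativeMonoid.commutativeSemigroup (*ₚ-commutativeMonoid n)) using (interchange)

  monomial-0ₑ : ∀ {k n} (Ts : Fin k → Poly F n) → monomial Ts 0ₑ ≈ₚ 1P F
  monomial-0ₑ {zero} Ts e = refl
  monomial-0ₑ {suc k} Ts e = trans (*ₚ-identityˡ (monomial (Ts ∘ Fin.suc) 0ₑ) e) (monomial-0ₑ (Ts ∘ Fin.suc) e)

  linExt-constP-*ₚ : ∀ {n} (h : Exponent n → Carrier) a (P : Poly F n) → linExt h (constP F a *ₚ P) ≈ a * linExt h P
  linExt-constP-*ₚ h a [] = sym (zeroʳ a)
  linExt-constP-*ₚ h a ((b , g) ∷ P) =
    trans (+-cong (trans (*-congˡ (reflexive (≡.cong h (+ₑ-identityˡ g)))) (*-assoc _ _ _)) (linExt-constP-*ₚ h a P))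
          (sym (distribˡ _ _ _))

  linExt-substP : ∀ {k n} (h : Exponent n → Carrier) (G : Poly F k) (Ts : Fin k → Poly F n) →
                  linExt h (substP F G Ts) ≈ linExt (λ f → linExt h (monomial Ts f)) G
  linExt-substP h [] Ts = refl
  linExt-substP h ((a , f) ∷ G) Ts = trans (sumBy-++ _ (constP F a *ₚ monomial Ts f) (substP F G Ts))
    (+-cong (linExt-constP-*ₚ h a (monomial Ts f)) (linExt-substP h G Ts))

  coeff-substP : ∀ {k n} (G : Poly F k) (Ts : Fin k → Poly F n) e →
                 coeff F (substP F G Ts) e ≈ linExt (λ f → coeff F (monomial Ts f) e) G
  coeff-substP G Ts e = begin
    coeff F (substP F G Ts) e                                       ≈⟨ coeff-as-linExt (substP F G Ts) e ⟩
    linExt (λ f → δ f e 1#) (substP F G Ts)                         ≈⟨ linExt-substP _ G Ts ⟩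
    linExt (λ f → linExt (λ f′ → δ f′ e 1#) (monomial Ts f)) G      ≈⟨ linExt-congʳ G (λ f → coeff-as-linExt (monomial Ts f) e) ⟨
    linExt (λ f → coeff F (monomial Ts f) e) G                      ∎

  substP-congʳ : ∀ {k n} (G : Poly F k) (Ts Ts′ : Fin k → Poly F n) → (∀ i → Ts i ≈ₚ Ts′ i) → substP F G Ts ≈ₚ substP F G Ts′
  substP-congʳ G Ts Ts′ Ts≈Ts′ e = trans (coeff-substP G Ts e)
    (trans (linExt-congʳ G (λ f → monomial-cong Ts Ts′ f Ts≈Ts′ e)) (sym (coeff-substP G Ts′ e)))

  substP-*ₚ : ∀ {k n} (T : Fin k → Poly F n) (P R : Poly F k) → substP F (P *ₚ R) T ≈ₚ substP F P T *ₚ substP F R T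
  substP-*ₚ T P R e = begin
    coeff F (substP F (P *ₚ R) T) e                                                   ≈⟨ coeff-substP (P *ₚ R) T e ⟩
    linExt cT (P *ₚ R)                                                                ≈⟨ sumBy-*ₚ _ P R ⟩
    sumBy (λ t → sumBy (λ s → (proj₁ t * proj₁ s) * cT (proj₂ t +ₑ proj₂ s)) R) P
      ≈⟨ sumBy-cong P (λ t → trans (sumBy-cong R (λ s → *-assoc _ _ _)) (sym (sumBy-*ˡ _ _ R))) ⟩
    sumBy (λ t → proj₁ t * sumBy (λ s → proj₁ s * cT (proj₂ t +ₑ proj₂ s)) R) P       ≈⟨ sumBy-cong P (λ t → *-congˡ (inner (proj₂ t))) ⟨
    linExt (λ f → linExt (λ f′ → coeffShift (substP F R T) f′ e) (monomial T f)) P     ≈⟨ linExt-substP _ P T ⟨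
    linExt (λ f → coeffShift (substP F R T) f e) (substP F P T)                        ≈⟨ coeff-*ₚ (substP F P T) (substP F R T) e ⟨
    coeff F (substP F P T *ₚ substP F R T) e                                           ∎
    where
    cT : Exponent _ → Carrier
    cT f = coeff F (monomial T f) e
    inner : ∀ f → linExt (λ f′ → coeffShift (substP F R T) f′ e) (monomial T f) ≈ sumBy (λ s → proj₁ s * cT (f +ₑ proj₂ s)) R
    inner f = begin
      linExt (λ f′ → coeffShift (substP F R T) f′ e) (monomial T f)  ≈⟨ coeff-*ₚ (monomial T f) (substP F R T) e ⟨
      coeff F (monomial T f *ₚ substP F R T) e                       ≈⟨ *ₚ-comm (monomial T f) (substP F R T) e ⟩
      coeff F (substP F R T *ₚ monomial T f) e                       ≈⟨ coeff-*ₚ (substP F R T) (monomial T f) e ⟩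
      linExt (λ g → coeffShift (monomial T f) g e) (substP F R T)    ≈⟨ linExt-substP _ R T ⟩
      linExt (λ g → linExt (λ g′ → coeffShift (monomial T f) g′ e) (monomial T g)) R
        ≈⟨ linExt-congʳ R (λ g → begin
          linExt (λ g′ → coeffShift (monomial T f) g′ e) (monomial T g)  ≈⟨ coeff-*ₚ (monomial T g) (monomial T f) e ⟨
          coeff F (monomial T g *ₚ monomial T f) e                       ≈⟨ monomial-+ₑ T g f e ⟨
          coeff F (monomial T (g +ₑ f)) e                                ≡⟨ ≡.cong (λ h → coeff F (monomial T h) e) (+ₑ-comm g f) ⟩
          cT (f +ₑ g)                                                    ∎) ⟩
      sumBy (λ s → proj₁ s * cT (f +ₑ proj₂ s)) R                    ∎

  substP-1P : ∀ {k n} (T : Fin k → Poly F n) → substP F (1P F) T ≈ₚ 1P F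
  substP-1P T e = trans (coeff-substP (1P F) T e) (trans (+-identityʳ _) (trans (*-identityˡ _) (monomial-0ₑ T e)))

  substP-^ₚ : ∀ {k n} (T : Fin k → Poly F n) (P : Poly F k) i → substP F (P ^ₚ i) T ≈ₚ substP F P T ^ₚ i
  substP-^ₚ T P zero = substP-1P T
  substP-^ₚ T P (suc i) e = trans (substP-*ₚ T P (P ^ₚ i) e) (*ₚ-congʳ (substP F P T) _ _ (substP-^ₚ T P i) e)

  substP-monomial : ∀ {j k n} (T : Fin k → Poly F n) (Ps : Fin j → Poly F k) f →
                    substP F (monomial Ps f) T ≈ₚ monomial (λ i → substP F (Ps i) T) f
  substP-monomial T Ps [] = substP-1P T
  substP-monomial T Ps (x ∷ f) e = trans (substP-*ₚ T (Ps Fin.zero ^ₚ x) (monomial (λ i → Ps (Fin.suc i)) f) e)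
    (*ₚ-cong (substP F (Ps Fin.zero ^ₚ x) T) (substP F (Ps Fin.zero) T ^ₚ x)
             (substP F (monomial (λ i → Ps (Fin.suc i)) f) T) (monomial (λ i → substP F (Ps (Fin.suc i)) T) f)
             (substP-^ₚ T (Ps Fin.zero) x) (substP-monomial T (λ i → Ps (Fin.suc i)) f) e)

  substP-substP : ∀ {j k n} (T : Fin k → Poly F n) (G : Poly F j) (Ps : Fin j → Poly F k) →
                  substP F (substP F G Ps) T ≈ₚ substP F G (λ i → substP F (Ps i) T)
  substP-substP T G Ps e = begin
    coeff F (substP F (substP F G Ps) T) e                             ≈⟨ coeff-substP (substP F G Ps) T e ⟩
    linExt (λ f → coeff F (monomial T f) e) (substP F G Ps)            ≈⟨ linExt-substP _ G Ps ⟩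
    linExt (λ f → linExt (λ f′ → coeff F (monomial T f′) e) (monomial Ps f)) G
      ≈⟨ linExt-congʳ G (λ f → trans (sym (coeff-substP (monomial Ps f) T e)) (substP-monomial T Ps f e)) ⟩
    linExt (λ f → coeff F (monomial (λ i → substP F (Ps i) T) f) e) G  ≈⟨ coeff-substP G (λ i → substP F (Ps i) T) e ⟨
    coeff F (substP F G (λ i → substP F (Ps i) T)) e                   ∎

  substP-IsZero : ∀ {k n} (G : Poly F k) (Ts : Fin k → Poly F n) → IsZero F G → IsZero F (substP F G Ts)
  substP-IsZero G Ts G≈0 e = trans (coeff-substP G Ts e) (linExt-congˡ _ G [] G≈0)

  independent-cong : ∀ {k n} (Ps Ps′ : Fin k → Poly F n) → (∀ i → Ps i ≈ₚ Ps′ i) →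
                     AlgebraicallyIndependent F Ps → AlgebraicallyIndependent F Ps′
  independent-cong Ps Ps′ Ps≈Ps′ independent G G[Ps′]≈0 =
    independent G (λ e → trans (substP-congʳ G Ps Ps′ Ps≈Ps′ e) (G[Ps′]≈0 e))

  independent-substP : ∀ {k m n} (T : Fin m → Poly F n) (Ps : Fin k → Poly F m) →
                       AlgebraicallyIndependent F (λ i → substP F (Ps i) T) → AlgebraicallyIndependent F Ps
  independent-substP T Ps independent G G[Ps]≈0 = independent G (λ e →
    trans (sym (substP-substP T G Ps e)) (substP-IsZero (substP F G Ps) T G[Ps]≈0 e))

  module _ {n} (T : Fin 2 → Poly F n) where
    open import Algebra.Solver.CommutativeMonoid (*ₚ-commutativeMonoid n) using (solve; _⊜_; _⊕_; id)
    private
      T₀ = T Fin.zero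
      T₁ = T (Fin.suc Fin.zero)

    monomial-x¹ : monomial T (1 ∷ 0 ∷ []) ≈ₚ T₀
    monomial-x¹ = solve 1 (λ t → (t ⊕ id) ⊕ (id ⊕ id) ⊜ t) (λ _ → refl) T₀

    monomial-y¹ : monomial T (0 ∷ 1 ∷ []) ≈ₚ T₁
    monomial-y¹ = solve 1 (λ t → id ⊕ ((t ⊕ id) ⊕ id) ⊜ t) (λ _ → refl) T₁

    monomial-x² : monomial T (2 ∷ 0 ∷ []) ≈ₚ T₀ *ₚ T₀
    monomial-x² = solve 1 (λ t → (t ⊕ (t ⊕ id)) ⊕ (id ⊕ id) ⊜ t ⊕ t) (λ _ → refl) T₀

    monomial-xy : monomial T (1 ∷ 1 ∷ []) ≈ₚ T₀ *ₚ T₁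
    monomial-xy = solve 2 (λ t u → (t ⊕ id) ⊕ ((u ⊕ id) ⊕ id) ⊜ t ⊕ u) (λ _ → refl) T₀ T₁

    monomial-y² : monomial T (0 ∷ 2 ∷ []) ≈ₚ T₁ *ₚ T₁
    monomial-y² = solve 1 (λ u → id ⊕ ((u ⊕ (u ⊕ id)) ⊕ id) ⊜ u ⊕ u) (λ _ → refl) T₁

  module _ {n} (S : Poly F n) where

    coeff-square-0ₑ : coeff F (S *ₚ S) 0ₑ ≈ coeff F S 0ₑ * coeff F S 0ₑ
    coeff-square-0ₑ = begin
      coeff F (S *ₚ S) 0ₑ                                           ≈⟨ coeff-*ₚ-divisors S S 0ₑ ⟩
      sumBy (λ f → coeff F S f * coeffShift S f 0ₑ) (divisorsₑ 0ₑ)  ≡⟨ ≡.cong (sumBy _) (divisors-0ₑ n) ⟩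
      coeff F S 0ₑ * coeffShift S 0ₑ 0ₑ + 0#                        ≈⟨ +-identityʳ _ ⟩
      coeff F S 0ₑ * coeffShift S 0ₑ 0ₑ                             ≈⟨ *-congˡ (coeffShift-hit S 0ₑ 0ₑ 0ₑ (+ₑ-identityʳ 0ₑ)) ⟩
      coeff F S 0ₑ * coeff F S 0ₑ                                   ∎
      where
      divisors-0ₑ : ∀ n → divisorsₑ {n} 0ₑ ≡ 0ₑ ∷ []
      divisors-0ₑ zero = ≡.refl
      divisors-0ₑ (suc n) = ≡.trans (++-identityʳ _) (≡.cong (List.map (0 ∷_)) (divisors-0ₑ n))

    module _ (S₀≈0 : coeff F S 0ₑ ≈ 0#) where

      coeff-square-diagonal : ∀ f m → divisorsₑ m ≡ 0ₑ ∷ f ∷ m ∷ [] → f +ₑ f ≡ m →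
                              coeff F (S *ₚ S) m ≈ coeff F S f * coeff F S f
      coeff-square-diagonal f m divisors f+f≡m = begin
        coeff F (S *ₚ S) m                                                         ≈⟨ coeff-*ₚ-divisors S S m ⟩
        sumBy (λ g → coeff F S g * coeffShift S g m) (divisorsₑ m)                 ≡⟨ ≡.cong (sumBy _) divisors ⟩
        coeff F S 0ₑ * coeffShift S 0ₑ m + (coeff F S f * coeffShift S f m + (coeff F S m * coeffShift S m m + 0#))
          ≈⟨ +-cong (trans (*-congʳ S₀≈0) (zeroˡ _))
                    (+-cong (*-congˡ (coeffShift-hit S f f m f+f≡m))
                            (trans (+-identityʳ _) (trans (*-congˡ (trans (coeffShift-hit S m 0ₑ m (+ₑ-identityʳ m)) S₀≈0)) (zeroʳ _)))) ⟩
        0# + (coeff F S f * coeff F S f + 0#)                                      ≈⟨ trans (+-identityˡ _) (+-identityʳ _) ⟩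
        coeff F S f * coeff F S f                                                  ∎

      coeff-square-cross : ∀ f g m → divisorsₑ m ≡ 0ₑ ∷ f ∷ g ∷ m ∷ [] → f +ₑ g ≡ m →
                           coeff F (S *ₚ S) m ≈ coeff F S f * coeff F S g + coeff F S f * coeff F S g
      coeff-square-cross f g m divisors f+g≡m = begin
        coeff F (S *ₚ S) m                                                         ≈⟨ coeff-*ₚ-divisors S S m ⟩
        sumBy (λ h → coeff F S h * coeffShift S h m) (divisorsₑ m)                 ≡⟨ ≡.cong (sumBy _) divisors ⟩
        coeff F S 0ₑ * coeffShift S 0ₑ m + (coeff F S f * coeffShift S f m + (coeff F S g * coeffShift S g m + (coeff F S m * coeffShift S m m + 0#)))
          ≈⟨ +-cong (trans (*-congʳ S₀≈0) (zeroˡ _))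
                    (+-cong (*-congˡ (coeffShift-hit S f g m f+g≡m))
                            (+-cong (*-congˡ (coeffShift-hit S g f m (≡.trans (+ₑ-comm g f) f+g≡m)))
                                    (trans (+-identityʳ _) (trans (*-congˡ (trans (coeffShift-hit S m 0ₑ m (+ₑ-identityʳ m)) S₀≈0)) (zeroʳ _))))) ⟩
        0# + (coeff F S f * coeff F S g + (coeff F S g * coeff F S f + 0#))        ≈⟨ trans (+-identityˡ _) (+-congˡ (trans (+-identityʳ _) (*-comm _ _))) ⟩
        coeff F S f * coeff F S g + coeff F S f * coeff F S g                      ∎

module Variables {c ℓ : Level} (F : Field c ℓ) where

  open Exponents
  open Polynomials F
  open import Data.List.Relation.Unary.All using (All; []; _∷_; all?)
  open import Data.Empty using (⊥-elim)
  open import Data.List using ([]; _∷_)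
  open import Data.Nat as ℕ using (ℕ)
  open import Data.Nat.Properties as ℕ using ()
  open import Data.Fin.Permutation as Perm using (Permutation′)
  open import Data.Product using (_,_; proj₁; proj₂)
  open import Data.Vec as Vec using (_∷ʳ_)
  open import Data.Vec.Properties as Vecₚ using ()
  open import Relation.Nullary using (yes; no)
  open import Relation.Nullary.Decidable using (True; toWitness)
  open import Relation.Binary.PropositionalEquality as ≡ using (_≡_; _≢_)

  open Field F
  open import Relation.Binary.Reasoning.Setoid setoid

  Homogeneous : ∀ {n} → ℕ → Poly F n → Set ℓ
  Homogeneous d P = ∀ e → Vec.sum e ≢ d → coeff F P e ≈ 0#

  TermsOfDegree : ∀ {n} → ℕ → Poly F n → Set c
  TermsOfDegree d = All (λ t → Vec.sum (proj₂ t) ≡ d)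

  TermsOfDegree⇒Homogeneous : ∀ {n} d (P : Poly F n) → TermsOfDegree d P → Homogeneous d P
  TermsOfDegree⇒Homogeneous d [] _ e _ = refl
  TermsOfDegree⇒Homogeneous d ((a , f) ∷ P) (f-d ∷ P-d) e e≢d with f ≟ₑ e
  ... | yes ≡.refl = ⊥-elim (e≢d f-d)
  ... | no _ = TermsOfDegree⇒Homogeneous d P P-d e e≢d

  -- For explicitly given P the hypothesis is discharged by evaluation.
  homogeneous : ∀ {n} d (P : Poly F n) → {True (all? (λ t → Vec.sum (proj₂ t) ℕ.≟ d) P)} → Homogeneous d P
  homogeneous d P {P-d} = TermsOfDegree⇒Homogeneous d P (toWitness P-d)

  homogeneous-ext : ∀ {n d} {Monomial : Exponent n → Set} → (∀ e → Vec.sum e ≡ d → Monomial e) →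
                    (P R : Poly F n) → Homogeneous d P → Homogeneous d R →
                    (∀ e → Monomial e → coeff F P e ≈ coeff F R e) → P ≈ₚ R
  homogeneous-ext {d = d} monomials P R P-d R-d agree e with Vec.sum e ℕ.≟ d
  ... | yes deg≡d = agree e (monomials e deg≡d)
  ... | no deg≢d = trans (P-d e deg≢d) (sym (R-d e deg≢d))

  coeff-rename : ∀ {n} (σ : Permutation′ n) (P : Poly F n) e → coeff F (rename F σ P) e ≈ coeff F P (unpermuteₑ σ e)
  coeff-rename σ [] e = refl
  coeff-rename σ ((a , f) ∷ P) e with permuteₑ σ f ≟ₑ e | f ≟ₑ unpermuteₑ σ e
  ... | yes _ | yes _ = +-congˡ (coeff-rename σ P e)
  ... | yes σf≡e | no f≢ = ⊥-elim (f≢ (permuteₑ⇒unpermuteₑ σ f e σf≡e))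
  ... | no σf≢e | yes f≡ = ⊥-elim (σf≢e (unpermuteₑ⇒permuteₑ σ f e f≡))
  ... | no _ | no _ = coeff-rename σ P e

  δ-unpermuteₑ : ∀ {n} (σ : Permutation′ n) f e x → δ f (unpermuteₑ σ e) x ≈ δ (permuteₑ σ f) e x
  δ-unpermuteₑ σ f e x with f ≟ₑ unpermuteₑ σ e | permuteₑ σ f ≟ₑ e
  ... | yes _ | yes _ = refl
  ... | yes f≡ | no σf≢e = ⊥-elim (σf≢e (unpermuteₑ⇒permuteₑ σ f e f≡))
  ... | no f≢ | yes σf≡e = ⊥-elim (f≢ (permuteₑ⇒unpermuteₑ σ f e σf≡e))
  ... | no _ | no _ = refl

  rename-*ₚ : ∀ {n} (σ : Permutation′ n) (P R : Poly F n) → rename F σ (P *ₚ R) ≈ₚ rename F σ P *ₚ rename F σ R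
  rename-*ₚ σ P R e = begin
    coeff F (rename F σ (P *ₚ R)) e       ≈⟨ coeff-rename σ (P *ₚ R) e ⟩
    coeff F (P *ₚ R) (unpermuteₑ σ e)     ≈⟨ coeff-*ₚ-convolution P R (unpermuteₑ σ e) ⟩
    convolution P R (unpermuteₑ σ e)
      ≈⟨ sumBy-cong P (λ t → sumBy-cong R (λ s →
           trans (δ-unpermuteₑ σ _ e _) (δ-cong e (permuteₑ-+ₑ σ (proj₂ t) (proj₂ s)) refl))) ⟩
    sumBy (λ t → sumBy (λ s → δ (permuteₑ σ (proj₂ t) +ₑ permuteₑ σ (proj₂ s)) e (proj₁ t * proj₁ s)) R) P
      ≈⟨ reflexive (≡.trans (sumBy-map _ _ P) (sumBy-cong′ P (λ t → sumBy-map _ _ R))) ⟨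
    convolution (rename F σ P) (rename F σ R) e  ≈⟨ coeff-*ₚ-convolution (rename F σ P) (rename F σ R) e ⟨
    coeff F (rename F σ P *ₚ rename F σ R) e     ∎
    where
    sumBy-cong′ : ∀ {a} {A : Set a} {g h : A → Carrier} xs → (∀ x → g x ≡ h x) → sumBy g xs ≡ sumBy h xs
    sumBy-cong′ [] _ = ≡.refl
    sumBy-cong′ (x ∷ xs) g≡h = ≡.cong₂ _+_ (g≡h x) (sumBy-cong′ xs g≡h)

  rename-flip : ∀ {n} (σ : Permutation′ n) (P : Poly F n) → rename F (Perm.flip σ) (rename F σ P) ≈ₚ P
  rename-flip σ P e = begin
    coeff F (rename F (Perm.flip σ) (rename F σ P)) e              ≈⟨ coeff-rename (Perm.flip σ) (rename F σ P) e ⟩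
    coeff F (rename F σ P) (unpermuteₑ (Perm.flip σ) e)            ≈⟨ coeff-rename σ P _ ⟩
    coeff F P (unpermuteₑ σ (unpermuteₑ (Perm.flip σ) e))          ≡⟨ ≡.cong (coeff F P) (unpermuteₑ-flip σ e) ⟩
    coeff F P e                                                    ∎

  coeff-liftP-∷ʳ-zero : ∀ {n} (P : Poly F n) e → coeff F (liftP F P) (e ∷ʳ 0) ≈ coeff F P e
  coeff-liftP-∷ʳ-zero [] e = refl
  coeff-liftP-∷ʳ-zero ((a , f) ∷ P) e with f ∷ʳ 0 ≟ₑ e ∷ʳ 0 | f ≟ₑ e
  ... | yes _ | yes _ = +-congˡ (coeff-liftP-∷ʳ-zero P e)
  ... | yes f0≡e0 | no f≢e = ⊥-elim (f≢e (Vecₚ.∷ʳ-injectiveˡ f e f0≡e0))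
  ... | no f0≢e0 | yes ≡.refl = ⊥-elim (f0≢e0 ≡.refl)
  ... | no _ | no _ = coeff-liftP-∷ʳ-zero P e

  coeff-liftP-∷ʳ-nonzero : ∀ {n} (P : Poly F n) e m → m ≢ 0 → coeff F (liftP F P) (e ∷ʳ m) ≈ 0#
  coeff-liftP-∷ʳ-nonzero [] e m _ = refl
  coeff-liftP-∷ʳ-nonzero ((a , f) ∷ P) e m m≢0 with f ∷ʳ 0 ≟ₑ e ∷ʳ m
  ... | yes f0≡em = ⊥-elim (m≢0 (≡.sym (Vecₚ.∷ʳ-injectiveʳ f e f0≡em)))
  ... | no _ = coeff-liftP-∷ʳ-nonzero P e m m≢0

  coeff-lastVar^ : ∀ {n} j (e : Exponent n) k → k ≢ j → coeff F (lastVar^ F j) (e ∷ʳ k) ≈ 0#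
  coeff-lastVar^ j e k k≢j with 0ₑ ∷ʳ j ≟ₑ e ∷ʳ k
  ... | yes 0j≡ek = ⊥-elim (k≢j (≡.sym (Vecₚ.∷ʳ-injectiveʳ _ e 0j≡ek)))
  ... | no _ = refl

  coeff-liftP-*ₚ-lastVar^ : ∀ {n} (P : Poly F n) j e → coeff F (liftP F P *ₚ lastVar^ F j) (e ∷ʳ j) ≈ coeff F P e
  coeff-liftP-*ₚ-lastVar^ P j e = begin
    coeff F (liftP F P *ₚ lastVar^ F j) (e ∷ʳ j)       ≈⟨ *ₚ-comm (liftP F P) (lastVar^ F j) _ ⟩
    coeff F (lastVar^ F j *ₚ liftP F P) (e ∷ʳ j)       ≈⟨ coeff-term-*ₚ 1# (0ₑ ∷ʳ j) (liftP F P) _ ⟩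
    1# * coeffShift (liftP F P) (0ₑ ∷ʳ j) (e ∷ʳ j)     ≈⟨ *-identityˡ _ ⟩
    coeffShift (liftP F P) (0ₑ ∷ʳ j) (e ∷ʳ j)          ≈⟨ coeffShift-hit (liftP F P) (0ₑ ∷ʳ j) (e ∷ʳ 0) (e ∷ʳ j) shift ⟩
    coeff F (liftP F P) (e ∷ʳ 0)                       ≈⟨ coeff-liftP-∷ʳ-zero P e ⟩
    coeff F P e                                        ∎
    where
    shift : (0ₑ ∷ʳ j) +ₑ (e ∷ʳ 0) ≡ e ∷ʳ j
    shift = ≡.trans (∷ʳ-+ₑ 0ₑ e j 0) (≡.cong₂ _∷ʳ_ (+ₑ-identityˡ e) (ℕ.+-identityʳ j))

  coeff-liftP-*ₚ-lastVar^-≢ : ∀ {n} (P : Poly F n) j e k → k ≢ j → coeff F (liftP F P *ₚ lastVar^ F j) (e ∷ʳ k) ≈ 0#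
  coeff-liftP-*ₚ-lastVar^-≢ P j e k k≢j = begin
    coeff F (liftP F P *ₚ lastVar^ F j) (e ∷ʳ k)       ≈⟨ *ₚ-comm (liftP F P) (lastVar^ F j) _ ⟩
    coeff F (lastVar^ F j *ₚ liftP F P) (e ∷ʳ k)       ≈⟨ coeff-term-*ₚ 1# (0ₑ ∷ʳ j) (liftP F P) _ ⟩
    1# * coeffShift (liftP F P) (0ₑ ∷ʳ j) (e ∷ʳ k)     ≈⟨ *-identityˡ _ ⟩
    coeffShift (liftP F P) (0ₑ ∷ʳ j) (e ∷ʳ k)          ≈⟨ shift≈0 ⟩
    0#                                                 ∎
    where
    shift≈0 : coeffShift (liftP F P) (0ₑ ∷ʳ j) (e ∷ʳ k) ≈ 0#
    shift≈0 with (0ₑ ∷ʳ j) ∣ₑ? (e ∷ʳ k)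
    ... | no ∤ = coeffShift-miss (liftP F P) _ _ ∤
    ... | yes (g , p) with Vec.initLast g
    ...   | g′ , m , ≡.refl = trans (coeffShift-hit (liftP F P) _ (g′ ∷ʳ m) _ p)
                                    (coeff-liftP-∷ʳ-nonzero P g′ m m≢0)
      where
      j+m≡k : j ℕ.+ m ≡ k
      j+m≡k = Vecₚ.∷ʳ-injectiveʳ (0ₑ +ₑ g′) e (≡.trans (≡.sym (∷ʳ-+ₑ 0ₑ g′ j m)) p)
      m≢0 : m ≢ 0
      m≢0 m≡0 = k≢j (≡.trans (≡.sym j+m≡k) (≡.trans (≡.cong (j ℕ.+_) m≡0) (ℕ.+-identityʳ j)))

  Homogeneous-rename : ∀ {n d} (σ : Permutation′ n) (P : Poly F n) → Homogeneous d P → Homogeneous d (rename F σ P)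
  Homogeneous-rename σ P P-d e sum≢d =
    trans (coeff-rename σ P e) (P-d (unpermuteₑ σ e) (λ sum≡d → sum≢d (≡.trans (≡.sym (sum-unpermuteₑ σ e)) sum≡d)))

  AllVariablesAppear-rename : ∀ {n} (σ : Permutation′ n) (P : Poly F n) → AllVariablesAppear F (rename F σ P) → AllVariablesAppear F P
  AllVariablesAppear-rename σ P appear i with appear (σ Perm.⟨$⟩ˡ i)
  ... | e , e≉0 , eσᵢ≢0 = unpermuteₑ σ e , (λ ≈0 → e≉0 (trans (coeff-rename σ P e) ≈0)) ,
                          (λ eᵢ≡0 → eσᵢ≢0 (≡.trans (≡.sym (lookup-unpermuteₑ σ e i)) eᵢ≡0))

  unpermuteₑ-∘ₚ : ∀ {n} (π ρ : Permutation′ n) e → unpermuteₑ (π Perm.∘ₚ ρ) e ≡ unpermuteₑ ρ (unpermuteₑ π e)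
  unpermuteₑ-∘ₚ π ρ e = vec-ext _ _ λ j → ≡.trans (lookup-unpermuteₑ (π Perm.∘ₚ ρ) e j)
    (≡.sym (≡.trans (lookup-unpermuteₑ ρ (unpermuteₑ π e) j) (lookup-unpermuteₑ π e _)))

  rename-∘ₚ : ∀ {n} (π ρ : Permutation′ n) (P : Poly F n) → rename F (π Perm.∘ₚ ρ) P ≈ₚ rename F π (rename F ρ P)
  rename-∘ₚ π ρ P e = begin
    coeff F (rename F (π Perm.∘ₚ ρ) P) e              ≈⟨ coeff-rename (π Perm.∘ₚ ρ) P e ⟩
    coeff F P (unpermuteₑ (π Perm.∘ₚ ρ) e)            ≡⟨ ≡.cong (coeff F P) (unpermuteₑ-∘ₚ π ρ e) ⟩
    coeff F P (unpermuteₑ ρ (unpermuteₑ π e))         ≈⟨ coeff-rename ρ P _ ⟨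
    coeff F (rename F ρ P) (unpermuteₑ π e)           ≈⟨ coeff-rename π (rename F ρ P) e ⟨
    coeff F (rename F π (rename F ρ P)) e             ∎

module SmallMonomials where

  open import Data.Nat using (ℕ; suc)
  open import Data.Vec using (Vec; []; _∷_; sum)
  open import Relation.Binary.PropositionalEquality using (_≡_)

  data Linear₂ : Vec ℕ 2 → Set where
    x¹ : Linear₂ (1 ∷ 0 ∷ [])
    y¹ : Linear₂ (0 ∷ 1 ∷ [])

  data Quadratic₂ : Vec ℕ 2 → Set where
    x² : Quadratic₂ (2 ∷ 0 ∷ [])
    xy : Quadratic₂ (1 ∷ 1 ∷ [])
    y² : Quadratic₂ (0 ∷ 2 ∷ [])

  data Quadratic₃ : Vec ℕ 3 → Set where
    x² : Quadratic₃ (2 ∷ 0 ∷ 0 ∷ [])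
    y² : Quadratic₃ (0 ∷ 2 ∷ 0 ∷ [])
    z² : Quadratic₃ (0 ∷ 0 ∷ 2 ∷ [])
    yz : Quadratic₃ (0 ∷ 1 ∷ 1 ∷ [])
    xz : Quadratic₃ (1 ∷ 0 ∷ 1 ∷ [])
    xy : Quadratic₃ (1 ∷ 1 ∷ 0 ∷ [])

  linearMonomial₂ : ∀ e → sum e ≡ 1 → Linear₂ e
  linearMonomial₂ (1 ∷ 0 ∷ []) _ = x¹
  linearMonomial₂ (0 ∷ 1 ∷ []) _ = y¹
  linearMonomial₂ (0 ∷ 0 ∷ []) ()
  linearMonomial₂ (0 ∷ suc (suc _) ∷ []) ()
  linearMonomial₂ (1 ∷ suc _ ∷ []) ()
  linearMonomial₂ (suc (suc _) ∷ _ ∷ []) ()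

  quadraticMonomial₂ : ∀ e → sum e ≡ 2 → Quadratic₂ e
  quadraticMonomial₂ (2 ∷ 0 ∷ []) _ = x²
  quadraticMonomial₂ (1 ∷ 1 ∷ []) _ = xy
  quadraticMonomial₂ (0 ∷ 2 ∷ []) _ = y²
  quadraticMonomial₂ (0 ∷ 0 ∷ []) ()
  quadraticMonomial₂ (0 ∷ 1 ∷ []) ()
  quadraticMonomial₂ (0 ∷ suc (suc (suc _)) ∷ []) ()
  quadraticMonomial₂ (1 ∷ 0 ∷ []) ()
  quadraticMonomial₂ (1 ∷ suc (suc _) ∷ []) ()
  quadraticMonomial₂ (2 ∷ suc _ ∷ []) ()
  quadraticMonomial₂ (suc (suc (suc _)) ∷ _ ∷ []) ()

  quadraticMonomial₃ : ∀ e → sum e ≡ 2 → Quadratic₃ e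
  quadraticMonomial₃ (2 ∷ 0 ∷ 0 ∷ []) _ = x²
  quadraticMonomial₃ (0 ∷ 2 ∷ 0 ∷ []) _ = y²
  quadraticMonomial₃ (0 ∷ 0 ∷ 2 ∷ []) _ = z²
  quadraticMonomial₃ (0 ∷ 1 ∷ 1 ∷ []) _ = yz
  quadraticMonomial₃ (1 ∷ 0 ∷ 1 ∷ []) _ = xz
  quadraticMonomial₃ (1 ∷ 1 ∷ 0 ∷ []) _ = xy
  quadraticMonomial₃ (0 ∷ 0 ∷ 0 ∷ []) ()
  quadraticMonomial₃ (0 ∷ 0 ∷ 1 ∷ []) ()
  quadraticMonomial₃ (0 ∷ 0 ∷ suc (suc (suc _)) ∷ []) ()
  quadraticMonomial₃ (0 ∷ 1 ∷ 0 ∷ []) ()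
  quadraticMonomial₃ (0 ∷ 1 ∷ suc (suc _) ∷ []) ()
  quadraticMonomial₃ (0 ∷ 2 ∷ suc _ ∷ []) ()
  quadraticMonomial₃ (0 ∷ suc (suc (suc _)) ∷ _ ∷ []) ()
  quadraticMonomial₃ (1 ∷ 0 ∷ 0 ∷ []) ()
  quadraticMonomial₃ (1 ∷ 0 ∷ suc (suc _) ∷ []) ()
  quadraticMonomial₃ (1 ∷ 1 ∷ suc _ ∷ []) ()
  quadraticMonomial₃ (1 ∷ suc (suc _) ∷ _ ∷ []) ()
  quadraticMonomial₃ (2 ∷ 0 ∷ suc _ ∷ []) ()
  quadraticMonomial₃ (2 ∷ suc _ ∷ _ ∷ []) ()
  quadraticMonomial₃ (suc (suc (suc _)) ∷ _ ∷ _ ∷ []) ()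

module LeadingTerms {c ℓ : Level} (F : Field c ℓ) where

  open Exponents
  open Polynomials F
  open FieldProperties F using (_^_; 1≉0; *-nonzero; ^-nonzero; x*y≈0∧y≉0⇒x≈0)
  open import Data.Empty using (⊥-elim)
  open import Data.Fin as Fin using (Fin)
  open import Data.List using ([]; _∷_)
  open import Data.Nat as ℕ using (ℕ; zero; suc; _∸_; _≤_; _<_; _⊔_)
  open import Data.Nat.Properties as ℕ using ()
  open import Data.Product using (_×_; _,_)
  open import Data.Sum using (_⊎_; inj₁; inj₂)
  open import Data.Vec as Vec using ([]; _∷_)
  open import Relation.Binary using (tri<; tri≈; tri>)
  open import Relation.Nullary using (¬_; yes; no)
  open import Relation.Binary.PropositionalEquality as ≡ using (_≡_; _≢_)

  open Field F
  open import Relation.Binary.Reasoning.Setoid setoid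

  yDeg : Exponent 2 → ℕ
  yDeg (_ ∷ j ∷ []) = j

  yDeg-+ₑ : ∀ f g → yDeg (f +ₑ g) ≡ yDeg f ℕ.+ yDeg g
  yDeg-+ₑ (_ ∷ _ ∷ []) (_ ∷ _ ∷ []) = ≡.refl

  top : ℕ → ℕ → Exponent 2
  top d m = (d ∸ m) ∷ m ∷ []

  -- A YBounded d m polynomial has leading monomial top d m = x^(d-m) y^m.
  YBounded : ℕ → ℕ → Poly F 2 → Set ℓ
  YBounded d m P = ∀ e → Vec.sum e ≢ d ⊎ m < yDeg e → coeff F P e ≈ 0#

  sum₂ : ∀ i j → Vec.sum (i ∷ j ∷ []) ≡ i ℕ.+ j
  sum₂ i j = ≡.cong (i ℕ.+_) (ℕ.+-identityʳ j)

  top-unique : ∀ (f : Exponent 2) d m → Vec.sum f ≡ d → yDeg f ≡ m → f ≡ top d m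
  top-unique (i ∷ j ∷ []) d m sum≡d ≡.refl =
    ≡.cong (_∷ j ∷ []) (≡.sym (≡.trans (≡.cong (_∸ j) (≡.trans (≡.sym sum≡d) (sum₂ i j))) (ℕ.m+n∸n≡m i j)))

  sum-top : ∀ d m → m ≤ d → Vec.sum (top d m) ≡ d
  sum-top d m m≤d = ≡.trans (sum₂ (d ∸ m) m) (ℕ.m∸n+n≡m m≤d)

  top-+ₑ : ∀ d₁ m₁ d₂ m₂ → m₁ ≤ d₁ → m₂ ≤ d₂ → top d₁ m₁ +ₑ top d₂ m₂ ≡ top (d₁ ℕ.+ d₂) (m₁ ℕ.+ m₂)
  top-+ₑ d₁ m₁ d₂ m₂ m₁≤d₁ m₂≤d₂ = ≡.cong (_∷ m₁ ℕ.+ m₂ ∷ [])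
    (≡.sym (≡.trans (≡.cong (_∸ (m₁ ℕ.+ m₂)) (≡.sym split)) (ℕ.m+n∸n≡m _ (m₁ ℕ.+ m₂))))
    where
    open import Algebra.Properties.CommutativeSemigroup ℕ.+-commutativeSemigroup using (interchange)
    split : (d₁ ∸ m₁) ℕ.+ (d₂ ∸ m₂) ℕ.+ (m₁ ℕ.+ m₂) ≡ d₁ ℕ.+ d₂
    split = ≡.trans (interchange (d₁ ∸ m₁) (d₂ ∸ m₂) m₁ m₂) (≡.cong₂ ℕ._+_ (ℕ.m∸n+n≡m m₁≤d₁) (ℕ.m∸n+n≡m m₂≤d₂))

  off-top-vanishes : ∀ P R {d₁ m₁ d₂ m₂} → YBounded d₁ m₁ P → YBounded d₂ m₂ R → ∀ f e →
                     (Vec.sum e ≢ d₁ ℕ.+ d₂ ⊎ m₁ ℕ.+ m₂ < yDeg e) ⊎ (yDeg f < m₁ × e ≡ top (d₁ ℕ.+ d₂) (m₁ ℕ.+ m₂)) →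
                     coeff F P f * coeffShift R f e ≈ 0#
  off-top-vanishes P R {d₁} {m₁} {d₂} {m₂} P-bounded R-bounded f e outside
    with Vec.sum f ℕ.≟ d₁ | yDeg f ℕ.≤? m₁ | f ∣ₑ? e
  ... | no deg≢ | _ | _ = trans (*-congʳ (P-bounded f (inj₁ deg≢))) (zeroˡ _)
  ... | yes _ | no y> | _ = trans (*-congʳ (P-bounded f (inj₂ (ℕ.≰⇒> y>)))) (zeroˡ _)
  ... | yes _ | yes _ | no f∤e = trans (*-congˡ (coeffShift-miss R f e f∤e)) (zeroʳ _)
  ... | yes deg≡ | yes y≤ | yes (g , f+g≡e) =
    trans (*-congˡ (trans (coeffShift-hit R f g e f+g≡e) (R-bounded g (g-outside outside)))) (zeroʳ _)
    where
    sum-e : Vec.sum e ≡ Vec.sum f ℕ.+ Vec.sum g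
    sum-e = ≡.trans (≡.cong Vec.sum (≡.sym f+g≡e)) (sum-+ₑ f g)
    yDeg-e : yDeg e ≡ yDeg f ℕ.+ yDeg g
    yDeg-e = ≡.trans (≡.cong yDeg (≡.sym f+g≡e)) (yDeg-+ₑ f g)
    g-outside : (Vec.sum e ≢ d₁ ℕ.+ d₂ ⊎ m₁ ℕ.+ m₂ < yDeg e) ⊎ (yDeg f < m₁ × e ≡ top (d₁ ℕ.+ d₂) (m₁ ℕ.+ m₂)) →
                Vec.sum g ≢ d₂ ⊎ m₂ < yDeg g
    g-outside (inj₁ (inj₁ deg≢)) = inj₁ λ g≡d₂ → deg≢ (≡.trans sum-e (≡.cong₂ ℕ._+_ deg≡ g≡d₂))
    g-outside (inj₁ (inj₂ m<y)) = inj₂ (ℕ.+-cancelˡ-< m₁ m₂ (yDeg g)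
      (ℕ.<-≤-trans (≡.subst (m₁ ℕ.+ m₂ <_) yDeg-e m<y) (ℕ.+-monoˡ-≤ (yDeg g) y≤)))
    g-outside (inj₂ (y< , ≡.refl)) = inj₂ (ℕ.+-cancelˡ-< m₁ m₂ (yDeg g)
      (ℕ.≤-<-trans (ℕ.≤-reflexive yDeg-e) (ℕ.+-monoˡ-< (yDeg g) y<)))

  *ₚ-YBounded : ∀ P R {d₁ m₁ d₂ m₂} → YBounded d₁ m₁ P → YBounded d₂ m₂ R → YBounded (d₁ ℕ.+ d₂) (m₁ ℕ.+ m₂) (P *ₚ R)
  *ₚ-YBounded P R P-bounded R-bounded e outside = trans (coeff-*ₚ P R e)
    (linExt-zero _ P (λ f → off-top-vanishes P R P-bounded R-bounded f e (inj₁ outside)))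

  coeff-top-*ₚ : ∀ P R {d₁ m₁ d₂ m₂} → YBounded d₁ m₁ P → YBounded d₂ m₂ R → m₁ ≤ d₁ → m₂ ≤ d₂ →
                 coeff F (P *ₚ R) (top (d₁ ℕ.+ d₂) (m₁ ℕ.+ m₂)) ≈ coeff F P (top d₁ m₁) * coeff F R (top d₂ m₂)
  coeff-top-*ₚ P R {d₁} {m₁} {d₂} {m₂} P-bounded R-bounded m₁≤d₁ m₂≤d₂ = begin
    coeff F (P *ₚ R) e                                   ≈⟨ coeff-*ₚ P R e ⟩
    linExt (λ f → coeffShift R f e) P                    ≈⟨ linExt-point _ P (top d₁ m₁) off-top ⟩
    coeff F P (top d₁ m₁) * coeffShift R (top d₁ m₁) e   ≈⟨ *-congˡ (coeffShift-hit R _ _ e (top-+ₑ d₁ m₁ d₂ m₂ m₁≤d₁ m₂≤d₂)) ⟩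
    coeff F P (top d₁ m₁) * coeff F R (top d₂ m₂)        ∎
    where
    e = top (d₁ ℕ.+ d₂) (m₁ ℕ.+ m₂)
    off-top : ∀ f → f ≢ top d₁ m₁ → coeff F P f * coeffShift R f e ≈ 0#
    off-top f f≢top with Vec.sum f ℕ.≟ d₁ | yDeg f ℕ.≤? m₁
    ... | no deg≢ | _ = trans (*-congʳ (P-bounded f (inj₁ deg≢))) (zeroˡ _)
    ... | yes _ | no y> = trans (*-congʳ (P-bounded f (inj₂ (ℕ.≰⇒> y>)))) (zeroˡ _)
    ... | yes deg≡ | yes y≤ with ℕ.m≤n⇒m<n∨m≡n y≤
    ...   | inj₁ y< = off-top-vanishes P R P-bounded R-bounded f e (inj₂ (y< , ≡.refl))
    ...   | inj₂ y≡ = ⊥-elim (f≢top (top-unique f d₁ m₁ deg≡ y≡))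

  1P-YBounded : YBounded 0 0 (1P F)
  1P-YBounded (0 ∷ 0 ∷ []) (inj₁ 0≢0) = ⊥-elim (0≢0 ≡.refl)
  1P-YBounded (0 ∷ suc _ ∷ []) _ = refl
  1P-YBounded (suc _ ∷ _ ∷ []) _ = refl

  ^ₚ-YBounded : ∀ P {d m} i → YBounded d m P → YBounded (i ℕ.* d) (i ℕ.* m) (P ^ₚ i)
  ^ₚ-YBounded P zero P-bounded = 1P-YBounded
  ^ₚ-YBounded P (suc i) P-bounded = *ₚ-YBounded P (P ^ₚ i) P-bounded (^ₚ-YBounded P i P-bounded)

  coeff-top-^ₚ : ∀ P {d m} i → YBounded d m P → m ≤ d →
                 coeff F (P ^ₚ i) (top (i ℕ.* d) (i ℕ.* m)) ≈ coeff F P (top d m) ^ i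
  coeff-top-^ₚ P zero P-bounded m≤d = +-identityʳ 1#
  coeff-top-^ₚ P (suc i) P-bounded m≤d = trans
    (coeff-top-*ₚ P (P ^ₚ i) P-bounded (^ₚ-YBounded P i P-bounded) m≤d (ℕ.*-monoʳ-≤ i m≤d))
    (*-congˡ (coeff-top-^ₚ P i P-bounded m≤d))

  maxYDeg : Poly F 2 → ℕ
  maxYDeg [] = 0
  maxYDeg ((a , f) ∷ G) = yDeg f ⊔ maxYDeg G

  coeff-above-maxYDeg : ∀ (G : Poly F 2) i j → maxYDeg G < j → coeff F G (i ∷ j ∷ []) ≈ 0#
  coeff-above-maxYDeg [] i j _ = refl
  coeff-above-maxYDeg ((a , f) ∷ G) i j max<j with f ≟ₑ i ∷ j ∷ []
  ... | yes ≡.refl = ⊥-elim (ℕ.<-irrefl ≡.refl (ℕ.≤-<-trans (ℕ.m≤m⊔n j (maxYDeg G)) max<j))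
  ... | no _ = coeff-above-maxYDeg G i j (ℕ.≤-<-trans (ℕ.m≤n⊔m (yDeg f) (maxYDeg G)) max<j)

  -- The monomials P₀ⁱ P₁ʲ have pairwise distinct leading exponents
  -- (i d₀ + j d₁ , j m), so a relation G(P₀, P₁) = 0 forces the
  -- coefficients of G to vanish, by descending induction on j.
  leadingTerms⇒independent : ∀ (Ps : Fin 2 → Poly F 2) {d₀ d₁ m} → 1 ≤ d₀ → 1 ≤ m → m ≤ d₁ →
    YBounded d₀ 0 (Ps Fin.zero) → ¬ coeff F (Ps Fin.zero) (top d₀ 0) ≈ 0# →
    YBounded d₁ m (Ps (Fin.suc Fin.zero)) → ¬ coeff F (Ps (Fin.suc Fin.zero)) (top d₁ m) ≈ 0# →
    AlgebraicallyIndependent F Ps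
  leadingTerms⇒independent Ps {d₀} {d₁} {m} 1≤d₀ 1≤m m≤d₁ P₀-bounded P₀-lead P₁-bounded P₁-lead G G[Ps]≈0 (i ∷ j ∷ []) =
    vanishes-from (suc (maxYDeg G)) j (ℕ.<-≤-trans (ℕ.n<1+n (maxYDeg G)) (ℕ.m≤n+m (suc (maxYDeg G)) j)) i
    where
    P₀ = Ps Fin.zero
    P₁ = Ps (Fin.suc Fin.zero)
    deg yd : ℕ → ℕ → ℕ
    deg i j = i ℕ.* d₀ ℕ.+ (j ℕ.* d₁ ℕ.+ 0)
    yd i j = i ℕ.* 0 ℕ.+ (j ℕ.* m ℕ.+ 0)
    yd≤deg : ∀ i j → yd i j ≤ deg i j
    yd≤deg i j = ℕ.+-mono-≤ (ℕ.*-monoʳ-≤ i ℕ.z≤n) (ℕ.+-monoˡ-≤ 0 (ℕ.*-monoʳ-≤ j m≤d₁))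
    P₁ʲ-bounded : ∀ j → YBounded (j ℕ.* d₁ ℕ.+ 0) (j ℕ.* m ℕ.+ 0) (P₁ ^ₚ j *ₚ 1P F)
    P₁ʲ-bounded j = *ₚ-YBounded (P₁ ^ₚ j) (1P F) (^ₚ-YBounded P₁ j P₁-bounded) 1P-YBounded
    monomial-bounded : ∀ i j → YBounded (deg i j) (yd i j) (monomial Ps (i ∷ j ∷ []))
    monomial-bounded i j = *ₚ-YBounded (P₀ ^ₚ i) (P₁ ^ₚ j *ₚ 1P F) (^ₚ-YBounded P₀ i P₀-bounded) (P₁ʲ-bounded j)
    monomial-lead : ∀ i j → coeff F (monomial Ps (i ∷ j ∷ [])) (top (deg i j) (yd i j)) ≈
                            coeff F P₀ (top d₀ 0) ^ i * (coeff F P₁ (top d₁ m) ^ j * 1#)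
    monomial-lead i j = begin
      coeff F (monomial Ps (i ∷ j ∷ [])) (top (deg i j) (yd i j))
        ≈⟨ coeff-top-*ₚ (P₀ ^ₚ i) (P₁ ^ₚ j *ₚ 1P F) (^ₚ-YBounded P₀ i P₀-bounded) (P₁ʲ-bounded j)
                        (ℕ.*-monoʳ-≤ i ℕ.z≤n) (ℕ.+-monoˡ-≤ 0 (ℕ.*-monoʳ-≤ j m≤d₁)) ⟩
      coeff F (P₀ ^ₚ i) (top (i ℕ.* d₀) (i ℕ.* 0)) * coeff F (P₁ ^ₚ j *ₚ 1P F) (top (j ℕ.* d₁ ℕ.+ 0) (j ℕ.* m ℕ.+ 0))
        ≈⟨ *-cong (coeff-top-^ₚ P₀ i P₀-bounded ℕ.z≤n)
                  (coeff-top-*ₚ (P₁ ^ₚ j) (1P F) (^ₚ-YBounded P₁ j P₁-bounded) 1P-YBounded (ℕ.*-monoʳ-≤ j m≤d₁) ℕ.z≤n) ⟩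
      coeff F P₀ (top d₀ 0) ^ i * (coeff F (P₁ ^ₚ j) (top (j ℕ.* d₁) (j ℕ.* m)) * (1# + 0#))
        ≈⟨ *-congˡ (*-cong (coeff-top-^ₚ P₁ j P₁-bounded m≤d₁) (+-identityʳ 1#)) ⟩
      coeff F P₀ (top d₀ 0) ^ i * (coeff F P₁ (top d₁ m) ^ j * 1#)  ∎
    monomial-lead≉0 : ∀ i j → ¬ coeff F (monomial Ps (i ∷ j ∷ [])) (top (deg i j) (yd i j)) ≈ 0#
    monomial-lead≉0 i j lead≈0 =
      *-nonzero (^-nonzero P₀-lead i) (*-nonzero (^-nonzero P₁-lead j) 1≉0) (trans (sym (monomial-lead i j)) lead≈0)
    yd< : ∀ i i′ j j′ → j′ < j → yd i′ j′ < yd i j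
    yd< i i′ j j′ j′<j = ≡.subst₂ _<_ (≡.sym (yd≡ i′ j′)) (≡.sym (yd≡ i j))
                                    (ℕ.<-≤-trans (ℕ.m<n+m (j′ ℕ.* m) 1≤m) (ℕ.*-monoˡ-≤ m j′<j))
      where
      yd≡ : ∀ i j → yd i j ≡ j ℕ.* m
      yd≡ i j = ≡.cong₂ ℕ._+_ (ℕ.*-zeroʳ i) (ℕ.+-identityʳ (j ℕ.* m))
    deg-injective : ∀ i i′ j → deg i j ≡ deg i′ j → i ≡ i′
    deg-injective i i′ j eq = ℕ.*-cancelʳ-≡ i i′ d₀ {{ℕ.>-nonZero 1≤d₀}} (ℕ.+-cancelʳ-≡ (j ℕ.* d₁ ℕ.+ 0) _ _ eq)
    top-coefficient : ∀ i j → (∀ i′ j′ → j < j′ → coeff F G (i′ ∷ j′ ∷ []) ≈ 0#) → coeff F G (i ∷ j ∷ []) ≈ 0#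
    top-coefficient i j higher≈0 = x*y≈0∧y≉0⇒x≈0 G[Ps]-at-e (monomial-lead≉0 i j)
      where
      e = top (deg i j) (yd i j)
      others : ∀ f → f ≢ i ∷ j ∷ [] → coeff F G f * coeff F (monomial Ps f) e ≈ 0#
      others (i′ ∷ j′ ∷ []) f≢ with ℕ.<-cmp j j′
      ... | tri< j<j′ _ _ = trans (*-congʳ (higher≈0 i′ j′ j<j′)) (zeroˡ _)
      ... | tri> _ _ j′<j = trans (*-congˡ (monomial-bounded i′ j′ e (inj₂ (yd< i i′ j j′ j′<j)))) (zeroʳ _)
      ... | tri≈ _ ≡.refl _ = trans (*-congˡ (monomial-bounded i′ j e (inj₁ λ deg≡ →
              f≢ (≡.cong (_∷ j ∷ []) (≡.sym (deg-injective i i′ j (≡.trans (≡.sym (sum-top _ _ (yd≤deg i j))) deg≡))))))) (zeroʳ _)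
      G[Ps]-at-e : coeff F G (i ∷ j ∷ []) * coeff F (monomial Ps (i ∷ j ∷ [])) e ≈ 0#
      G[Ps]-at-e = trans (sym (linExt-point _ G (i ∷ j ∷ []) others)) (trans (sym (coeff-substP G Ps e)) (G[Ps]≈0 e))
    vanishes-from : ∀ n j → maxYDeg G < j ℕ.+ n → ∀ i → coeff F G (i ∷ j ∷ []) ≈ 0#
    vanishes-from zero j max< i = coeff-above-maxYDeg G i j (≡.subst (maxYDeg G <_) (ℕ.+-identityʳ j) max<)
    vanishes-from (suc n) j max< i = top-coefficient i j λ i′ j′ j<j′ →
      vanishes-from n j′ (ℕ.<-≤-trans max< (≡.subst (_≤ j′ ℕ.+ n) (≡.sym (ℕ.+-suc j n)) (ℕ.+-monoˡ-≤ n j<j′))) i′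

module BinaryForms {c ℓ : Level} (F : Field c ℓ) where

  open Exponents
  open Polynomials F
  open Variables F using (homogeneous; homogeneous-ext)
  open LeadingTerms F using (YBounded; leadingTerms⇒independent)
  open FieldProperties F using (2#; x+x≈2#*x; 1≉0; inv; *-inv)
  open SmallMonomials
  import Algebra.Properties.Ring as RingProperties
  open import Data.Empty using (⊥-elim)
  open import Data.Fin as Fin using (Fin)
  open import Data.List using ([]; _∷_)
  open import Data.Nat as ℕ using ()
  open import Data.Nat.Properties as ℕ using ()
  open import Data.Product using (Σ; _×_; _,_; proj₁)
  open import Data.Sum using (_⊎_; inj₁; inj₂)
  open import Data.Vec as Vec using ([]; _∷_)
  open import Relation.Binary using (Decidable)
  open import Relation.Nullary using (¬_; yes; no)
  import Relation.Binary.PropositionalEquality as ≡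

  open Field F
  open RingProperties ring using (-‿distribˡ-*; -‿distribʳ-*; -‿involutive)
  open import Algebra.Properties.AbelianGroup +-abelianGroup using (inverseʳ-unique; ⁻¹-∙-comm)
  open import Algebra.Solver.CommutativeMonoid *-commutativeMonoid using (solve; _⊜_; _⊕_)
  open import Relation.Binary.Reasoning.Setoid setoid

  linearForm₂ : Carrier → Carrier → Poly F 2
  linearForm₂ α β = (α , 1 ∷ 0 ∷ []) ∷ (β , 0 ∷ 1 ∷ []) ∷ []

  quadraticForm₂ : Carrier → Carrier → Carrier → Poly F 2
  quadraticForm₂ A B C = (A , 2 ∷ 0 ∷ []) ∷ (B , 1 ∷ 1 ∷ []) ∷ (C , 0 ∷ 2 ∷ []) ∷ []

  pair : ∀ {n} → Poly F n → Poly F n → Fin 2 → Poly F n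
  pair P₀ P₁ Fin.zero = P₀
  pair P₀ P₁ (Fin.suc Fin.zero) = P₁

  SquareMultiple : Carrier → Carrier → Carrier → Carrier → Carrier → Set (c Level.⊔ ℓ)
  SquareMultiple α β A B C = Σ Carrier λ l → A ≈ l * (α * α) × B ≈ 2# * (l * (α * β)) × C ≈ l * (β * β)

  squareMultiple-cong : ∀ {α β A B C α′ β′ A′ B′ C′} → α ≈ α′ → β ≈ β′ → A ≈ A′ → B ≈ B′ → C ≈ C′ →
                        SquareMultiple α β A B C → SquareMultiple α′ β′ A′ B′ C′
  squareMultiple-cong α≈ β≈ A≈ B≈ C≈ (l , A≈lαα , B≈2lαβ , C≈lββ) =
    l , trans (sym A≈) (trans A≈lαα (*-congˡ (*-cong α≈ α≈))) ,
        trans (sym B≈) (trans B≈2lαβ (*-congˡ (*-congˡ (*-cong α≈ β≈)))) ,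
        trans (sym C≈) (trans C≈lββ (*-congˡ (*-cong β≈ β≈)))

  squareMultiple-swap : ∀ {α β A B C} → SquareMultiple β α C B A → SquareMultiple α β A B C
  squareMultiple-swap (l , C≈lββ , B≈2lβα , A≈lαα) = l , A≈lαα , trans B≈2lβα (*-congˡ (*-congˡ (*-comm _ _))) , C≈lββ

  squareMultiple⇒discriminant : ∀ {α β A B C} → SquareMultiple α β A B C → B * B ≈ (2# * 2#) * (A * C)
  squareMultiple⇒discriminant {α} {β} {A} {B} {C} (l , A≈lαα , B≈2lαβ , C≈lββ) = begin
    B * B                                                 ≈⟨ *-cong B≈2lαβ B≈2lαβ ⟩
    (2# * (l * (α * β))) * (2# * (l * (α * β)))           ≈⟨ solve 4 (λ t l a b → (t ⊕ (l ⊕ (a ⊕ b))) ⊕ (t ⊕ (l ⊕ (a ⊕ b))) ⊜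
                                                                                (t ⊕ t) ⊕ ((l ⊕ (a ⊕ a)) ⊕ (l ⊕ (b ⊕ b)))) refl 2# l α β ⟩
    (2# * 2#) * ((l * (α * α)) * (l * (β * β)))           ≈⟨ *-congˡ (*-cong A≈lαα C≈lββ) ⟨
    (2# * 2#) * (A * C)                                   ∎

  squareMultiple⇒mixed : ∀ {α β A B C} → SquareMultiple α β A B C → 2# * (A * β) ≈ B * α
  squareMultiple⇒mixed {α} {β} {A} {B} (l , A≈lαα , B≈2lαβ , _) = begin
    2# * (A * β)                    ≈⟨ *-congˡ (*-congʳ A≈lαα) ⟩
    2# * ((l * (α * α)) * β)        ≈⟨ solve 4 (λ t l a b → t ⊕ ((l ⊕ (a ⊕ a)) ⊕ b) ⊜ (t ⊕ (l ⊕ (a ⊕ b))) ⊕ a) refl 2# l α β ⟩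
    (2# * (l * (α * β))) * α        ≈⟨ *-congʳ B≈2lαβ ⟨
    B * α                           ∎

  squareMultiple⇒≈ₚ : ∀ {α β A B C} (square : SquareMultiple α β A B C) →
                      quadraticForm₂ A B C ≈ₚ constP F (proj₁ square) *ₚ (linearForm₂ α β *ₚ linearForm₂ α β)
  squareMultiple⇒≈ₚ {α} {β} {A} {B} {C} (l , A≈lαα , B≈2lαβ , C≈lββ) =
    homogeneous-ext quadraticMonomial₂ R lL² (homogeneous 2 R) (homogeneous 2 lL²) agree
    where
    R = quadraticForm₂ A B C
    lL² = constP F l *ₚ (linearForm₂ α β *ₚ linearForm₂ α β)
    agree : ∀ e → Quadratic₂ e → coeff F R e ≈ coeff F lL² e
    agree _ x² = +-congʳ A≈lαα
    agree _ xy = begin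
      B + 0#                                 ≈⟨ +-identityʳ B ⟩
      B                                      ≈⟨ B≈2lαβ ⟩
      2# * (l * (α * β))                     ≈⟨ x+x≈2#*x _ ⟨
      l * (α * β) + l * (α * β)              ≈⟨ +-cong refl (trans (*-congˡ (*-comm α β)) (sym (+-identityʳ _))) ⟩
      l * (α * β) + (l * (β * α) + 0#)       ∎
    agree _ y² = +-congʳ C≈lββ

  independent⇒nonzero : ∀ {n} (Ps : Fin 2 → Poly F n) → AlgebraicallyIndependent F Ps → ¬ IsZero F (Ps Fin.zero)
  independent⇒nonzero Ps independent P₀≈0 = 1≉0 (trans (sym (+-identityʳ 1#)) (independent X G[Ps]≈0 (1 ∷ 0 ∷ [])))
    where
    X : Poly F 2
    X = (1# , 1 ∷ 0 ∷ []) ∷ []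
    G[Ps]≈0 : IsZero F (substP F X Ps)
    G[Ps]≈0 e = trans (coeff-substP X Ps e) (trans (+-identityʳ _) (trans (*-identityˡ _) (trans (monomial-x¹ Ps e) (P₀≈0 e))))

  -- G = Y - l X² is the relation.
  independent⇒notSquareMultiple : ∀ {n} (Ps : Fin 2 → Poly F n) → AlgebraicallyIndependent F Ps →
                                   ∀ l → ¬ Ps (Fin.suc Fin.zero) ≈ₚ constP F l *ₚ (Ps Fin.zero *ₚ Ps Fin.zero)
  independent⇒notSquareMultiple Ps independent l P₁≈lP₀² =
    1≉0 (trans (sym (+-identityʳ 1#)) (independent G G[Ps]≈0 (0 ∷ 1 ∷ [])))
    where
    P₀ = Ps Fin.zero
    P₁ = Ps (Fin.suc Fin.zero)
    G : Poly F 2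
    G = (1# , 0 ∷ 1 ∷ []) ∷ (- l , 2 ∷ 0 ∷ []) ∷ []
    G[Ps]≈0 : IsZero F (substP F G Ps)
    G[Ps]≈0 e = begin
      coeff F (substP F G Ps) e
        ≈⟨ coeff-substP G Ps e ⟩
      1# * coeff F (monomial Ps (0 ∷ 1 ∷ [])) e + (- l * coeff F (monomial Ps (2 ∷ 0 ∷ [])) e + 0#)
        ≈⟨ +-cong (trans (*-identityˡ _) (monomial-y¹ Ps e)) (trans (+-identityʳ _) (*-congˡ (monomial-x² Ps e))) ⟩
      coeff F P₁ e + - l * coeff F (P₀ *ₚ P₀) e
        ≈⟨ +-cong (trans (P₁≈lP₀² e) (coeff-constP-*ₚ l (P₀ *ₚ P₀) e)) (sym (-‿distribˡ-* l (coeff F (P₀ *ₚ P₀) e))) ⟩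
      l * coeff F (P₀ *ₚ P₀) e - l * coeff F (P₀ *ₚ P₀) e
        ≈⟨ -‿inverseʳ _ ⟩
      0#
        ∎

  coeff-substP-linearForm₂ : ∀ {n} α β (T : Fin 2 → Poly F n) e →
    coeff F (substP F (linearForm₂ α β) T) e ≈ α * coeff F (T Fin.zero) e + β * coeff F (T (Fin.suc Fin.zero)) e
  coeff-substP-linearForm₂ α β T e = trans (coeff-substP (linearForm₂ α β) T e)
    (+-cong (*-congˡ (monomial-x¹ T e)) (trans (+-identityʳ _) (*-congˡ (monomial-y¹ T e))))

  coeff-substP-quadraticForm₂ : ∀ {n} A B C (T : Fin 2 → Poly F n) e → let T₀ = T Fin.zero ; T₁ = T (Fin.suc Fin.zero) in
    coeff F (substP F (quadraticForm₂ A B C) T) e ≈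
      A * coeff F (T₀ *ₚ T₀) e + (B * coeff F (T₀ *ₚ T₁) e + C * coeff F (T₁ *ₚ T₁) e)
  coeff-substP-quadraticForm₂ A B C T e = trans (coeff-substP (quadraticForm₂ A B C) T e)
    (+-cong (*-congˡ (monomial-x² T e)) (+-cong (*-congˡ (monomial-xy T e)) (trans (+-identityʳ _) (*-congˡ (monomial-y² T e)))))

  -- After the substitution x ↦ x + t y with αt + β = 0, the linear form
  -- becomes αx and the quadratic form becomes Ax² + B′xy + C′y².  The
  -- pair is then independent by its leading terms unless B′ = C′ = 0,
  -- which is exactly the case of a square multiple.
  module Shear {α : Carrier} (β A B C : Carrier) (α≉0 : ¬ α ≈ 0#) where
    t B′ C′ : Carrier
    t = - (β * inv α α≉0)
    B′ = (A + A) * t + B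
    C′ = (A * t) * t + B * t + C

    shear : Fin 2 → Poly F 2
    shear = pair (linearForm₂ 1# t) ((1# , 0 ∷ 1 ∷ []) ∷ [])

    αt+β≈0 : α * t + β ≈ 0#
    αt+β≈0 = begin
      α * - (β * inv α α≉0) + β      ≈⟨ +-congʳ (-‿distribʳ-* α _) ⟨
      - (α * (β * inv α α≉0)) + β    ≈⟨ +-congʳ (-‿cong (solve 3 (λ a b w → a ⊕ (b ⊕ w) ⊜ b ⊕ (a ⊕ w)) refl α β (inv α α≉0))) ⟩
      - (β * (α * inv α α≉0)) + β    ≈⟨ +-congʳ (-‿cong (trans (*-congˡ (*-inv α α≉0)) (*-identityʳ β))) ⟩
      - β + β                        ≈⟨ -‿inverseˡ β ⟩
      0#                             ∎

    sheared-linear : substP F (linearForm₂ α β) shear ≈ₚ (α , 1 ∷ 0 ∷ []) ∷ []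
    sheared-linear = homogeneous-ext linearMonomial₂ L′ αx (homogeneous 1 L′) (homogeneous 1 αx) agree
      where
      L′ = substP F (linearForm₂ α β) shear
      αx = (α , 1 ∷ 0 ∷ []) ∷ []
      agree : ∀ e → Linear₂ e → coeff F (substP F (linearForm₂ α β) shear) e ≈ coeff F ((α , 1 ∷ 0 ∷ []) ∷ []) e
      agree e x¹ = begin
        coeff F (substP F (linearForm₂ α β) shear) e   ≈⟨ coeff-substP-linearForm₂ α β shear e ⟩
        α * (1# + 0#) + β * 0#                         ≈⟨ +-cong (*-congˡ (+-identityʳ 1#)) (zeroʳ β) ⟩
        α * 1# + 0#                                    ≈⟨ +-congʳ (*-identityʳ α) ⟩
        α + 0#                                         ∎
      agree e y¹ = begin
        coeff F (substP F (linearForm₂ α β) shear) e   ≈⟨ coeff-substP-linearForm₂ α β shear e ⟩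
        α * (t + 0#) + β * (1# + 0#)                   ≈⟨ +-cong (*-congˡ (+-identityʳ t)) (trans (*-congˡ (+-identityʳ 1#)) (*-identityʳ β)) ⟩
        α * t + β                                      ≈⟨ αt+β≈0 ⟩
        0#                                             ∎

    sheared-quadratic : substP F (quadraticForm₂ A B C) shear ≈ₚ quadraticForm₂ A B′ C′
    sheared-quadratic = homogeneous-ext quadraticMonomial₂ R′ R″ (homogeneous 2 R′) (homogeneous 2 R″) agree
      where
      R′ = substP F (quadraticForm₂ A B C) shear
      R″ = quadraticForm₂ A B′ C′
      agree : ∀ e → Quadratic₂ e → coeff F (substP F (quadraticForm₂ A B C) shear) e ≈ coeff F (quadraticForm₂ A B′ C′) e
      agree e x² = begin
        coeff F (substP F (quadraticForm₂ A B C) shear) e   ≈⟨ coeff-substP-quadraticForm₂ A B C shear e ⟩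
        A * (1# * 1# + 0#) + (B * 0# + C * 0#)             ≈⟨ +-cong (trans (*-congˡ (trans (+-identityʳ _) (*-identityˡ 1#))) (*-identityʳ A))
                                                                      (trans (+-cong (zeroʳ B) (zeroʳ C)) (+-identityʳ 0#)) ⟩
        A + 0#                                             ∎
      agree e xy = begin
        coeff F (substP F (quadraticForm₂ A B C) shear) e        ≈⟨ coeff-substP-quadraticForm₂ A B C shear e ⟩
        A * (1# * t + (t * 1# + 0#)) + (B * (1# * 1# + 0#) + C * 0#)
          ≈⟨ +-cong (*-congˡ (+-cong (*-identityˡ t) (trans (+-identityʳ _) (*-identityʳ t))))
                    (trans (+-cong (trans (*-congˡ (trans (+-identityʳ _) (*-identityˡ 1#))) (*-identityʳ B)) (zeroʳ C)) (+-identityʳ B)) ⟩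
        A * (t + t) + B                                          ≈⟨ +-congʳ (trans (distribˡ A t t) (sym (distribʳ t A A))) ⟩
        B′                                                       ≈⟨ +-identityʳ B′ ⟨
        B′ + 0#                                                  ∎
      agree e y² = begin
        coeff F (substP F (quadraticForm₂ A B C) shear) e        ≈⟨ coeff-substP-quadraticForm₂ A B C shear e ⟩
        A * (t * t + 0#) + (B * (t * 1# + 0#) + C * (1# * 1# + 0#))
          ≈⟨ +-cong (trans (*-congˡ (+-identityʳ _)) (sym (*-assoc A t t)))
                    (+-cong (*-congˡ (trans (+-identityʳ _) (*-identityʳ t))) (trans (*-congˡ (trans (+-identityʳ _) (*-identityˡ 1#))) (*-identityʳ C))) ⟩
        A * t * t + (B * t + C)                                  ≈⟨ +-assoc _ _ _ ⟨
        C′                                                       ≈⟨ +-identityʳ C′ ⟨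
        C′ + 0#                                                  ∎

    B′≈0∧C′≈0⇒squareMultiple : B′ ≈ 0# → C′ ≈ 0# → SquareMultiple α β A B C
    B′≈0∧C′≈0⇒squareMultiple B′≈0 C′≈0 = A * (w * w) , A≈ , B≈ , C≈
      where
      w = inv α α≉0
      u = β * w
      αw≈1 : α * w ≈ 1#
      αw≈1 = *-inv α α≉0
      B≈[A+A]u : B ≈ (A + A) * u
      B≈[A+A]u = begin
        B                      ≈⟨ inverseʳ-unique _ B B′≈0 ⟩
        - ((A + A) * - u)      ≈⟨ -‿cong (-‿distribʳ-* (A + A) u) ⟨
        - - ((A + A) * u)      ≈⟨ -‿involutive _ ⟩
        (A + A) * u            ∎
      A≈ : A ≈ (A * (w * w)) * (α * α)
      A≈ = sym (begin
        (A * (w * w)) * (α * α)     ≈⟨ solve 3 (λ A w a → (A ⊕ (w ⊕ w)) ⊕ (a ⊕ a) ⊜ A ⊕ ((a ⊕ w) ⊕ (a ⊕ w))) refl A w α ⟩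
        A * ((α * w) * (α * w))     ≈⟨ *-congˡ (trans (*-cong αw≈1 αw≈1) (*-identityˡ 1#)) ⟩
        A * 1#                      ≈⟨ *-identityʳ A ⟩
        A                           ∎)
      B≈ : B ≈ 2# * ((A * (w * w)) * (α * β))
      B≈ = begin
        B                                    ≈⟨ B≈[A+A]u ⟩
        (A + A) * u                          ≈⟨ *-congʳ (x+x≈2#*x A) ⟩
        (2# * A) * u                         ≈⟨ *-identityʳ _ ⟨
        ((2# * A) * u) * 1#                  ≈⟨ *-congˡ αw≈1 ⟨
        ((2# * A) * u) * (α * w)             ≈⟨ solve 5 (λ t A b w a → ((t ⊕ A) ⊕ (b ⊕ w)) ⊕ (a ⊕ w) ⊜ t ⊕ ((A ⊕ (w ⊕ w)) ⊕ (a ⊕ b))) refl 2# A β w α ⟩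
        2# * ((A * (w * w)) * (α * β))       ∎
      C≈ : C ≈ (A * (w * w)) * (β * β)
      C≈ = begin
        C                                          ≈⟨ inverseʳ-unique _ C C′≈0 ⟩
        - ((A * t) * t + B * t)                    ≈⟨ -‿cong (+-cong At²≈Auu (trans (*-congʳ B≈[A+A]u) Bt≈-2Auu)) ⟩
        - (A * (u * u) + - (A * (u * u) + A * (u * u)))  ≈⟨ -‿cong (x+-[x+x]≈-x (A * (u * u))) ⟩
        - - (A * (u * u))                          ≈⟨ -‿involutive _ ⟩
        A * (u * u)                                ≈⟨ solve 3 (λ A b w → A ⊕ ((b ⊕ w) ⊕ (b ⊕ w)) ⊜ (A ⊕ (w ⊕ w)) ⊕ (b ⊕ b)) refl A β w ⟩
        (A * (w * w)) * (β * β)                    ∎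
        where
        -u*-u : - u * - u ≈ u * u
        -u*-u = trans (sym (-‿distribʳ-* (- u) u)) (trans (-‿cong (sym (-‿distribˡ-* u u))) (-‿involutive _))
        At²≈Auu : (A * t) * t ≈ A * (u * u)
        At²≈Auu = trans (*-assoc A t t) (*-congˡ -u*-u)
        Bt≈-2Auu : ((A + A) * u) * t ≈ - (A * (u * u) + A * (u * u))
        Bt≈-2Auu = begin
          ((A + A) * u) * - u              ≈⟨ -‿distribʳ-* _ u ⟨
          - (((A + A) * u) * u)            ≈⟨ -‿cong (trans (*-assoc (A + A) u u) (distribʳ (u * u) A A)) ⟩
          - (A * (u * u) + A * (u * u))    ∎
        x+-[x+x]≈-x : ∀ x → x + - (x + x) ≈ - x
        x+-[x+x]≈-x x = begin
          x + - (x + x)      ≈⟨ +-congˡ (⁻¹-∙-comm x x) ⟨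
          x + (- x + - x)    ≈⟨ +-assoc x _ _ ⟨
          (x - x) + - x      ≈⟨ +-congʳ (-‿inverseʳ x) ⟩
          0# + - x           ≈⟨ +-identityˡ _ ⟩
          - x                ∎

    private
      L R αx R′ : Poly F 2
      L = linearForm₂ α β
      R = quadraticForm₂ A B C
      αx = (α , 1 ∷ 0 ∷ []) ∷ []
      R′ = quadraticForm₂ A B′ C′

      αx-bounded : YBounded 1 0 αx
      αx-bounded e outside with (1 ∷ 0 ∷ []) ≟ₑ e
      αx-bounded e (inj₁ sum≢1) | yes ≡.refl = ⊥-elim (sum≢1 ≡.refl)
      αx-bounded e (inj₂ ())    | yes ≡.refl
      ... | no _ = refl

      R′-bounded : YBounded 2 2 R′
      R′-bounded e (inj₁ sum≢2) = homogeneous 2 R′ e sum≢2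
      R′-bounded (i ∷ j ∷ []) (inj₂ 2<j) = homogeneous 2 R′ (i ∷ j ∷ []) λ i+j+0≡2 →
        ℕ.<-irrefl ≡.refl (ℕ.<-≤-trans 2<j (ℕ.≤-trans (ℕ.m≤m+n j 0) (ℕ.≤-trans (ℕ.m≤n+m (j ℕ.+ 0) i) (ℕ.≤-reflexive i+j+0≡2))))

      R′-bounded-when-C′≈0 : C′ ≈ 0# → YBounded 2 1 R′
      R′-bounded-when-C′≈0 C′≈0 e (inj₁ sum≢2) = homogeneous 2 R′ e sum≢2
      R′-bounded-when-C′≈0 C′≈0 e (inj₂ 1<yDeg) with Vec.sum e ℕ.≟ 2
      ... | no sum≢2 = homogeneous 2 R′ e sum≢2
      ... | yes sum≡2 with quadraticMonomial₂ e sum≡2 | 1<yDeg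
      ...   | y² | _ = trans (+-identityʳ C′) C′≈0
      ...   | x² | ()
      ...   | xy | ℕ.s≤s ()

      sheared-independent : ∀ m → 1 ℕ.≤ m → m ℕ.≤ 2 → YBounded 2 m R′ → ¬ coeff F R′ (2 ℕ.∸ m ∷ m ∷ []) ≈ 0# →
                            AlgebraicallyIndependent F (pair L R)
      sheared-independent m 1≤m m≤2 R′-bounded R′-lead =
        independent-substP shear (pair L R)
          (independent-cong (pair αx R′) (λ i → substP F (pair L R i) shear) sheared
            (leadingTerms⇒independent (pair αx R′) ℕ.≤-refl 1≤m m≤2 αx-bounded αx-lead R′-bounded R′-lead))
        where
        αx-lead : ¬ α + 0# ≈ 0#
        αx-lead α+0≈0 = α≉0 (trans (sym (+-identityʳ α)) α+0≈0)
        sheared : ∀ i → pair αx R′ i ≈ₚ substP F (pair L R i) shear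
        sheared Fin.zero e = sym (sheared-linear e)
        sheared (Fin.suc Fin.zero) e = sym (sheared-quadratic e)

    independent⊎squareMultiple : Decidable _≈_ →
      AlgebraicallyIndependent F (pair (linearForm₂ α β) (quadraticForm₂ A B C)) ⊎ SquareMultiple α β A B C
    independent⊎squareMultiple _≟_ with C′ ≟ 0# | B′ ≟ 0#
    ... | no C′≉0 | _ = inj₁ (sheared-independent 2 (ℕ.s≤s ℕ.z≤n) ℕ.≤-refl R′-bounded
                                λ C′+0≈0 → C′≉0 (trans (sym (+-identityʳ C′)) C′+0≈0))
    ... | yes C′≈0 | no B′≉0 = inj₁ (sheared-independent 1 ℕ.≤-refl (ℕ.s≤s ℕ.z≤n) (R′-bounded-when-C′≈0 C′≈0)
                                       λ B′+0≈0 → B′≉0 (trans (sym (+-identityʳ B′)) B′+0≈0))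
    ... | yes C′≈0 | yes B′≈0 = inj₂ (B′≈0∧C′≈0⇒squareMultiple B′≈0 C′≈0)

module TernaryForms {c ℓ : Level} (F : Field c ℓ) where

  open Exponents
  open Polynomials F
  open Variables F
  open BinaryForms F
  open FieldProperties F using (2#; inv; *-inv; *-nonzero; *-solveˡ)
  open SmallMonomials
  open import Data.Empty using (⊥-elim)
  open import Data.Fin as Fin using (Fin; toℕ)
  open import Data.Fin.Permutation using (_⟨$⟩ˡ_)
  open import Data.List as List using ([]; _∷_; _++_)
  open import Data.Nat as ℕ using (ℕ; suc; _∸_)
  open import Data.Nat.Properties as ℕ using ()
  open import Data.Product using (Σ; _×_; _,_; proj₁)
  open import Data.Sum using (_⊎_; inj₁; inj₂)
  open import Data.Vec as Vec using ([]; _∷_; _∷ʳ_; lookup)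
  open import Relation.Binary using (Decidable)
  open import Relation.Nullary using (¬_; yes; no)
  open import Relation.Binary.PropositionalEquality as ≡ using (_≡_; _≢_)

  open Field F
  open import Algebra.Solver.CommutativeMonoid *-commutativeMonoid using (solve; _⊜_; _⊕_)
  open import Relation.Binary.Reasoning.Setoid setoid

  [x²] [y²] [z²] [yz] [xz] [xy] : Poly F 3 → Carrier
  [x²] Q = coeff F Q (2 ∷ 0 ∷ 0 ∷ [])
  [y²] Q = coeff F Q (0 ∷ 2 ∷ 0 ∷ [])
  [z²] Q = coeff F Q (0 ∷ 0 ∷ 2 ∷ [])
  [yz] Q = coeff F Q (0 ∷ 1 ∷ 1 ∷ [])
  [xz] Q = coeff F Q (1 ∷ 0 ∷ 1 ∷ [])
  [xy] Q = coeff F Q (1 ∷ 1 ∷ 0 ∷ [])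

  -- Q = [z²] z² + L z + R with L and R forms in x and y.
  pivotPair : Poly F 3 → Fin 2 → Poly F 2
  pivotPair Q = pair (linearForm₂ ([xz] Q) ([yz] Q)) (quadraticForm₂ ([x²] Q) ([xy] Q) ([y²] Q))

  -- The right-hand side in the definition of Nice, for degree 2.
  zExpansion : Carrier → (Fin 2 → Poly F 2) → Poly F 3
  zExpansion a Ps = constP F a *ₚ lastVar^ F 2 +ₚ sumP F (List.tabulate (λ k → liftP F (Ps k) *ₚ lastVar^ F (2 ∸ suc (toℕ k))))

  Degenerate : Carrier → Carrier → Carrier → Carrier → Carrier → Set (c Level.⊔ ℓ)
  Degenerate α β A B C = (α ≈ 0# × β ≈ 0#) ⊎ SquareMultiple α β A B C

  degenerate-cong : ∀ {α β A B C α′ β′ A′ B′ C′} → α ≈ α′ → β ≈ β′ → A ≈ A′ → B ≈ B′ → C ≈ C′ →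
                    Degenerate α β A B C → Degenerate α′ β′ A′ B′ C′
  degenerate-cong α≈ β≈ _ _ _ (inj₁ (α≈0 , β≈0)) = inj₁ (trans (sym α≈) α≈0 , trans (sym β≈) β≈0)
  degenerate-cong α≈ β≈ A≈ B≈ C≈ (inj₂ square) = inj₂ (squareMultiple-cong α≈ β≈ A≈ B≈ C≈ square)

  DegenerateAtZ : Poly F 3 → Set (c Level.⊔ ℓ)
  DegenerateAtZ Q = Degenerate ([xz] Q) ([yz] Q) ([x²] Q) ([xy] Q) ([y²] Q)

  linearForm₂-IsZero : ∀ {α β} → α ≈ 0# → β ≈ 0# → IsZero F (linearForm₂ α β)
  linearForm₂-IsZero {α} {β} α≈0 β≈0 =
    homogeneous-ext linearMonomial₂ (linearForm₂ α β) [] (homogeneous 1 (linearForm₂ α β)) (λ _ _ → refl) agree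
    where
    agree : ∀ e → Linear₂ e → coeff F (linearForm₂ α β) e ≈ 0#
    agree _ x¹ = trans (+-identityʳ α) α≈0
    agree _ y¹ = trans (+-identityʳ β) β≈0

  independent⇒nondegenerate : ∀ Q → AlgebraicallyIndependent F (pivotPair Q) → ¬ DegenerateAtZ Q
  independent⇒nondegenerate Q independent (inj₁ (xz≈0 , yz≈0)) =
    independent⇒nonzero (pivotPair Q) independent (linearForm₂-IsZero xz≈0 yz≈0)
  independent⇒nondegenerate Q independent (inj₂ square) =
    independent⇒notSquareMultiple (pivotPair Q) independent (proj₁ square) (squareMultiple⇒≈ₚ square)

  decomposition : ∀ Q → IsQuadraticForm F Q → Q ≈ₚ zExpansion ([z²] Q) (pivotPair Q)
  decomposition Q quadratic = homogeneous-ext quadraticMonomial₃ Q RHS quadratic (homogeneous 2 RHS) agree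
    where
    RHS = zExpansion ([z²] Q) (pivotPair Q)
    x≈x·1+0 : ∀ {x} → x ≈ x * 1# + 0#
    x≈x·1+0 = sym (trans (+-identityʳ _) (*-identityʳ _))
    agree : ∀ e → Quadratic₃ e → coeff F Q e ≈ coeff F RHS e
    agree _ x² = x≈x·1+0
    agree _ y² = x≈x·1+0
    agree _ z² = x≈x·1+0
    agree _ yz = x≈x·1+0
    agree _ xz = x≈x·1+0
    agree _ xy = x≈x·1+0

  module _ (a : Carrier) (Ps : Fin 2 → Poly F 2) (e : Exponent 2) (k : ℕ) where
    private
      P₀ = Ps Fin.zero
      P₁ = Ps (Fin.suc Fin.zero)

    coeff-zExpansion : coeff F (zExpansion a Ps) (e ∷ʳ k) ≈
      a * coeff F (lastVar^ F 2) (e ∷ʳ k) + (coeff F (liftP F P₀ *ₚ lastVar^ F 1) (e ∷ʳ k) + coeff F (liftP F P₁ *ₚ lastVar^ F 0) (e ∷ʳ k))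
    coeff-zExpansion = trans (coeff-+ₚ (constP F a *ₚ lastVar^ F 2) (X₁ ++ (X₀ ++ [])) (e ∷ʳ k))
      (+-cong (coeff-constP-*ₚ a (lastVar^ F 2) (e ∷ʳ k))
              (trans (coeff-+ₚ X₁ (X₀ ++ []) (e ∷ʳ k)) (+-congˡ (trans (coeff-+ₚ X₀ [] (e ∷ʳ k)) (+-identityʳ _)))))
      where
      X₁ = liftP F P₀ *ₚ lastVar^ F 1
      X₀ = liftP F P₁ *ₚ lastVar^ F 0

  zExpansion-linear : ∀ a Ps e → coeff F (zExpansion a Ps) (e ∷ʳ 1) ≈ coeff F (Ps Fin.zero) e
  zExpansion-linear a Ps e = begin
    coeff F (zExpansion a Ps) (e ∷ʳ 1)                 ≈⟨ coeff-zExpansion a Ps e 1 ⟩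
    a * coeff F (lastVar^ F 2) (e ∷ʳ 1) + (_ + _)
      ≈⟨ +-cong (trans (*-congˡ (coeff-lastVar^ 2 e 1 (λ ()))) (zeroʳ a))
                (+-cong (coeff-liftP-*ₚ-lastVar^ (Ps Fin.zero) 1 e) (coeff-liftP-*ₚ-lastVar^-≢ (Ps (Fin.suc Fin.zero)) 0 e 1 (λ ()))) ⟩
    0# + (coeff F (Ps Fin.zero) e + 0#)                ≈⟨ trans (+-identityˡ _) (+-identityʳ _) ⟩
    coeff F (Ps Fin.zero) e                            ∎

  zExpansion-constant : ∀ a Ps e → coeff F (zExpansion a Ps) (e ∷ʳ 0) ≈ coeff F (Ps (Fin.suc Fin.zero)) e
  zExpansion-constant a Ps e = begin
    coeff F (zExpansion a Ps) (e ∷ʳ 0)                 ≈⟨ coeff-zExpansion a Ps e 0 ⟩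
    a * coeff F (lastVar^ F 2) (e ∷ʳ 0) + (_ + _)
      ≈⟨ +-cong (trans (*-congˡ (coeff-lastVar^ 2 e 0 (λ ()))) (zeroʳ a))
                (+-cong (coeff-liftP-*ₚ-lastVar^-≢ (Ps Fin.zero) 1 e 0 (λ ())) (coeff-liftP-*ₚ-lastVar^ (Ps (Fin.suc Fin.zero)) 0 e)) ⟩
    0# + (0# + coeff F (Ps (Fin.suc Fin.zero)) e)      ≈⟨ trans (+-identityˡ _) (+-identityˡ _) ⟩
    coeff F (Ps (Fin.suc Fin.zero)) e                  ∎

  decomposition-unique : ∀ Q a Ps → IsQuadraticForm F Q → Q ≈ₚ zExpansion a Ps → ∀ i → Ps i ≈ₚ pivotPair Q i
  decomposition-unique Q a Ps quadratic Q≈ Fin.zero =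
    homogeneous-ext linearMonomial₂ (Ps Fin.zero) (pivotPair Q Fin.zero) P₀-homogeneous (homogeneous 1 (pivotPair Q Fin.zero)) agree
    where
    slice : ∀ e → coeff F (Ps Fin.zero) e ≈ coeff F Q (e ∷ʳ 1)
    slice e = sym (trans (Q≈ (e ∷ʳ 1)) (zExpansion-linear a Ps e))
    P₀-homogeneous : Homogeneous 1 (Ps Fin.zero)
    P₀-homogeneous e sum≢1 = trans (slice e) (quadratic (e ∷ʳ 1) λ sum≡2 →
      sum≢1 (ℕ.+-cancelʳ-≡ 1 (Vec.sum e) 1 (≡.trans (≡.sym (sum-∷ʳ e 1)) sum≡2)))
    agree : ∀ e → Linear₂ e → coeff F (Ps Fin.zero) e ≈ coeff F (pivotPair Q Fin.zero) e
    agree e x¹ = trans (slice e) (sym (+-identityʳ _))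
    agree e y¹ = trans (slice e) (sym (+-identityʳ _))
  decomposition-unique Q a Ps quadratic Q≈ (Fin.suc Fin.zero) =
    homogeneous-ext quadraticMonomial₂ (Ps (Fin.suc Fin.zero)) (pivotPair Q (Fin.suc Fin.zero)) P₁-homogeneous (homogeneous 2 (pivotPair Q (Fin.suc Fin.zero))) agree
    where
    slice : ∀ e → coeff F (Ps (Fin.suc Fin.zero)) e ≈ coeff F Q (e ∷ʳ 0)
    slice e = sym (trans (Q≈ (e ∷ʳ 0)) (zExpansion-constant a Ps e))
    P₁-homogeneous : Homogeneous 2 (Ps (Fin.suc Fin.zero))
    P₁-homogeneous e sum≢2 = trans (slice e) (quadratic (e ∷ʳ 0) λ sum≡2 →
      sum≢2 (≡.trans (≡.sym (ℕ.+-identityʳ (Vec.sum e))) (≡.trans (≡.sym (sum-∷ʳ e 0)) sum≡2)))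
    agree : ∀ e → Quadratic₂ e → coeff F (Ps (Fin.suc Fin.zero)) e ≈ coeff F (pivotPair Q (Fin.suc Fin.zero)) e
    agree e x² = trans (slice e) (sym (+-identityʳ _))
    agree e xy = trans (slice e) (sym (+-identityʳ _))
    agree e y² = trans (slice e) (sym (+-identityʳ _))

  pivotPair-degrees : ∀ Q (k : Fin 2) → DegreeAtMost F (pivotPair Q k) (suc (toℕ k))
  pivotPair-degrees Q Fin.zero e 1<sum = homogeneous 1 (pivotPair Q Fin.zero) e (λ sum≡1 → ℕ.<-irrefl (≡.sym sum≡1) 1<sum)
  pivotPair-degrees Q (Fin.suc Fin.zero) e 2<sum = homogeneous 2 (pivotPair Q (Fin.suc Fin.zero)) e (λ sum≡2 → ℕ.<-irrefl (≡.sym sum≡2) 2<sum)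

  -- The 2×2 minors of the symmetric matrix of 2Q vanish.
  record RankOne (Q : Poly F 3) : Set ℓ where
    field
      principal-xy : [xy] Q * [xy] Q ≈ (2# * 2#) * ([x²] Q * [y²] Q)
      principal-xz : [xz] Q * [xz] Q ≈ (2# * 2#) * ([x²] Q * [z²] Q)
      principal-yz : [yz] Q * [yz] Q ≈ (2# * 2#) * ([z²] Q * [y²] Q)
      mixed-x : 2# * ([x²] Q * [yz] Q) ≈ [xy] Q * [xz] Q
      mixed-y : 2# * ([y²] Q * [xz] Q) ≈ [yz] Q * [xy] Q
      mixed-z : 2# * ([z²] Q * [xy] Q) ≈ [xz] Q * [yz] Q

  appears : ∀ Q → IsQuadraticForm F Q → AllVariablesAppear F Q → ∀ i →
            Σ (Exponent 3) λ m → Quadratic₃ m × lookup m i ≢ 0 × ¬ coeff F Q m ≈ 0#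
  appears Q quadratic appear i with appear i
  ... | m , m≉0 , mᵢ≢0 with Vec.sum m ℕ.≟ 2
  ...   | yes sum≡2 = m , quadraticMonomial₃ m sum≡2 , mᵢ≢0 , m≉0
  ...   | no sum≢2 = ⊥-elim (m≉0 (quadratic m sum≢2))

  module _ (Q : Poly F 3) (quadratic : IsQuadraticForm F Q) (appear : AllVariablesAppear F Q) where

    x-appears : ¬ ([x²] Q ≈ 0# × [xz] Q ≈ 0# × [xy] Q ≈ 0#)
    x-appears (x²≈0 , xz≈0 , xy≈0) with appears Q quadratic appear Fin.zero
    ... | _ , x² , _ , m≉0 = m≉0 x²≈0
    ... | _ , xz , _ , m≉0 = m≉0 xz≈0
    ... | _ , xy , _ , m≉0 = m≉0 xy≈0
    ... | _ , y² , 0≢0 , _ = 0≢0 ≡.refl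
    ... | _ , z² , 0≢0 , _ = 0≢0 ≡.refl
    ... | _ , yz , 0≢0 , _ = 0≢0 ≡.refl

    y-appears : ¬ ([y²] Q ≈ 0# × [yz] Q ≈ 0# × [xy] Q ≈ 0#)
    y-appears (y²≈0 , yz≈0 , xy≈0) with appears Q quadratic appear (Fin.suc Fin.zero)
    ... | _ , y² , _ , m≉0 = m≉0 y²≈0
    ... | _ , yz , _ , m≉0 = m≉0 yz≈0
    ... | _ , xy , _ , m≉0 = m≉0 xy≈0
    ... | _ , x² , 0≢0 , _ = 0≢0 ≡.refl
    ... | _ , z² , 0≢0 , _ = 0≢0 ≡.refl
    ... | _ , xz , 0≢0 , _ = 0≢0 ≡.refl

    z-appears : ¬ ([z²] Q ≈ 0# × [yz] Q ≈ 0# × [xz] Q ≈ 0#)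
    z-appears (z²≈0 , yz≈0 , xz≈0) with appears Q quadratic appear (Fin.suc (Fin.suc Fin.zero))
    ... | _ , z² , _ , m≉0 = m≉0 z²≈0
    ... | _ , yz , _ , m≉0 = m≉0 yz≈0
    ... | _ , xz , _ , m≉0 = m≉0 xz≈0
    ... | _ , x² , 0≢0 , _ = 0≢0 ≡.refl
    ... | _ , y² , 0≢0 , _ = 0≢0 ≡.refl
    ... | _ , xy , 0≢0 , _ = 0≢0 ≡.refl

  nonDiagonal : ∀ Q → NonDiagonal F Q → ¬ ([yz] Q ≈ 0# × [xz] Q ≈ 0# × [xy] Q ≈ 0#)
  nonDiagonal Q (inj₁ yz≉0) (yz≈0 , _ , _) = yz≉0 yz≈0
  nonDiagonal Q (inj₂ (inj₁ xz≉0)) (_ , xz≈0 , _) = xz≉0 xz≈0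
  nonDiagonal Q (inj₂ (inj₂ xy≉0)) (_ , _ , xy≈0) = xy≉0 xy≈0

  l·0²≈0 : ∀ l {x} → x ≈ 0# → l * (x * x) ≈ 0#
  l·0²≈0 l x≈0 = trans (*-congˡ (trans (*-congʳ x≈0) (zeroˡ _))) (zeroʳ l)

  -- A vanishing L at one pivot makes, together with another pivot, a whole
  -- variable or all mixed terms disappear.
  module _ (Q : Poly F 3) (quadratic : IsQuadraticForm F Q) (nondiagonal : NonDiagonal F Q) (appear : AllVariablesAppear F Q) where
    private
      a = [x²] Q ; b = [y²] Q ; c′ = [z²] Q ; d = [yz] Q ; e = [xz] Q ; f = [xy] Q

    private
      squareAt-z : Degenerate e d a f b → Degenerate e f c′ d b → SquareMultiple e d a f b
      squareAt-z (inj₂ square) _ = square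
      squareAt-z (inj₁ (e≈0 , d≈0)) (inj₁ (_ , f≈0)) = ⊥-elim (nonDiagonal Q nondiagonal (d≈0 , e≈0 , f≈0))
      squareAt-z (inj₁ (e≈0 , d≈0)) (inj₂ (l , c≈lee , _)) =
        ⊥-elim (z-appears Q quadratic appear (trans c≈lee (l·0²≈0 l e≈0) , d≈0 , e≈0))

      squareAt-x : Degenerate e f c′ d b → Degenerate e d a f b → SquareMultiple e f c′ d b
      squareAt-x (inj₂ square) _ = square
      squareAt-x (inj₁ (e≈0 , f≈0)) (inj₁ (_ , d≈0)) = ⊥-elim (nonDiagonal Q nondiagonal (d≈0 , e≈0 , f≈0))
      squareAt-x (inj₁ (e≈0 , f≈0)) (inj₂ (l , a≈lee , _)) =
        ⊥-elim (x-appears Q quadratic appear (trans a≈lee (l·0²≈0 l e≈0) , e≈0 , f≈0))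

      squareAt-y : Degenerate f d a e c′ → Degenerate e d a f b → SquareMultiple f d a e c′
      squareAt-y (inj₂ square) _ = square
      squareAt-y (inj₁ (f≈0 , d≈0)) (inj₁ (e≈0 , _)) = ⊥-elim (nonDiagonal Q nondiagonal (d≈0 , e≈0 , f≈0))
      squareAt-y (inj₁ (f≈0 , d≈0)) (inj₂ (l , _ , _ , b≈ldd)) =
        ⊥-elim (y-appears Q quadratic appear (trans b≈ldd (l·0²≈0 l d≈0) , d≈0 , f≈0))

    degenerate⇒rankOne : Degenerate e d a f b → Degenerate e f c′ d b → Degenerate f d a e c′ → RankOne Q
    degenerate⇒rankOne at-z at-x at-y = record
      { principal-xy = squareMultiple⇒discriminant square-z
      ; principal-xz = squareMultiple⇒discriminant square-y
      ; principal-yz = squareMultiple⇒discriminant square-x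
      ; mixed-x = squareMultiple⇒mixed square-z
      ; mixed-y = squareMultiple⇒mixed (squareMultiple-swap {f} {e} {b} {d} {c′} square-x)
      ; mixed-z = squareMultiple⇒mixed (squareMultiple-swap {d} {f} {c′} {e} {a} square-y)
      }
      where
      square-z = squareAt-z at-z at-x
      square-x = squareAt-x at-x at-z
      square-y = squareAt-y at-y at-z

  module _ (_≟_ : Decidable _≈_) where

    x*x≈0⇒x≈0 : ∀ {x} → x * x ≈ 0# → x ≈ 0#
    x*x≈0⇒x≈0 {x} xx≈0 with x ≟ 0#
    ... | yes x≈0 = x≈0
    ... | no x≉0 = ⊥-elim (*-nonzero x≉0 x≉0 xx≈0)

    nondegenerate⇒NonDiagonal : ∀ Q → ¬ DegenerateAtZ Q → NonDiagonal F Q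
    nondegenerate⇒NonDiagonal Q nondegenerate with [xz] Q ≟ 0# | [yz] Q ≟ 0#
    ... | no xz≉0 | _ = inj₂ (inj₁ xz≉0)
    ... | yes _ | no yz≉0 = inj₁ yz≉0
    ... | yes xz≈0 | yes yz≈0 = ⊥-elim (nondegenerate (inj₁ (xz≈0 , yz≈0)))

    -- A missing variable leaves L and R depending on one common variable,
    -- so R is a multiple of L² (or L = 0).
    nondegenerate⇒AllVariablesAppear : ∀ Q → ¬ DegenerateAtZ Q → AllVariablesAppear F Q
    nondegenerate⇒AllVariablesAppear Q nondegenerate Fin.zero
      with [x²] Q ≟ 0# | [xz] Q ≟ 0# | [xy] Q ≟ 0#
    ... | no x²≉0 | _ | _ = _ , x²≉0 , λ ()
    ... | yes _ | no xz≉0 | _ = _ , xz≉0 , λ ()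
    ... | yes _ | yes _ | no xy≉0 = _ , xy≉0 , λ ()
    ... | yes x²≈0 | yes xz≈0 | yes xy≈0 with [yz] Q ≟ 0#
    ...   | yes yz≈0 = ⊥-elim (nondegenerate (inj₁ (xz≈0 , yz≈0)))
    ...   | no yz≉0 = ⊥-elim (nondegenerate (inj₂ (l , x²≈ , xy≈ , y²≈)))
      where
      yz² = [yz] Q * [yz] Q
      yz²≉0 = *-nonzero yz≉0 yz≉0
      l = [y²] Q * inv yz² yz²≉0
      x²≈ : [x²] Q ≈ l * ([xz] Q * [xz] Q)
      x²≈ = trans x²≈0 (sym (l·0²≈0 l xz≈0))
      xy≈ : [xy] Q ≈ 2# * (l * ([xz] Q * [yz] Q))
      xy≈ = trans xy≈0 (sym (trans (*-congˡ (trans (*-congˡ (trans (*-congʳ xz≈0) (zeroˡ _))) (zeroʳ l))) (zeroʳ 2#)))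
      y²≈ : [y²] Q ≈ l * yz²
      y²≈ = sym (trans (*-assoc _ _ _) (trans (*-congˡ (trans (*-comm _ _) (*-inv yz² yz²≉0))) (*-identityʳ _)))
    nondegenerate⇒AllVariablesAppear Q nondegenerate (Fin.suc Fin.zero)
      with [y²] Q ≟ 0# | [yz] Q ≟ 0# | [xy] Q ≟ 0#
    ... | no y²≉0 | _ | _ = _ , y²≉0 , λ ()
    ... | yes _ | no yz≉0 | _ = _ , yz≉0 , λ ()
    ... | yes _ | yes _ | no xy≉0 = _ , xy≉0 , λ ()
    ... | yes y²≈0 | yes yz≈0 | yes xy≈0 with [xz] Q ≟ 0#
    ...   | yes xz≈0 = ⊥-elim (nondegenerate (inj₁ (xz≈0 , yz≈0)))
    ...   | no xz≉0 = ⊥-elim (nondegenerate (inj₂ (l , x²≈ , xy≈ , y²≈)))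
      where
      xz² = [xz] Q * [xz] Q
      xz²≉0 = *-nonzero xz≉0 xz≉0
      l = [x²] Q * inv xz² xz²≉0
      x²≈ : [x²] Q ≈ l * xz²
      x²≈ = sym (trans (*-assoc _ _ _) (trans (*-congˡ (trans (*-comm _ _) (*-inv xz² xz²≉0))) (*-identityʳ _)))
      xy≈ : [xy] Q ≈ 2# * (l * ([xz] Q * [yz] Q))
      xy≈ = trans xy≈0 (sym (trans (*-congˡ (trans (*-congˡ (trans (*-congˡ yz≈0) (zeroʳ _))) (zeroʳ l))) (zeroʳ 2#)))
      y²≈ : [y²] Q ≈ l * ([yz] Q * [yz] Q)
      y²≈ = trans y²≈0 (sym (l·0²≈0 l yz≈0))
    nondegenerate⇒AllVariablesAppear Q nondegenerate (Fin.suc (Fin.suc Fin.zero))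
      with [z²] Q ≟ 0# | [yz] Q ≟ 0# | [xz] Q ≟ 0#
    ... | no z²≉0 | _ | _ = _ , z²≉0 , λ ()
    ... | yes _ | no yz≉0 | _ = _ , yz≉0 , λ ()
    ... | yes _ | yes _ | no xz≉0 = _ , xz≉0 , λ ()
    ... | yes _ | yes yz≈0 | yes xz≈0 = ⊥-elim (nondegenerate (inj₁ (xz≈0 , yz≈0)))

    -- With [z²] ≉ 0 the minors give R = L² / (4 [z²]).
    rankOne⇒degenerateAtZ : ¬ 2# ≈ 0# → ∀ Q → RankOne Q → DegenerateAtZ Q
    rankOne⇒degenerateAtZ 2≉0 Q rankOne with [z²] Q ≟ 0#
    ... | yes z²≈0 = inj₁ (x*x≈0⇒x≈0 (trans principal-xz (4·x·0≈0 ([x²] Q) z²≈0)) ,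
                           x*x≈0⇒x≈0 (trans principal-yz (trans (*-congˡ (*-comm _ _)) (4·x·0≈0 ([y²] Q) z²≈0))))
      where
      open RankOne rankOne
      4·x·0≈0 : ∀ x {y} → y ≈ 0# → (2# * 2#) * (x * y) ≈ 0#
      4·x·0≈0 x y≈0 = trans (*-congˡ (trans (*-congˡ y≈0) (zeroʳ x))) (zeroʳ _)
    ... | no z²≉0 = inj₂ (l , x²≈ , xy≈ , y²≈)
      where
      open RankOne rankOne
      X = (2# * 2#) * [z²] Q
      X≉0 = *-nonzero (*-nonzero 2≉0 2≉0) z²≉0
      l = inv X X≉0
      x²≈ : [x²] Q ≈ l * ([xz] Q * [xz] Q)
      x²≈ = *-solveˡ X≉0 (trans (solve 3 (λ t z a → ((t ⊕ t) ⊕ z) ⊕ a ⊜ (t ⊕ t) ⊕ (a ⊕ z)) refl 2# ([z²] Q) ([x²] Q))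
                                (sym principal-xz))
      y²≈ : [y²] Q ≈ l * ([yz] Q * [yz] Q)
      y²≈ = *-solveˡ X≉0 (trans (*-assoc _ _ _) (sym principal-yz))
      xy≈ : [xy] Q ≈ 2# * (l * ([xz] Q * [yz] Q))
      xy≈ = trans (*-solveˡ X≉0 (trans (solve 3 (λ t z f → ((t ⊕ t) ⊕ z) ⊕ f ⊜ t ⊕ (t ⊕ (z ⊕ f))) refl 2# ([z²] Q) ([xy] Q))
                                        (*-congˡ mixed-z)))
                  (solve 4 (λ l t e d → l ⊕ (t ⊕ (e ⊕ d)) ⊜ t ⊕ (l ⊕ (e ⊕ d))) refl l 2# ([xz] Q) ([yz] Q))

  quadratic-degree : ∀ Q {d} → IsQuadraticForm F Q → HasDegree F Q d → d ≡ 2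
  quadratic-degree Q quadratic ((m , sum≡d , m≉0) , _) with Vec.sum m ℕ.≟ 2
  ... | yes sum≡2 = ≡.trans (≡.sym sum≡d) sum≡2
  ... | no sum≢2 = ⊥-elim (m≉0 (quadratic m sum≢2))

  NonDiagonal⇒HasDegree : ∀ Q → IsQuadraticForm F Q → NonDiagonal F Q → HasDegree F Q 2
  NonDiagonal⇒HasDegree Q quadratic nondiagonal = witness nondiagonal , λ e 2<sum → quadratic e λ sum≡2 → ℕ.<-irrefl (≡.sym sum≡2) 2<sum
    where
    witness : NonDiagonal F Q → Σ (Exponent 3) λ m → Vec.sum m ≡ 2 × ¬ coeff F Q m ≈ 0#
    witness (inj₁ yz≉0) = _ , ≡.refl , yz≉0
    witness (inj₂ (inj₁ xz≉0)) = _ , ≡.refl , xz≉0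
    witness (inj₂ (inj₂ xy≉0)) = _ , ≡.refl , xy≉0

  squareFree⇒NonDiagonal : ∀ Q m → Vec.sum m ≡ 2 → (∀ i → lookup m i ℕ.≤ 1) → ¬ coeff F Q m ≈ 0# → NonDiagonal F Q
  squareFree⇒NonDiagonal Q m sum≡2 entries≤1 m≉0 with quadraticMonomial₃ m sum≡2
  ... | yz = inj₁ m≉0
  ... | xz = inj₂ (inj₁ m≉0)
  ... | xy = inj₂ (inj₂ m≉0)
  ... | x² = ⊥-elim (ℕ.<-irrefl ≡.refl (entries≤1 Fin.zero))
  ... | y² = ⊥-elim (ℕ.<-irrefl ≡.refl (entries≤1 (Fin.suc Fin.zero)))
  ... | z² = ⊥-elim (ℕ.<-irrefl ≡.refl (entries≤1 (Fin.suc (Fin.suc Fin.zero))))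

  squareFree-rename⇒NonDiagonal : ∀ σ Q m → Vec.sum m ≡ 2 → (∀ i → lookup m i ℕ.≤ 1) →
                                  ¬ coeff F (rename F σ Q) m ≈ 0# → NonDiagonal F Q
  squareFree-rename⇒NonDiagonal σ Q m sum≡2 entries≤1 m≉0 =
    squareFree⇒NonDiagonal Q (unpermuteₑ σ m) (≡.trans (sum-unpermuteₑ σ m) sum≡2)
      (λ i → ≡.subst (ℕ._≤ 1) (≡.sym (lookup-unpermuteₑ σ m i)) (entries≤1 (σ ⟨$⟩ˡ i)))
      (λ ≈0 → m≉0 (trans (coeff-rename σ Q m) ≈0))

  NonDiagonal-rename : ∀ σ Q → NonDiagonal F (rename F σ Q) → NonDiagonal F Q
  NonDiagonal-rename σ Q (inj₁ yz≉0) = squareFree-rename⇒NonDiagonal σ Q _ ≡.refl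
    (λ { Fin.zero → ℕ.z≤n ; (Fin.suc Fin.zero) → ℕ.≤-refl ; (Fin.suc (Fin.suc Fin.zero)) → ℕ.≤-refl }) yz≉0
  NonDiagonal-rename σ Q (inj₂ (inj₁ xz≉0)) = squareFree-rename⇒NonDiagonal σ Q _ ≡.refl
    (λ { Fin.zero → ℕ.≤-refl ; (Fin.suc Fin.zero) → ℕ.z≤n ; (Fin.suc (Fin.suc Fin.zero)) → ℕ.≤-refl }) xz≉0
  NonDiagonal-rename σ Q (inj₂ (inj₂ xy≉0)) = squareFree-rename⇒NonDiagonal σ Q _ ≡.refl
    (λ { Fin.zero → ℕ.≤-refl ; (Fin.suc Fin.zero) → ℕ.≤-refl ; (Fin.suc (Fin.suc Fin.zero)) → ℕ.z≤n }) xy≉0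

module Squares {c ℓ c′ ℓ′ : Level} (F : Field c ℓ) (K : Field c′ ℓ′) (φ : Field.Carrier F → Field.Carrier K)
    (closure : IsAlgebraicClosure F K φ) (_≟_ : Decidable (Field._≈_ F)) (2≉0 : ¬ Field._≈_ F (FieldProperties.2# F) (Field.0# F)) where

  open Exponents
  open SmallMonomials
  open TernaryForms F
  open import Algebra.Morphism.Structures using (module RingMorphisms)
  import Algebra.Solver.CommutativeMonoid as CommutativeMonoidSolver
  open import Data.Empty using (⊥-elim)
  open import Data.Fin as Fin using (Fin)
  open import Data.Fin.Permutation as Perm using (Permutation′; transpose)
  open import Data.List using ([]; _∷_)
  open import Data.Nat using (s≤s; z≤n)
  open import Data.Product using (Σ; _,_; proj₁; proj₂)
  open import Data.Vec using ([]; _∷_)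
  open import Relation.Nullary using (yes; no)
  open import Relation.Nullary.Decidable using (decidable-stable)
  open import Relation.Binary.PropositionalEquality as ≡ using (_≡_)

  private
    module F = Field F
    module K = Field K
    module FF = FieldProperties F
    module FK = FieldProperties K
    module PF = Polynomials F
    module PK = Polynomials K
    module VF = Variables F
    module VK = Variables K
    module φ = RingMorphisms.IsRingHomomorphism (IsAlgebraicClosure.isRingHom closure)
    open CommutativeMonoidSolver K.*-commutativeMonoid using (solve; _⊜_; _⊕_)

  open import Relation.Binary.Reasoning.Setoid K.setoid

  φ-nonzero : ∀ {x} → ¬ x F.≈ F.0# → ¬ φ x K.≈ K.0#
  φ-nonzero {x} x≉0 φx≈0 = FK.1≉0 (begin
    K.1#                       ≈⟨ φ.1#-homo ⟨
    φ F.1#                     ≈⟨ φ.⟦⟧-cong (FF.*-inv x x≉0) ⟨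
    φ (x F.* FF.inv x x≉0)     ≈⟨ φ.*-homo x _ ⟩
    φ x K.* φ (FF.inv x x≉0)   ≈⟨ K.*-congʳ φx≈0 ⟩
    K.0# K.* φ (FF.inv x x≉0)  ≈⟨ K.zeroˡ _ ⟩
    K.0#                       ∎)

  φ-injective : ∀ {x y} → φ x K.≈ φ y → x F.≈ y
  φ-injective {x} {y} φx≈φy with (x F.- y) ≟ F.0#
  ... | yes x-y≈0 = x∙y⁻¹≈ε⇒x≈y x y x-y≈0
    where open import Algebra.Properties.AbelianGroup F.+-abelianGroup using (x∙y⁻¹≈ε⇒x≈y)
  ... | no x-y≉0 = ⊥-elim (φ-nonzero x-y≉0 (begin
    φ (x F.- y)          ≈⟨ φ.+-homo x (F.- y) ⟩
    φ x K.+ φ (F.- y)    ≈⟨ K.+-cong φx≈φy (φ.-‿homo y) ⟩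
    φ y K.- φ y          ≈⟨ K.-‿inverseʳ (φ y) ⟩
    K.0#                 ∎))

  φ-2# : φ FF.2# K.≈ FK.2#
  φ-2# = K.trans (φ.+-homo F.1# F.1#) (K.+-cong φ.1#-homo φ.1#-homo)

  coeff-mapPoly : ∀ {n} (P : Poly F n) e → coeff K (mapPoly F K φ P) e K.≈ φ (coeff F P e)
  coeff-mapPoly [] e = K.sym φ.0#-homo
  coeff-mapPoly ((a , f) ∷ P) e with f ≟ₑ e
  ... | yes _ = K.trans (K.+-congˡ (coeff-mapPoly P e)) (K.sym (φ.+-homo a _))
  ... | no _ = coeff-mapPoly P e

  mapPoly-rename : ∀ {n} (σ : Permutation′ n) (P : Poly F n) → mapPoly F K φ (rename F σ P) ≡ rename K σ (mapPoly F K φ P)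
  mapPoly-rename σ [] = ≡.refl
  mapPoly-rename σ ((a , f) ∷ P) = ≡.cong (_ ∷_) (mapPoly-rename σ P)

  IsSquare-cong : ∀ {n} (P R : Poly K n) → PK._≈ₚ_ P R → IsSquare K P → IsSquare K R
  IsSquare-cong P R P≈R (S , P≈S²) = S , λ e → K.trans (K.sym (P≈R e)) (P≈S² e)

  IsSquare-rename : ∀ {n} (σ : Permutation′ n) (P : Poly K n) → IsSquare K P → IsSquare K (rename K σ P)
  IsSquare-rename σ P (S , P≈S²) = rename K σ S , λ e → begin
    coeff K (rename K σ P) e                       ≈⟨ VK.coeff-rename σ P e ⟩
    coeff K P (unpermuteₑ σ e)                     ≈⟨ P≈S² _ ⟩
    coeff K (S PK.*ₚ S) (unpermuteₑ σ e)           ≈⟨ VK.coeff-rename σ (S PK.*ₚ S) e ⟨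
    coeff K (rename K σ (S PK.*ₚ S)) e             ≈⟨ VK.rename-*ₚ σ S S e ⟩
    coeff K (rename K σ S PK.*ₚ rename K σ S) e      ∎

  square-rename : ∀ {n} (σ : Permutation′ n) (Q : Poly F n) → IsSquare K (mapPoly F K φ Q) → IsSquare K (mapPoly F K φ (rename F σ Q))
  square-rename σ Q square = ≡.subst (IsSquare K) (≡.sym (mapPoly-rename σ Q)) (IsSquare-rename σ (mapPoly F K φ Q) square)

  square-unrename : ∀ {n} (σ : Permutation′ n) (Q : Poly F n) → IsSquare K (mapPoly F K φ (rename F σ Q)) → IsSquare K (mapPoly F K φ Q)
  square-unrename σ Q square =
    IsSquare-cong (mapPoly F K φ (rename F (Perm.flip σ) (rename F σ Q))) (mapPoly F K φ Q) mapped (square-rename (Perm.flip σ) (rename F σ Q) square)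
    where
    mapped : PK._≈ₚ_ (mapPoly F K φ (rename F (Perm.flip σ) (rename F σ Q))) (mapPoly F K φ Q)
    mapped e = K.trans (coeff-mapPoly (rename F (Perm.flip σ) (rename F σ Q)) e) (K.trans (φ.⟦⟧-cong (VF.rename-flip σ Q e)) (K.sym (coeff-mapPoly Q e)))

  squareRoot : ∀ a → Σ K.Carrier λ s → s K.* s K.≈ a
  squareRoot a = s , x∙y⁻¹≈ε⇒x≈y (s K.* s) a (begin
    s K.* s K.- a
      ≈⟨ K.+-cong s·s (K.sym (K.trans (K.+-identityʳ _) (K.trans (K.*-congˡ (K.*-identityˡ K.1#)) (K.*-identityʳ _)))) ⟩
    K.1# K.* ((s K.* (s K.* K.1#)) K.* K.1#) K.+ ((K.- a) K.* (K.1# K.* K.1#) K.+ K.0#)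
      ≈⟨ proj₂ root ⟩
    K.0#
      ∎)
    where
    open import Algebra.Properties.AbelianGroup K.+-abelianGroup using (x∙y⁻¹≈ε⇒x≈y)
    x²-a : Poly K 1
    x²-a = (K.1# , 2 ∷ []) ∷ (K.- a , 0 ∷ []) ∷ []
    nonconstant : ¬ DegreeAtMost K x²-a 0
    nonconstant constant = FK.1≉0 (K.trans (K.sym (K.+-identityʳ K.1#)) (constant (2 ∷ []) (s≤s z≤n)))
    root = IsAlgebraicClosure.algClosed closure x²-a nonconstant
    s = proj₁ root
    s·s : s K.* s K.≈ K.1# K.* ((s K.* (s K.* K.1#)) K.* K.1#)
    s·s = K.sym (K.trans (K.*-identityˡ _) (K.trans (K.*-identityʳ _) (K.*-congˡ (K.*-identityʳ s))))

  φ-2#* : ∀ x y → φ (FF.2# F.* (x F.* y)) K.≈ FK.2# K.* (φ x K.* φ y)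
  φ-2#* x y = K.trans (φ.*-homo FF.2# _) (K.*-cong φ-2# (φ.*-homo x y))

  φ-4#* : ∀ x y → φ ((FF.2# F.* FF.2#) F.* (x F.* y)) K.≈ (FK.2# K.* FK.2#) K.* (φ x K.* φ y)
  φ-4#* x y = K.trans (φ.*-homo _ _) (K.*-cong (K.trans (φ.*-homo FF.2# FF.2#) (K.*-cong φ-2# φ-2#)) (φ.*-homo x y))

  -- If Q = S² over K, then S has no constant term (up to double
  -- negation), so the coefficients of Q are the products of the linear
  -- coefficients x, y, z of S; the minors then vanish identically.
  square⇒rankOne : ∀ Q → IsQuadraticForm F Q → IsSquare K (mapPoly F K φ Q) → RankOne Q
  square⇒rankOne Q quadratic (S , Q≈S²) = record
    { principal-xy = stable λ S₀≈0 → φ-injective (K.trans (φ.*-homo _ _) (K.trans (K.*-cong (φ[xy] S₀≈0) (φ[xy] S₀≈0))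
        (K.trans (solve 3 (λ t x y → (t ⊕ (y ⊕ x)) ⊕ (t ⊕ (y ⊕ x)) ⊜ (t ⊕ t) ⊕ ((x ⊕ x) ⊕ (y ⊕ y))) K.refl FK.2# x y)
                 (K.sym (K.trans (φ-4#* _ _) (K.*-congˡ (K.*-cong (φ[x²] S₀≈0) (φ[y²] S₀≈0))))))))
    ; principal-xz = stable λ S₀≈0 → φ-injective (K.trans (φ.*-homo _ _) (K.trans (K.*-cong (φ[xz] S₀≈0) (φ[xz] S₀≈0))
        (K.trans (solve 3 (λ t x z → (t ⊕ (z ⊕ x)) ⊕ (t ⊕ (z ⊕ x)) ⊜ (t ⊕ t) ⊕ ((x ⊕ x) ⊕ (z ⊕ z))) K.refl FK.2# x z)
                 (K.sym (K.trans (φ-4#* _ _) (K.*-congˡ (K.*-cong (φ[x²] S₀≈0) (φ[z²] S₀≈0))))))))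
    ; principal-yz = stable λ S₀≈0 → φ-injective (K.trans (φ.*-homo _ _) (K.trans (K.*-cong (φ[yz] S₀≈0) (φ[yz] S₀≈0))
        (K.trans (solve 3 (λ t y z → (t ⊕ (z ⊕ y)) ⊕ (t ⊕ (z ⊕ y)) ⊜ (t ⊕ t) ⊕ ((z ⊕ z) ⊕ (y ⊕ y))) K.refl FK.2# y z)
                 (K.sym (K.trans (φ-4#* _ _) (K.*-congˡ (K.*-cong (φ[z²] S₀≈0) (φ[y²] S₀≈0))))))))
    ; mixed-x = stable λ S₀≈0 → φ-injective (K.trans (φ-2#* _ _) (K.trans (K.*-congˡ (K.*-cong (φ[x²] S₀≈0) (φ[yz] S₀≈0)))
        (K.trans (solve 4 (λ t x y z → t ⊕ ((x ⊕ x) ⊕ (t ⊕ (z ⊕ y))) ⊜ (t ⊕ (y ⊕ x)) ⊕ (t ⊕ (z ⊕ x))) K.refl FK.2# x y z)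
                 (K.sym (K.trans (φ.*-homo _ _) (K.*-cong (φ[xy] S₀≈0) (φ[xz] S₀≈0)))))))
    ; mixed-y = stable λ S₀≈0 → φ-injective (K.trans (φ-2#* _ _) (K.trans (K.*-congˡ (K.*-cong (φ[y²] S₀≈0) (φ[xz] S₀≈0)))
        (K.trans (solve 4 (λ t x y z → t ⊕ ((y ⊕ y) ⊕ (t ⊕ (z ⊕ x))) ⊜ (t ⊕ (z ⊕ y)) ⊕ (t ⊕ (y ⊕ x))) K.refl FK.2# x y z)
                 (K.sym (K.trans (φ.*-homo _ _) (K.*-cong (φ[yz] S₀≈0) (φ[xy] S₀≈0)))))))
    ; mixed-z = stable λ S₀≈0 → φ-injective (K.trans (φ-2#* _ _) (K.trans (K.*-congˡ (K.*-cong (φ[z²] S₀≈0) (φ[xy] S₀≈0)))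
        (K.trans (solve 4 (λ t x y z → t ⊕ ((z ⊕ z) ⊕ (t ⊕ (y ⊕ x))) ⊜ (t ⊕ (z ⊕ x)) ⊕ (t ⊕ (z ⊕ y))) K.refl FK.2# x y z)
                 (K.sym (K.trans (φ.*-homo _ _) (K.*-cong (φ[xz] S₀≈0) (φ[yz] S₀≈0)))))))
    }
    where
    S₀ x y z : K.Carrier
    S₀ = coeff K S (0 ∷ 0 ∷ 0 ∷ [])
    x = coeff K S (1 ∷ 0 ∷ 0 ∷ [])
    y = coeff K S (0 ∷ 1 ∷ 0 ∷ [])
    z = coeff K S (0 ∷ 0 ∷ 1 ∷ [])
    φ-coeff : ∀ m → φ (coeff F Q m) K.≈ coeff K (S PK.*ₚ S) m
    φ-coeff m = K.trans (K.sym (coeff-mapPoly Q m)) (Q≈S² m)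
    S₀S₀≈0 : S₀ K.* S₀ K.≈ K.0#
    S₀S₀≈0 = K.trans (K.sym (PK.coeff-square-0ₑ S))
                     (K.trans (K.sym (φ-coeff _)) (K.trans (φ.⟦⟧-cong (quadratic (0 ∷ 0 ∷ 0 ∷ []) (λ ()))) φ.0#-homo))
    stable : ∀ {u v} → (S₀ K.≈ K.0# → u F.≈ v) → u F.≈ v
    stable {u} {v} u≈v = decidable-stable (u ≟ v) λ u≉v → FK.*-nonzero (λ S₀≈0 → u≉v (u≈v S₀≈0)) (λ S₀≈0 → u≉v (u≈v S₀≈0)) S₀S₀≈0
    module _ (S₀≈0 : S₀ K.≈ K.0#) where
      φ[x²] : φ ([x²] Q) K.≈ x K.* x
      φ[x²] = K.trans (φ-coeff _) (PK.coeff-square-diagonal S S₀≈0 (1 ∷ 0 ∷ 0 ∷ []) _ ≡.refl ≡.refl)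
      φ[y²] : φ ([y²] Q) K.≈ y K.* y
      φ[y²] = K.trans (φ-coeff _) (PK.coeff-square-diagonal S S₀≈0 (0 ∷ 1 ∷ 0 ∷ []) _ ≡.refl ≡.refl)
      φ[z²] : φ ([z²] Q) K.≈ z K.* z
      φ[z²] = K.trans (φ-coeff _) (PK.coeff-square-diagonal S S₀≈0 (0 ∷ 0 ∷ 1 ∷ []) _ ≡.refl ≡.refl)
      φ[yz] : φ ([yz] Q) K.≈ FK.2# K.* (z K.* y)
      φ[yz] = K.trans (φ-coeff _) (K.trans (PK.coeff-square-cross S S₀≈0 (0 ∷ 0 ∷ 1 ∷ []) (0 ∷ 1 ∷ 0 ∷ []) _ ≡.refl ≡.refl) (FK.x+x≈2#*x _))
      φ[xz] : φ ([xz] Q) K.≈ FK.2# K.* (z K.* x)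
      φ[xz] = K.trans (φ-coeff _) (K.trans (PK.coeff-square-cross S S₀≈0 (0 ∷ 0 ∷ 1 ∷ []) (1 ∷ 0 ∷ 0 ∷ []) _ ≡.refl ≡.refl) (FK.x+x≈2#*x _))
      φ[xy] : φ ([xy] Q) K.≈ FK.2# K.* (y K.* x)
      φ[xy] = K.trans (φ-coeff _) (K.trans (PK.coeff-square-cross S S₀≈0 (0 ∷ 1 ∷ 0 ∷ []) (1 ∷ 0 ∷ 0 ∷ []) _ ≡.refl ≡.refl) (FK.x+x≈2#*x _))

  -- With s² = [x²] ≉ 0, Q is the square of s x + ([xy] / 2s) y + ([xz] / 2s) z.
  square-at-x : ∀ Q → IsQuadraticForm F Q → ¬ [x²] Q F.≈ F.0# →
    [xy] Q F.* [xy] Q F.≈ (FF.2# F.* FF.2#) F.* ([x²] Q F.* [y²] Q) →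
    [xz] Q F.* [xz] Q F.≈ (FF.2# F.* FF.2#) F.* ([x²] Q F.* [z²] Q) →
    FF.2# F.* ([x²] Q F.* [yz] Q) F.≈ [xy] Q F.* [xz] Q →
    IsSquare K (mapPoly F K φ Q)
  square-at-x Q quadratic a≉0 principal-xy principal-xz mixed-x =
    S , VK.homogeneous-ext quadraticMonomial₃ (mapPoly F K φ Q) (S PK.*ₚ S) mapped-quadratic (VK.homogeneous 2 (S PK.*ₚ S)) agree
    where
    φa φb φc φd φe φf : K.Carrier
    φa = φ ([x²] Q) ; φb = φ ([y²] Q) ; φc = φ ([z²] Q)
    φd = φ ([yz] Q) ; φe = φ ([xz] Q) ; φf = φ ([xy] Q)
    s = proj₁ (squareRoot φa)
    s·s≈φa : s K.* s K.≈ φa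
    s·s≈φa = proj₂ (squareRoot φa)
    2s≉0 : ¬ FK.2# K.* s K.≈ K.0#
    2s≉0 = FK.*-nonzero (λ 2≈0 → φ-nonzero 2≉0 (K.trans φ-2# 2≈0))
                        (λ s≈0 → φ-nonzero a≉0 (K.trans (K.sym s·s≈φa) (K.trans (K.*-congʳ s≈0) (K.zeroˡ s))))
    w = FK.inv (FK.2# K.* s) 2s≉0
    2sw≈1 : (FK.2# K.* s) K.* w K.≈ K.1#
    2sw≈1 = FK.*-inv (FK.2# K.* s) 2s≉0
    S : Poly K 3
    S = (s , 1 ∷ 0 ∷ 0 ∷ []) ∷ (w K.* φf , 0 ∷ 1 ∷ 0 ∷ []) ∷ (w K.* φe , 0 ∷ 0 ∷ 1 ∷ []) ∷ []
    mapped-quadratic : VK.Homogeneous 2 (mapPoly F K φ Q)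
    mapped-quadratic m sum≢2 = K.trans (coeff-mapPoly Q m) (K.trans (φ.⟦⟧-cong (quadratic m sum≢2)) φ.0#-homo)
    cross : ∀ x → s K.* (w K.* x) K.+ ((w K.* x) K.* s K.+ K.0#) K.≈ x
    cross x = begin
      s K.* (w K.* x) K.+ ((w K.* x) K.* s K.+ K.0#)   ≈⟨ K.+-congˡ (K.+-identityʳ _) ⟩
      s K.* (w K.* x) K.+ (w K.* x) K.* s              ≈⟨ K.+-cong (K.sym (K.*-assoc s w x)) (solve 3 (λ s w x → (w ⊕ x) ⊕ s ⊜ (s ⊕ w) ⊕ x) K.refl s w x) ⟩
      (s K.* w) K.* x K.+ (s K.* w) K.* x              ≈⟨ FK.x+x≈2#*x _ ⟩
      FK.2# K.* ((s K.* w) K.* x)                      ≈⟨ solve 4 (λ t s w x → t ⊕ ((s ⊕ w) ⊕ x) ⊜ ((t ⊕ s) ⊕ w) ⊕ x) K.refl FK.2# s w x ⟩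
      ((FK.2# K.* s) K.* w) K.* x                      ≈⟨ K.*-congʳ 2sw≈1 ⟩
      K.1# K.* x                                       ≈⟨ K.*-identityˡ x ⟩
      x                                                  ∎
    cancel : ∀ x → (w K.* w) K.* ((FK.2# K.* FK.2#) K.* (φa K.* x)) K.≈ x
    cancel x = begin
      (w K.* w) K.* ((FK.2# K.* FK.2#) K.* (φa K.* x))          ≈⟨ K.*-congˡ (K.*-congˡ (K.*-congʳ (K.sym s·s≈φa))) ⟩
      (w K.* w) K.* ((FK.2# K.* FK.2#) K.* ((s K.* s) K.* x))   ≈⟨ solve 4 (λ w t s x → (w ⊕ w) ⊕ ((t ⊕ t) ⊕ ((s ⊕ s) ⊕ x)) ⊜ (((t ⊕ s) ⊕ w) ⊕ ((t ⊕ s) ⊕ w)) ⊕ x) K.refl w FK.2# s x ⟩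
      (((FK.2# K.* s) K.* w) K.* ((FK.2# K.* s) K.* w)) K.* x   ≈⟨ K.*-congʳ (K.trans (K.*-cong 2sw≈1 2sw≈1) (K.*-identityˡ K.1#)) ⟩
      K.1# K.* x                                                ≈⟨ K.*-identityˡ x ⟩
      x                                                           ∎
    diagonal : ∀ x y → x K.* x K.≈ (FK.2# K.* FK.2#) K.* (φa K.* y) → (w K.* x) K.* (w K.* x) K.+ K.0# K.≈ y
    diagonal x y x·x≈4ay = begin
      (w K.* x) K.* (w K.* x) K.+ K.0#                   ≈⟨ K.+-identityʳ _ ⟩
      (w K.* x) K.* (w K.* x)                            ≈⟨ solve 2 (λ w x → (w ⊕ x) ⊕ (w ⊕ x) ⊜ (w ⊕ w) ⊕ (x ⊕ x)) K.refl w x ⟩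
      (w K.* w) K.* (x K.* x)                            ≈⟨ K.*-congˡ x·x≈4ay ⟩
      (w K.* w) K.* ((FK.2# K.* FK.2#) K.* (φa K.* y))   ≈⟨ cancel y ⟩
      y                                                    ∎
    φ-principal : ∀ {u v} → u F.* u F.≈ (FF.2# F.* FF.2#) F.* ([x²] Q F.* v) → φ u K.* φ u K.≈ (FK.2# K.* FK.2#) K.* (φa K.* φ v)
    φ-principal u·u≈4av = K.trans (K.sym (φ.*-homo _ _)) (K.trans (φ.⟦⟧-cong u·u≈4av) (φ-4#* _ _))
    mixed : (w K.* φf) K.* (w K.* φe) K.+ ((w K.* φe) K.* (w K.* φf) K.+ K.0#) K.≈ φd
    mixed = begin
      (w K.* φf) K.* (w K.* φe) K.+ ((w K.* φe) K.* (w K.* φf) K.+ K.0#)   ≈⟨ K.+-congˡ (K.trans (K.+-identityʳ _) (K.*-comm _ _)) ⟩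
      (w K.* φf) K.* (w K.* φe) K.+ (w K.* φf) K.* (w K.* φe)              ≈⟨ FK.x+x≈2#*x _ ⟩
      FK.2# K.* ((w K.* φf) K.* (w K.* φe))                                ≈⟨ solve 4 (λ t w f e → t ⊕ ((w ⊕ f) ⊕ (w ⊕ e)) ⊜ (w ⊕ w) ⊕ (t ⊕ (f ⊕ e))) K.refl FK.2# w φf φe ⟩
      (w K.* w) K.* (FK.2# K.* (φf K.* φe))                                ≈⟨ K.*-congˡ (K.*-congˡ (K.sym (φ.*-homo _ _))) ⟩
      (w K.* w) K.* (FK.2# K.* φ ([xy] Q F.* [xz] Q))                      ≈⟨ K.*-congˡ (K.*-congˡ (φ.⟦⟧-cong (F.sym mixed-x))) ⟩
      (w K.* w) K.* (FK.2# K.* φ (FF.2# F.* ([x²] Q F.* [yz] Q)))          ≈⟨ K.*-congˡ (K.*-congˡ (φ-2#* _ _)) ⟩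
      (w K.* w) K.* (FK.2# K.* (FK.2# K.* (φa K.* φd)))                    ≈⟨ K.*-congˡ (K.sym (K.*-assoc _ _ _)) ⟩
      (w K.* w) K.* ((FK.2# K.* FK.2#) K.* (φa K.* φd))                    ≈⟨ cancel φd ⟩
      φd                                                                     ∎
    agree : ∀ m → Quadratic₃ m → coeff K (mapPoly F K φ Q) m K.≈ coeff K (S PK.*ₚ S) m
    agree m x² = K.trans (coeff-mapPoly Q m) (K.sym (K.trans (K.+-identityʳ _) s·s≈φa))
    agree m y² = K.trans (coeff-mapPoly Q m) (K.sym (diagonal φf φb (φ-principal principal-xy)))
    agree m z² = K.trans (coeff-mapPoly Q m) (K.sym (diagonal φe φc (φ-principal principal-xz)))
    agree m yz = K.trans (coeff-mapPoly Q m) (K.sym mixed)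
    agree m xz = K.trans (coeff-mapPoly Q m) (K.sym (cross φe))
    agree m xy = K.trans (coeff-mapPoly Q m) (K.sym (cross φf))

  -- Pivot on a variable whose square has a nonzero coefficient; if there
  -- is none, all mixed terms vanish too.
  rankOne⇒square : ∀ Q → IsQuadraticForm F Q → NonDiagonal F Q → RankOne Q → IsSquare K (mapPoly F K φ Q)
  rankOne⇒square Q quadratic nondiagonal rankOne with [x²] Q ≟ F.0#
  ... | no x²≉0 = square-at-x Q quadratic x²≉0 principal-xy principal-xz mixed-x
    where open RankOne rankOne
  ... | yes x²≈0 with [y²] Q ≟ F.0#
  ...   | no y²≉0 = square-unrename τ Q (square-at-x (rename F τ Q) (VF.Homogeneous-rename τ Q quadratic)
            (λ ≈0 → y²≉0 (F.trans (F.sym (r _)) ≈0))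
            (F.trans (F.*-cong (r _) (r _)) (F.trans principal-xy (F.*-congˡ (F.trans (F.*-comm _ _) (F.*-cong (F.sym (r _)) (F.sym (r _)))))))
            (F.trans (F.*-cong (r _) (r _)) (F.trans principal-yz (F.*-congˡ (F.trans (F.*-comm _ _) (F.*-cong (F.sym (r _)) (F.sym (r _)))))))
            (F.trans (F.*-congˡ (F.*-cong (r _) (r _))) (F.trans mixed-y (F.trans (F.*-comm _ _) (F.*-cong (F.sym (r _)) (F.sym (r _)))))))
    where
    open RankOne rankOne
    τ = transpose Fin.zero (Fin.suc Fin.zero)
    r : ∀ m → coeff F (rename F τ Q) m F.≈ coeff F Q (unpermuteₑ τ m)
    r = VF.coeff-rename τ Q
  ...   | yes y²≈0 with [z²] Q ≟ F.0#
  ...     | no z²≉0 = square-unrename τ Q (square-at-x (rename F τ Q) (VF.Homogeneous-rename τ Q quadratic)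
            (λ ≈0 → z²≉0 (F.trans (F.sym (r _)) ≈0))
            (F.trans (F.*-cong (r _) (r _)) (F.trans principal-yz (F.*-congˡ (F.*-cong (F.sym (r _)) (F.sym (r _))))))
            (F.trans (F.*-cong (r _) (r _)) (F.trans principal-xz (F.*-congˡ (F.trans (F.*-comm _ _) (F.*-cong (F.sym (r _)) (F.sym (r _)))))))
            (F.trans (F.*-congˡ (F.*-cong (r _) (r _))) (F.trans mixed-z (F.trans (F.*-comm _ _) (F.*-cong (F.sym (r _)) (F.sym (r _)))))))
    where
    open RankOne rankOne
    τ = transpose Fin.zero (Fin.suc (Fin.suc Fin.zero))
    r : ∀ m → coeff F (rename F τ Q) m F.≈ coeff F Q (unpermuteₑ τ m)
    r = VF.coeff-rename τ Q
  ...     | yes z²≈0 = ⊥-elim (nonDiagonal Q nondiagonal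
            (x*x≈0⇒x≈0 _≟_ (F.trans principal-yz (4·x·0≈0 ([y²] Q) z²≈0 (F.*-comm _ _))) ,
             x*x≈0⇒x≈0 _≟_ (F.trans principal-xz (4·x·0≈0 ([x²] Q) z²≈0 F.refl)) ,
             x*x≈0⇒x≈0 _≟_ (F.trans principal-xy (4·x·0≈0 ([x²] Q) y²≈0 F.refl))))
    where
    open RankOne rankOne
    4·x·0≈0 : ∀ x {y u} → y F.≈ F.0# → u F.≈ x F.* y → (FF.2# F.* FF.2#) F.* u F.≈ F.0#
    4·x·0≈0 x y≈0 u≈xy = F.trans (F.*-congˡ (F.trans u≈xy (F.trans (F.*-congˡ y≈0) (F.zeroʳ x)))) (F.zeroʳ _)

module Classification {c ℓ c′ ℓ′ : Level} (F : Field c ℓ) (K : Field c′ ℓ′) (φ : Field.Carrier F → Field.Carrier K)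
    (closure : IsAlgebraicClosure F K φ) (_≟_ : Decidable (Field._≈_ F)) (2≉0 : ¬ Field._≈_ F (FieldProperties.2# F) (Field.0# F))
    (Q : Poly F 3) (quadratic : IsQuadraticForm F Q) where

  open Exponents
  open Polynomials F
  open Variables F
  open BinaryForms F
  open TernaryForms F
  open Squares F K φ closure _≟_ 2≉0
  open import Data.Empty using (⊥-elim)
  open import Data.Fin as Fin using (Fin)
  open import Data.Fin.Permutation as Perm using (Permutation′; transpose; _∘ₚ_)
  open import Data.Product using (Σ; _×_; _,_)
  open import Data.Sum using (_⊎_; inj₁; inj₂)
  open import Data.Vec using ([]; _∷_)
  open import Relation.Nullary using (yes; no)
  import Relation.Binary.PropositionalEquality as ≡

  open Field F

  nice⇒nondegenerate : Nice F Q → Σ (Permutation′ 3) λ σ → ¬ DegenerateAtZ (rename F σ Q)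
  nice⇒nondegenerate (d , degree , σ , a , Ps , _ , Q′≈ , independent) with quadratic-degree Q quadratic degree
  ... | ≡.refl = σ , independent⇒nondegenerate Q′
    (independent-cong Ps (pivotPair Q′) (decomposition-unique Q′ a Ps (Homogeneous-rename σ Q quadratic) Q′≈) independent)
    where Q′ = rename F σ Q

  nice⇒conditions : Nice F Q → NonDiagonal F Q × AllVariablesAppear F Q × ¬ IsSquare K (mapPoly F K φ Q)
  nice⇒conditions nice with nice⇒nondegenerate nice
  ... | σ , nondegenerate =
      NonDiagonal-rename σ Q (nondegenerate⇒NonDiagonal _≟_ Q′ nondegenerate)
    , AllVariablesAppear-rename σ Q (nondegenerate⇒AllVariablesAppear _≟_ Q′ nondegenerate)
    , λ square → nondegenerate (rankOne⇒degenerateAtZ _≟_ 2≉0 Q′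
                   (square⇒rankOne Q′ (Homogeneous-rename σ Q quadratic) (square-rename σ Q square)))
    where Q′ = rename F σ Q

  independent⇒nice : ∀ σ → NonDiagonal F Q → AlgebraicallyIndependent F (pivotPair (rename F σ Q)) → Nice F Q
  independent⇒nice σ nondiagonal independent =
    2 , NonDiagonal⇒HasDegree Q quadratic nondiagonal , σ , [z²] Q′ , pivotPair Q′ ,
    pivotPair-degrees Q′ , decomposition Q′ (Homogeneous-rename σ Q quadratic) , independent
    where Q′ = rename F σ Q

  module _ (σ : Permutation′ 3) (nondiagonal : NonDiagonal F Q) where
    private
      swap : Permutation′ 3
      swap = transpose Fin.zero (Fin.suc Fin.zero)
      Q′ Q″ : Poly F 3
      Q′ = rename F σ Q
      Q″ = rename F (swap ∘ₚ σ) Q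
      swapped : ∀ m → coeff F Q″ m ≈ coeff F Q′ (unpermuteₑ swap m)
      swapped m = trans (rename-∘ₚ swap σ Q m) (coeff-rename swap Q′ m)

      pivot-xz : ¬ [xz] Q′ ≈ 0# → Nice F Q ⊎ DegenerateAtZ Q′
      pivot-xz xz≉0 with Shear.independent⊎squareMultiple ([yz] Q′) ([x²] Q′) ([xy] Q′) ([y²] Q′) xz≉0 _≟_
      ... | inj₁ independent = inj₁ (independent⇒nice σ nondiagonal independent)
      ... | inj₂ square = inj₂ (inj₂ square)

      -- exchanging x and y turns [yz] into the pivot coefficient
      pivot-yz : ¬ [yz] Q′ ≈ 0# → Nice F Q ⊎ DegenerateAtZ Q′
      pivot-yz yz≉0 with Shear.independent⊎squareMultiple ([yz] Q″) ([x²] Q″) ([xy] Q″) ([y²] Q″)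
                           (λ ≈0 → yz≉0 (trans (sym (swapped (1 ∷ 0 ∷ 1 ∷ []))) ≈0)) _≟_
      ... | inj₁ independent = inj₁ (independent⇒nice (swap ∘ₚ σ) nondiagonal independent)
      ... | inj₂ square = inj₂ (inj₂ (squareMultiple-swap
              (squareMultiple-cong (swapped (1 ∷ 0 ∷ 1 ∷ [])) (swapped (0 ∷ 1 ∷ 1 ∷ [])) (swapped (2 ∷ 0 ∷ 0 ∷ []))
                                   (swapped (1 ∷ 1 ∷ 0 ∷ [])) (swapped (0 ∷ 2 ∷ 0 ∷ [])) square)))

    nice⊎degenerate : Nice F Q ⊎ DegenerateAtZ (rename F σ Q)
    nice⊎degenerate with [xz] Q′ ≟ 0# | [yz] Q′ ≟ 0#
    ... | no xz≉0 | _ = pivot-xz xz≉0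
    ... | yes _ | no yz≉0 = pivot-yz yz≉0
    ... | yes xz≈0 | yes yz≈0 = inj₂ (inj₁ (xz≈0 , yz≈0))

  degenerateAtZ-rename : ∀ σ → DegenerateAtZ (rename F σ Q) →
    Degenerate (coeff F Q (unpermuteₑ σ (1 ∷ 0 ∷ 1 ∷ []))) (coeff F Q (unpermuteₑ σ (0 ∷ 1 ∷ 1 ∷ [])))
               (coeff F Q (unpermuteₑ σ (2 ∷ 0 ∷ 0 ∷ []))) (coeff F Q (unpermuteₑ σ (1 ∷ 1 ∷ 0 ∷ []))) (coeff F Q (unpermuteₑ σ (0 ∷ 2 ∷ 0 ∷ [])))
  degenerateAtZ-rename σ = degenerate-cong (r _) (r _) (r _) (r _) (r _)
    where
    r : ∀ m → coeff F (rename F σ Q) m ≈ coeff F Q (unpermuteₑ σ m)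
    r = coeff-rename σ Q

  x↔z y↔z : Permutation′ 3
  x↔z = transpose Fin.zero (Fin.suc (Fin.suc Fin.zero))
  y↔z = transpose (Fin.suc Fin.zero) (Fin.suc (Fin.suc Fin.zero))

  conditions⇒nice : NonDiagonal F Q × AllVariablesAppear F Q × ¬ IsSquare K (mapPoly F K φ Q) → Nice F Q
  conditions⇒nice (nondiagonal , appear , nonsquare)
    with nice⊎degenerate Perm.id nondiagonal | nice⊎degenerate x↔z nondiagonal | nice⊎degenerate y↔z nondiagonal
  ... | inj₁ nice | _ | _ = nice
  ... | _ | inj₁ nice | _ = nice
  ... | _ | _ | inj₁ nice = nice
  ... | inj₂ at-z | inj₂ at-x | inj₂ at-y = ⊥-elim (nonsquare (rankOne⇒square Q quadratic nondiagonal
        (degenerate⇒rankOne Q quadratic nondiagonal appear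
          (degenerateAtZ-rename Perm.id at-z) (degenerateAtZ-rename x↔z at-x) (degenerateAtZ-rename y↔z at-y))))

open import Data.Product using (_,_)
open import Function.Bundles using (mk⇔)

lemma3p2 : ∀ {c ℓ c′ ℓ′} (q : ℕ) → OddPrimePower q →
    (F : Field c ℓ) → HasOrder F q →
    (K : Field c′ ℓ′) (φ : Field.Carrier F → Field.Carrier K) → IsAlgebraicClosure F K φ →
    (Q : Poly F 3) → IsQuadraticForm F Q →
    Nice F Q ⇔ (NonDiagonal F Q × AllVariablesAppear F Q × ¬ IsSquare K (mapPoly F K φ Q))
lemma3p2 q (_ , _ , _ , _ , odd) F order K φ closure Q quadratic = mk⇔ nice⇒conditions conditions⇒nice
  where
  open Classification F K φ closure (OddOrder._≟_ F order) (OddOrder.oddOrder⇒2≉0 F order odd) Q quadratic
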